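{- Let $\beta>1$ be a quadratic Pisot unit, i.e. the root $>1$ of $x^2-ax-1$ with $a$ a positive integer, and let $\alpha=-\beta^{ -1}$. Let $x\in\mathbb{Z}[\beta]$ with $x<0$ and let $x'$ be its conjugate (image under $\beta\mapsto\alpha$). Then $x'$ has exactly two eventually periodic $\alpha$-adic expansions, each with left period ${}^{\omega}(a0)$ (i.e. of the form ${}^{\omega}(a0)\,v$ with $v$ a finite word containing the fractional point).
   Context: Here $\mathrm{d}_\beta(1)=a1$. An $\alpha$-adic expansion of a number $z$ is a sequence of digits $(x_i)_{i\ge-k}$ in $\{0,1,\dots,a\}$, written $\cdots x_1x_0\bullet x_{ -1}\cdots x_{ -k}$, with $z=\sum_{i\ge-k}x_i\alpha^i$, which is weakly admissible: every factor $x_jx_{j-1}$ (read left to right) is lexicographically strictly smaller than $a1$. ${}^{\omega}(a0)$ denotes the left-infinite word $\cdots a0a0a0$. Eventually periodic means $x_{i+p}=x_i$ for some $p\ge 1$ and all large $i$. -}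

module Defs where

open import Data.Nat as ℕ using (ℕ; zero; suc)
open import Data.Integer as ℤ using (ℤ; +_; -[1+_]; _+_; _*_; -_; _-_; _<_; _≤_)
open import Data.Product using (Σ; ∃; _×_; _,_)
open import Data.Sum using (_⊎_)
open import Relation.Binary.PropositionalEquality using (_≡_; _≢_)

-- Throughout, a : ℕ is the parameter (assumed ≥ 1 in the theorem),
-- β = (a + √D)/2 > 1 and α = -β⁻¹ = (a - √D)/2 are the two roots of
-- x² - a x - 1, where D = a² + 4 (never a perfect square for a ≥ 1).

D : ℕ → ℤ
D a = + (a ℕ.* a ℕ.+ 4)

-- Exact real comparison  A < q·√D  for integers A, q.
LtSqrtD : ℕ → ℤ → ℤ → Set
LtSqrtD a A q =
  (q ≤ + 0 → (A < + 0) × (q * q * D a < A * A)) ×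
  (+ 0 < q → (A < + 0) ⊎ (A * A < q * q * D a))

-- Elements of ℤ[α] = ℤ[β]:  ⟨ m , n ⟩ stands for the real number m + n·α.
record ℤα : Set where
  constructor ⟨_,_⟩
  field
    re : ℤ
    im : ℤ
open ℤα public

-- The real number m + nα is negative:  2m + na - n√D < 0  ⇔  2m + na < n√D.
Negα : ℕ → ℤα → Set
Negα a ⟨ m , n ⟩ = LtSqrtD a ((+ 2) * m + n * + a) n

-- The real number x = m + nβ is negative:  2m + na + n√D < 0 ⇔ 2m + na < (-n)√D.
Negβ : ℕ → ℤ → ℤ → Set
Negβ a m n = LtSqrtD a ((+ 2) * m + n * + a) (- n)

-- Ring operations in ℤ[α], using α² = aα + 1.
infixl 6 _⊕_
infix 8 ⊖_

_⊕_ : ℤα → ℤα → ℤα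
⟨ m , n ⟩ ⊕ ⟨ p , q ⟩ = ⟨ m + p , n + q ⟩

⊖_ : ℤα → ℤα
⊖ ⟨ m , n ⟩ = ⟨ - m , - n ⟩

mulα : ℕ → ℤα → ℤα → ℤα
mulα a ⟨ m , n ⟩ ⟨ p , q ⟩ = ⟨ m * p + n * q , m * q + n * p + n * q * + a ⟩

fromℤ : ℤ → ℤα
fromℤ k = ⟨ k , + 0 ⟩

αe : ℤα
αe = ⟨ + 0 , + 1 ⟩

-- α⁻¹ = α - a  (since α(α - a) = α² - aα = 1)
αinv : ℕ → ℤα
αinv a = ⟨ - (+ a) , + 1 ⟩

powα : ℕ → ℤα → ℕ → ℤα
powα a x zero = fromℤ (+ 1)
powα a x (suc k) = mulα a x (powα a x k)

αpow : ℕ → ℤ → ℤα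
αpow a (+ n) = powα a αe n
αpow a -[1+ n ] = powα a (αinv a) (suc n)

Digits : Set
Digits = ℤ → ℕ

-- Partial sum  Σ_{j=0}^{M} x_{j-k} α^{j-k}  =  Σ_{i=-k}^{M-k} x_i α^i.
partialSum : ℕ → Digits → ℕ → ℕ → ℤα
partialSum a x k zero = mulα a (fromℤ (+ x (- (+ k)))) (αpow a (- (+ k)))
partialSum a x k (suc M) =
  partialSum a x k M ⊕
  mulα a (fromℤ (+ x (+ suc M - + k))) (αpow a (+ suc M - + k))

-- |w| < 1/(n+1) for the real number w ∈ ℤ[α].
AbsLtInv : ℕ → ℤα → ℕ → Set
AbsLtInv a w n =
  Negα a (mulα a (fromℤ (+ suc n)) w ⊕ fromℤ (- (+ 1))) ×
  Negα a ((⊖ (mulα a (fromℤ (+ suc n)) w)) ⊕ fromℤ (- (+ 1)))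

Represents : ℕ → Digits → ℤα → Set
Represents a x z =
  Σ ℕ λ k →
    (∀ i → i < - (+ k) → x i ≡ 0) ×
    (∀ n → Σ ℕ λ N → ∀ M → N ℕ.≤ M →
       AbsLtInv a (partialSum a x k M ⊕ (⊖ z)) n)

DigitsIn : ℕ → Digits → Set
DigitsIn a x = ∀ i → x i ℕ.≤ a

-- Weak admissibility: every factor x_j x_{j-1} is lexicographically < a1.
WeaklyAdmissible : ℕ → Digits → Set
WeaklyAdmissible a x =
  ∀ j → (x j ℕ.< a) ⊎ ((x j ≡ a) × (x (j - + 1) ℕ.< 1))

IsAlphaExpansion : ℕ → Digits → ℤα → Set
IsAlphaExpansion a x z = Represents a x z × DigitsIn a x × WeaklyAdmissible a x

EventuallyPeriodic : Digits → Set
EventuallyPeriodic x =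
  Σ ℕ λ p → (1 ℕ.≤ p) × Σ ℤ λ N → ∀ i → N ≤ i → x (i + + p) ≡ x i

-- Left period ω(a0): from some index on (towards the left) the digits
-- alternate a,0,a,0,…
LeftPeriodA0 : ℕ → Digits → Set
LeftPeriodA0 a x =
  Σ ℤ λ N → ∀ i → N ≤ i →
    ((x i ≡ a) × (x (i + + 1) ≡ 0)) ⊎ ((x i ≡ 0) × (x (i + + 1) ≡ a))

-- Everything is computed in ℤ[α] = ℤ[β], where conjugation α ↦ β turns α-adic digit sums into β-adic ones;
-- the point x′ to expand has conjugate x < 0.  Signs are decided exactly: x > 0 iff βᵏ x ∈ ℕ[β] ∖ {0} for
-- some k.  For an expansion d of x′ (shifted to start at position 0) the remainders
-- r_T = (αᴷ x′ − Σ_{t<T} d_t αᵗ) α⁻ᵀ must stay in [−1, β] for the series to converge, while their conjugates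
-- (βᴷ x − Σ_{t<T} d_t βᵗ) ρᵀ, ρ = β⁻¹, are negative and, by the admissibility bound Σ_{t<T} d_t βᵗ < βᵀ,
-- eventually exceed −1 − ρ.  The only elements of ℤ[α] in that window are −1 and β, and r = d + α r′ then
-- forces the cycle −1, β, −1, … with digits 0, a, 0, …: the left period ω(a0).  Admissible β-sums determine
-- their digits, so an expansion is fixed by which of −1, β it reaches at one late time; hence there are at
-- most two.  Always choosing the least, resp. the greatest, admissible digit yields two expansions, and they
-- part ways at the step where the least choice first enters the cycle.

module Submission where

open import Defs
open import Data.Nat as ℕ using (ℕ; zero; suc)
import Data.Nat.Properties as ℕP
open import Data.Integer as ℤ using (ℤ; +_; -[1+_]; _+_; _*_; -_; _-_; +<+; -<+; -<-; +≤+; -≤+; -≤-)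
import Data.Integer.Properties as ℤP
import Data.Nat.Tactic.RingSolver as NatSolver
open import Data.Integer.Tactic.RingSolver using (solve-∀)
open import Data.Bool using (Bool; true; false)
open import Data.Unit using (⊤; tt)
open import Data.Product using (Σ; _,_; _×_; proj₁; proj₂)
open import Data.Sum using (_⊎_; inj₁; inj₂; [_,_]′)
open import Data.Empty using (⊥; ⊥-elim)
open import Relation.Nullary using (Dec; yes; no; ¬_)
open import Relation.Nullary.Decidable using (map′; _×-dec_)
open import Relation.Binary.PropositionalEquality
open import Relation.Binary.Definitions using (DecidableEquality; tri<; tri≈; tri>)
open import Algebra.Bundles using (CommutativeRing)
open import Algebra.Structures using (IsCommutativeRing)
open import Algebra.Solver.Ring.AlmostCommutativeRing using (fromCommutativeRing)
import Algebra.Solver.Ring.Simple as SimpleRingSolver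
open import Relation.Binary.Structures using (IsPreorder)
import Relation.Binary.Reasoning.Base.Triple as TripleReasoning

private
  0<*0< : ∀ {x y} → + 0 ℤ.< x → + 0 ℤ.< y → + 0 ℤ.< x * y
  0<*0< {+ suc m} {+ suc n} _ _ = +<+ (ℕ.s≤s ℕ.z≤n)
  0<*0< {+ zero} (+<+ ())
  0<*0< {+ suc m} {+ zero} _ (+<+ ())

  0≤*0≤ : ∀ {x y} → + 0 ℤ.≤ x → + 0 ℤ.≤ y → + 0 ℤ.≤ x * y
  0≤*0≤ {+ m} {+ n} _ _ = subst (+ 0 ℤ.≤_) (ℤP.pos-* m n) (+≤+ ℕ.z≤n)

  0≤x*x : ∀ x → + 0 ℤ.≤ x * x
  0≤x*x (+ m) = subst (+ 0 ℤ.≤_) (ℤP.pos-* m m) (+≤+ ℕ.z≤n)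
  0≤x*x -[1+ m ] = +≤+ ℕ.z≤n

  x<0⇒0<x*x : ∀ {x} → x ℤ.< + 0 → + 0 ℤ.< x * x
  x<0⇒0<x*x { -[1+ m ]} _ = +<+ (ℕ.s≤s ℕ.z≤n)
  x<0⇒0<x*x {+ n} (+<+ ())

  0<+0≤ : ∀ {x y} → + 0 ℤ.< x → + 0 ℤ.≤ y → + 0 ℤ.< x + y
  0<+0≤ {+ suc m} {+ n} _ _ = +<+ (ℕ.s≤s ℕ.z≤n)
  0<+0≤ {+ zero} (+<+ ())

  0≤+0≤ : ∀ {x y} → + 0 ℤ.≤ x → + 0 ℤ.≤ y → + 0 ℤ.≤ x + y
  0≤+0≤ {+ m} {+ n} _ _ = +≤+ ℕ.z≤n

  0<4*⇒0< : ∀ {x} → + 0 ℤ.< + 4 * x → + 0 ℤ.< x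
  0<4*⇒0< {+ suc m} _ = +<+ (ℕ.s≤s ℕ.z≤n)
  0<4*⇒0< {+ zero} (+<+ ())

  <⇒0<- : ∀ {x y} → x ℤ.< y → + 0 ℤ.< y - x
  <⇒0<- {x} {y} x<y = subst (ℤ._< y - x) (ℤP.+-inverseʳ x) (ℤP.+-monoˡ-< (- x) x<y)

  0<-⇒< : ∀ {x y} → + 0 ℤ.< y - x → x ℤ.< y
  0<-⇒< {x} {y} 0<y-x = subst₂ ℤ._<_ (ℤP.+-identityˡ x) (eq x y) (ℤP.+-monoˡ-< x 0<y-x)
    where
    eq : ∀ x y → y - x + x ≡ y
    eq = solve-∀

  -≤0⇒0≤ : ∀ {n} → - n ℤ.≤ + 0 → + 0 ℤ.≤ n
  -≤0⇒0≤ {n} h = subst (+ 0 ℤ.≤_) (ℤP.neg-involutive n) (ℤP.neg-mono-≤ h)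

  0<-⇒<0 : ∀ {n} → + 0 ℤ.< - n → n ℤ.< + 0
  0<-⇒<0 {n} h = subst (ℤ._< + 0) (ℤP.neg-involutive n) (ℤP.neg-mono-< h)

Eventually : (ℕ → Set) → Set
Eventually P = Σ ℕ λ T₀ → ∀ T → T₀ ℕ.≤ T → P T

Eventually-× : ∀ {P Q : ℕ → Set} → Eventually P → Eventually Q → Eventually (λ T → P T × Q T)
Eventually-× (T₀ , p) (T₁ , q) = T₀ ℕ.⊔ T₁ , λ T T₀⊔T₁≤T →
  p T (ℕP.≤-trans (ℕP.m≤m⊔n T₀ T₁) T₀⊔T₁≤T) , q T (ℕP.≤-trans (ℕP.m≤n⊔m T₀ T₁) T₀⊔T₁≤T)

least : ∀ {P : ℕ → Set} → (∀ n → Dec (P n)) → ∀ m → P m → Σ ℕ λ k → P k × k ℕ.≤ m × (∀ j → j ℕ.< k → ¬ P j)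
least P? zero p = 0 , p , ℕ.z≤n , λ _ ()
least {P} P? (suc m) p with P? 0
... | yes p₀ = 0 , p₀ , ℕ.z≤n , λ _ ()
... | no ¬p₀ with least {λ n → P (suc n)} (λ n → P? (suc n)) m p
...   | (k , pk , k≤m , below) = suc k , pk , ℕ.s≤s k≤m , λ { zero _ → ¬p₀ ; (suc j) (ℕ.s≤s j<k) → below j j<k }

greatest : ∀ {P : ℕ → Set} → (∀ n → Dec (P n)) → ∀ m → P 0 →
           Σ ℕ λ k → P k × k ℕ.≤ m × (∀ j → k ℕ.< j → j ℕ.≤ m → ¬ P j)
greatest P? zero p₀ = 0 , p₀ , ℕ.z≤n , λ j 0<j j≤0 → ⊥-elim (ℕP.<⇒≱ 0<j j≤0)
greatest {P} P? (suc m) p₀ with P? (suc m)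
... | yes p = suc m , p , ℕP.≤-refl , λ j 1+m<j j≤1+m → ⊥-elim (ℕP.<⇒≱ 1+m<j j≤1+m)
... | no ¬p with greatest P? m p₀
...   | (k , pk , k≤m , above) = k , pk , ℕP.m≤n⇒m≤1+n k≤m , above′
  where
  above′ : ∀ j → k ℕ.< j → j ℕ.≤ suc m → ¬ P j
  above′ j k<j j≤1+m with ℕP.m≤n⇒m<n∨m≡n j≤1+m
  ... | inj₁ j<1+m = above j k<j (ℕP.≤-pred j<1+m)
  ... | inj₂ refl = ¬p

module Ring (a : ℕ) where

  infixl 7 _·_
  _·_ : ℤα → ℤα → ℤα
  _·_ = mulα a

  𝟘 𝟙 : ℤα
  𝟘 = fromℤ (+ 0)
  𝟙 = fromℤ (+ 1)

  ⊕-assoc : ∀ x y z → (x ⊕ y) ⊕ z ≡ x ⊕ (y ⊕ z)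
  ⊕-assoc ⟨ m , n ⟩ ⟨ p , q ⟩ ⟨ r , s ⟩ = cong₂ ⟨_,_⟩ (ℤP.+-assoc m p r) (ℤP.+-assoc n q s)

  ⊕-comm : ∀ x y → x ⊕ y ≡ y ⊕ x
  ⊕-comm ⟨ m , n ⟩ ⟨ p , q ⟩ = cong₂ ⟨_,_⟩ (ℤP.+-comm m p) (ℤP.+-comm n q)

  ⊕-identityˡ : ∀ x → 𝟘 ⊕ x ≡ x
  ⊕-identityˡ ⟨ m , n ⟩ = cong₂ ⟨_,_⟩ (ℤP.+-identityˡ m) (ℤP.+-identityˡ n)

  ⊕-identityʳ : ∀ x → x ⊕ 𝟘 ≡ x
  ⊕-identityʳ x = trans (⊕-comm x 𝟘) (⊕-identityˡ x)

  ⊖-inverseˡ : ∀ x → ⊖ x ⊕ x ≡ 𝟘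
  ⊖-inverseˡ ⟨ m , n ⟩ = cong₂ ⟨_,_⟩ (ℤP.+-inverseˡ m) (ℤP.+-inverseˡ n)

  ⊖-inverseʳ : ∀ x → x ⊕ ⊖ x ≡ 𝟘
  ⊖-inverseʳ x = trans (⊕-comm x (⊖ x)) (⊖-inverseˡ x)

  ·-assoc : ∀ x y z → (x · y) · z ≡ x · (y · z)
  ·-assoc ⟨ m , n ⟩ ⟨ p , q ⟩ ⟨ r , s ⟩ = cong₂ ⟨_,_⟩ (re-eq (+ a) m n p q r s) (im-eq (+ a) m n p q r s)
    where
    re-eq : ∀ A m n p q r s → (m * p + n * q) * r + (m * q + n * p + n * q * A) * s
                             ≡ m * (p * r + q * s) + n * (p * s + q * r + q * s * A)
    re-eq = solve-∀
    im-eq : ∀ A m n p q r s → (m * p + n * q) * s + (m * q + n * p + n * q * A) * r + (m * q + n * p + n * q * A) * s * A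
                             ≡ m * (p * s + q * r + q * s * A) + n * (p * r + q * s) + n * (p * s + q * r + q * s * A) * A
    im-eq = solve-∀

  ·-comm : ∀ x y → x · y ≡ y · x
  ·-comm ⟨ m , n ⟩ ⟨ p , q ⟩ = cong₂ ⟨_,_⟩ (re-eq m n p q) (im-eq (+ a) m n p q)
    where
    re-eq : ∀ m n p q → m * p + n * q ≡ p * m + q * n
    re-eq = solve-∀
    im-eq : ∀ A m n p q → m * q + n * p + n * q * A ≡ p * n + q * m + q * n * A
    im-eq = solve-∀

  ·-identityˡ : ∀ x → 𝟙 · x ≡ x
  ·-identityˡ ⟨ m , n ⟩ = cong₂ ⟨_,_⟩ (re-eq m n) (im-eq (+ a) m n)
    where
    re-eq : ∀ m n → + 1 * m + + 0 * n ≡ m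
    re-eq = solve-∀
    im-eq : ∀ A m n → + 1 * n + + 0 * m + + 0 * n * A ≡ n
    im-eq = solve-∀

  ·-identityʳ : ∀ x → x · 𝟙 ≡ x
  ·-identityʳ x = trans (·-comm x 𝟙) (·-identityˡ x)

  ·-distribˡ-⊕ : ∀ x y z → x · (y ⊕ z) ≡ x · y ⊕ x · z
  ·-distribˡ-⊕ ⟨ m , n ⟩ ⟨ p , q ⟩ ⟨ r , s ⟩ = cong₂ ⟨_,_⟩ (re-eq m n p q r s) (im-eq (+ a) m n p q r s)
    where
    re-eq : ∀ m n p q r s → m * (p + r) + n * (q + s) ≡ (m * p + n * q) + (m * r + n * s)
    re-eq = solve-∀
    im-eq : ∀ A m n p q r s → m * (q + s) + n * (p + r) + n * (q + s) * A
                             ≡ (m * q + n * p + n * q * A) + (m * s + n * r + n * s * A)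
    im-eq = solve-∀

  ·-distribʳ-⊕ : ∀ x y z → (y ⊕ z) · x ≡ y · x ⊕ z · x
  ·-distribʳ-⊕ x y z = begin
    (y ⊕ z) · x     ≡⟨ ·-comm (y ⊕ z) x ⟩
    x · (y ⊕ z)     ≡⟨ ·-distribˡ-⊕ x y z ⟩
    x · y ⊕ x · z   ≡⟨ cong₂ _⊕_ (·-comm x y) (·-comm x z) ⟩
    y · x ⊕ z · x   ∎
    where open ≡-Reasoning

  infix 4 _≟_
  _≟_ : DecidableEquality ℤα
  ⟨ m , n ⟩ ≟ ⟨ p , q ⟩ =
    map′ (λ (m≡p , n≡q) → cong₂ ⟨_,_⟩ m≡p n≡q) (λ x≡y → cong re x≡y , cong im x≡y)
         (m ℤ.≟ p ×-dec n ℤ.≟ q)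

  isCommutativeRing : IsCommutativeRing _≡_ _⊕_ _·_ ⊖_ 𝟘 𝟙
  isCommutativeRing = record
    { isRing = record
      { +-isAbelianGroup = record
        { isGroup = record
          { isMonoid = record
            { isSemigroup = record
              { isMagma = record { isEquivalence = isEquivalence ; ∙-cong = cong₂ _⊕_ }
              ; assoc = ⊕-assoc }
            ; identity = ⊕-identityˡ , ⊕-identityʳ }
          ; inverse = ⊖-inverseˡ , ⊖-inverseʳ
          ; ⁻¹-cong = cong ⊖_ }
        ; comm = ⊕-comm }
      ; *-cong = cong₂ _·_
      ; *-assoc = ·-assoc
      ; *-identity = ·-identityˡ , ·-identityʳ
      ; distrib = ·-distribˡ-⊕ , ·-distribʳ-⊕ }
    ; *-comm = ·-comm }

  commutativeRing : CommutativeRing _ _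
  commutativeRing = record { isCommutativeRing = isCommutativeRing }

  module ℤα-Solver = SimpleRingSolver (fromCommutativeRing commutativeRing) _≟_

  α β ρ α⁻¹ : ℤα
  α = αe
  β = ⟨ + a , - + 1 ⟩
  ρ = ⊖ α
  α⁻¹ = αinv a

  conj : ℤα → ℤα
  conj ⟨ m , n ⟩ = ⟨ m + n * + a , - n ⟩

  conj-⊕ : ∀ x y → conj (x ⊕ y) ≡ conj x ⊕ conj y
  conj-⊕ ⟨ m , n ⟩ ⟨ p , q ⟩ = cong₂ ⟨_,_⟩ (re-eq (+ a) m n p q) (ℤP.neg-distrib-+ n q)
    where
    re-eq : ∀ A m n p q → m + p + (n + q) * A ≡ (m + n * A) + (p + q * A)
    re-eq = solve-∀

  conj-· : ∀ x y → conj (x · y) ≡ conj x · conj y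
  conj-· ⟨ m , n ⟩ ⟨ p , q ⟩ = cong₂ ⟨_,_⟩ (re-eq (+ a) m n p q) (im-eq (+ a) m n p q)
    where
    re-eq : ∀ A m n p q → (m * p + n * q) + (m * q + n * p + n * q * A) * A
                         ≡ (m + n * A) * (p + q * A) + (- n) * (- q)
    re-eq = solve-∀
    im-eq : ∀ A m n p q → - (m * q + n * p + n * q * A)
                         ≡ (m + n * A) * (- q) + (- n) * (p + q * A) + (- n) * (- q) * A
    im-eq = solve-∀

  conj-⊖ : ∀ x → conj (⊖ x) ≡ ⊖ conj x
  conj-⊖ ⟨ m , n ⟩ = cong₂ ⟨_,_⟩ (re-eq (+ a) m n) refl
    where
    re-eq : ∀ A m n → - m + - n * A ≡ - (m + n * A)
    re-eq = solve-∀

  conj-fromℤ : ∀ k → conj (fromℤ k) ≡ fromℤ k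
  conj-fromℤ k = cong₂ ⟨_,_⟩ (ℤP.+-identityʳ k) refl

  conj-α : conj α ≡ β
  conj-α = cong₂ ⟨_,_⟩ (trans (ℤP.+-identityˡ (+ 1 * + a)) (ℤP.*-identityˡ (+ a))) refl

  conj-α⁻¹ : conj α⁻¹ ≡ ρ
  conj-α⁻¹ = cong₂ ⟨_,_⟩ (trans (cong (_+_ (- + a)) (ℤP.*-identityˡ (+ a))) (ℤP.+-inverseˡ (+ a))) refl

  α·α⁻¹ : α · α⁻¹ ≡ 𝟙
  α·α⁻¹ = cong₂ ⟨_,_⟩ (re-eq (+ a)) (im-eq (+ a))
    where
    re-eq : ∀ A → + 0 * (- A) + + 1 * + 1 ≡ + 1
    re-eq = solve-∀
    im-eq : ∀ A → + 0 * + 1 + + 1 * (- A) + + 1 * + 1 * A ≡ + 0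
    im-eq = solve-∀

  β·ρ : β · ρ ≡ 𝟙
  β·ρ = cong₂ ⟨_,_⟩ (re-eq (+ a)) (im-eq (+ a))
    where
    re-eq : ∀ A → A * + 0 + (- + 1) * (- + 1) ≡ + 1
    re-eq = solve-∀
    im-eq : ∀ A → A * (- + 1) + (- + 1) * + 0 + (- + 1) * (- + 1) * A ≡ + 0
    im-eq = solve-∀

  β≡a⊕ρ : β ≡ fromℤ (+ a) ⊕ ρ
  β≡a⊕ρ = cong₂ ⟨_,_⟩ (sym (ℤP.+-identityʳ (+ a))) refl

  α·β : α · β ≡ ⊖ 𝟙
  α·β = cong₂ ⟨_,_⟩ (re-eq (+ a)) (im-eq (+ a))
    where
    re-eq : ∀ A → + 0 * A + + 1 * (- + 1) ≡ - + 1
    re-eq = solve-∀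
    im-eq : ∀ A → + 0 * (- + 1) + + 1 * A + + 1 * (- + 1) * A ≡ - + 0
    im-eq = solve-∀

  β·β : β · β ≡ fromℤ (+ a) · β ⊕ 𝟙
  β·β = cong₂ ⟨_,_⟩ (re-eq (+ a)) (im-eq (+ a))
    where
    re-eq : ∀ A → A * A + (- + 1) * (- + 1) ≡ A * A + + 0 * (- + 1) + + 1
    re-eq = solve-∀
    im-eq : ∀ A → A * (- + 1) + (- + 1) * A + (- + 1) * (- + 1) * A
                 ≡ A * (- + 1) + + 0 * A + + 0 * (- + 1) * A + + 0
    im-eq = solve-∀

  infixr 8 _^_
  _^_ : ℤα → ℕ → ℤα
  x ^ t = powα a x t

  ^-distribˡ-+-· : ∀ x s t → x ^ (s ℕ.+ t) ≡ x ^ s · x ^ t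
  ^-distribˡ-+-· x zero t = sym (·-identityˡ (x ^ t))
  ^-distribˡ-+-· x (suc s) t = trans (cong (x ·_) (^-distribˡ-+-· x s t)) (sym (·-assoc x (x ^ s) (x ^ t)))

  ^-distribʳ-· : ∀ x y t → (x · y) ^ t ≡ x ^ t · y ^ t
  ^-distribʳ-· x y zero = refl
  ^-distribʳ-· x y (suc t) = trans (cong ((x · y) ·_) (^-distribʳ-· x y t)) (interchange x y (x ^ t) (y ^ t))
    where
    open ℤα-Solver
    interchange : ∀ x y u v → (x · y) · (u · v) ≡ (x · u) · (y · v)
    interchange = solve 4 (λ x y u v → (x :* y) :* (u :* v) := (x :* u) :* (y :* v)) refl

  𝟙^ : ∀ t → 𝟙 ^ t ≡ 𝟙
  𝟙^ zero = refl
  𝟙^ (suc t) = trans (·-identityˡ (𝟙 ^ t)) (𝟙^ t)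

  ^-inverse : ∀ {x y} t → x · y ≡ 𝟙 → x ^ t · y ^ t ≡ 𝟙
  ^-inverse {x} {y} t xy≡𝟙 = trans (sym (^-distribʳ-· x y t)) (trans (cong (_^ t) xy≡𝟙) (𝟙^ t))

  conj-^ : ∀ x t → conj (x ^ t) ≡ conj x ^ t
  conj-^ x zero = conj-fromℤ (+ 1)
  conj-^ x (suc t) = trans (conj-· x (x ^ t)) (cong (conj x ·_) (conj-^ x t))

module Positivity (a : ℕ) (1≤a : 1 ℕ.≤ a) where
  open Ring a
  open ℤα-Solver using (solve; _:=_; _:+_; _:*_; :-_; con)

  -- x = c₀ x + c₁ x · β, since m + nα = (m + na) - nβ.
  c₀ c₁ : ℤα → ℤ
  c₀ ⟨ m , n ⟩ = m + n * + a
  c₁ ⟨ m , n ⟩ = - n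

  c₀-⊕ : ∀ x y → c₀ (x ⊕ y) ≡ c₀ x + c₀ y
  c₀-⊕ ⟨ m , n ⟩ ⟨ p , q ⟩ = eq (+ a) m n p q
    where
    eq : ∀ A m n p q → m + p + (n + q) * A ≡ (m + n * A) + (p + q * A)
    eq = solve-∀

  c₁-⊕ : ∀ x y → c₁ (x ⊕ y) ≡ c₁ x + c₁ y
  c₁-⊕ ⟨ m , n ⟩ ⟨ p , q ⟩ = ℤP.neg-distrib-+ n q

  c₀-· : ∀ x y → c₀ (x · y) ≡ c₀ x * c₀ y + c₁ x * c₁ y
  c₀-· ⟨ m , n ⟩ ⟨ p , q ⟩ = eq (+ a) m n p q
    where
    eq : ∀ A m n p q → m * p + n * q + (m * q + n * p + n * q * A) * A
                      ≡ (m + n * A) * (p + q * A) + (- n) * (- q)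
    eq = solve-∀

  c₁-· : ∀ x y → c₁ (x · y) ≡ c₀ x * c₁ y + c₁ x * c₀ y + + a * c₁ x * c₁ y
  c₁-· ⟨ m , n ⟩ ⟨ p , q ⟩ = eq (+ a) m n p q
    where
    eq : ∀ A m n p q → - (m * q + n * p + n * q * A)
                      ≡ (m + n * A) * (- q) + (- n) * (p + q * A) + A * (- n) * (- q)
    eq = solve-∀

  c₀-⊖ : ∀ x → c₀ (⊖ x) ≡ - c₀ x
  c₀-⊖ ⟨ m , n ⟩ = eq (+ a) m n
    where
    eq : ∀ A m n → - m + - n * A ≡ - (m + n * A)
    eq = solve-∀

  c₁-⊖ : ∀ x → c₁ (⊖ x) ≡ - c₁ x
  c₁-⊖ x = refl

  c₀-β· : ∀ x → c₀ (β · x) ≡ c₁ x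
  c₀-β· ⟨ m , n ⟩ = eq (+ a) m n
    where
    eq : ∀ A m n → A * m + (- + 1) * n + (A * n + (- + 1) * m + (- + 1) * n * A) * A ≡ - n
    eq = solve-∀

  c₁-β· : ∀ x → c₁ (β · x) ≡ c₀ x + + a * c₁ x
  c₁-β· ⟨ m , n ⟩ = eq (+ a) m n
    where
    eq : ∀ A m n → - (A * n + (- + 1) * m + (- + 1) * n * A) ≡ m + n * A + A * (- n)
    eq = solve-∀

  coords-zero : ∀ x → c₀ x ≡ + 0 → c₁ x ≡ + 0 → x ≡ 𝟘
  coords-zero ⟨ m , n ⟩ c₀≡0 c₁≡0 = cong₂ ⟨_,_⟩ m≡0 n≡0
    where
    n≡0 : n ≡ + 0
    n≡0 = trans (sym (ℤP.neg-involutive n)) (cong -_ c₁≡0)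
    m≡0 : m ≡ + 0
    m≡0 = trans (sym (ℤP.+-identityʳ m)) (trans (cong (λ k → m + k * + a) (sym n≡0)) c₀≡0)

  record Nβ⁺ (x : ℤα) : Set where
    constructor nβ⁺
    field
      {p q} : ℕ
      c₀≡ : c₀ x ≡ + p
      c₁≡ : c₁ x ≡ + q
      p+q>0 : 0 ℕ.< p ℕ.+ q

  Nβ⁺-⊕ : ∀ {x y} → Nβ⁺ x → Nβ⁺ y → Nβ⁺ (x ⊕ y)
  Nβ⁺-⊕ {x} {y} (nβ⁺ {p} {q} c₀x c₁x pos) (nβ⁺ {p′} {q′} c₀y c₁y _) =
    nβ⁺ (trans (c₀-⊕ x y) (trans (cong₂ _+_ c₀x c₀y) (sym (ℤP.pos-+ p p′))))
        (trans (c₁-⊕ x y) (trans (cong₂ _+_ c₁x c₁y) (sym (ℤP.pos-+ q q′))))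
        (ℕP.<-≤-trans pos (ℕP.+-mono-≤ (ℕP.m≤m+n p p′) (ℕP.m≤m+n q q′)))

  Nβ⁺-· : ∀ {x y} → Nβ⁺ x → Nβ⁺ y → Nβ⁺ (x · y)
  Nβ⁺-· {x} {y} (nβ⁺ {p} {q} c₀x c₁x pos) (nβ⁺ {p′} {q′} c₀y c₁y pos′) =
    nβ⁺ (trans (c₀-· x y) (trans (cong₂ _+_ (cong₂ _*_ c₀x c₀y) (cong₂ _*_ c₁x c₁y)) c₀-nat))
        (trans (c₁-· x y) (trans (cong₂ _+_ (cong₂ _+_ (cong₂ _*_ c₀x c₁y) (cong₂ _*_ c₁x c₀y))
                                                        (cong₂ (λ u v → + a * u * v) c₁x c₁y)) c₁-nat))
        (subst (0 ℕ.<_) (sym (sum-nat a p q p′ q′)) (ℕP.<-≤-trans (ℕP.*-mono-< pos pos′) (ℕP.m≤m+n _ _)))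
    where
    c₀-nat : + p * + p′ + + q * + q′ ≡ + (p ℕ.* p′ ℕ.+ q ℕ.* q′)
    c₀-nat = sym (trans (ℤP.pos-+ (p ℕ.* p′) (q ℕ.* q′)) (cong₂ _+_ (ℤP.pos-* p p′) (ℤP.pos-* q q′)))
    c₁-nat : + p * + q′ + + q * + p′ + + a * + q * + q′ ≡ + (p ℕ.* q′ ℕ.+ q ℕ.* p′ ℕ.+ a ℕ.* q ℕ.* q′)
    c₁-nat = sym (trans (ℤP.pos-+ (p ℕ.* q′ ℕ.+ q ℕ.* p′) (a ℕ.* q ℕ.* q′))
      (cong₂ _+_ (trans (ℤP.pos-+ (p ℕ.* q′) (q ℕ.* p′)) (cong₂ _+_ (ℤP.pos-* p q′) (ℤP.pos-* q p′)))
                 (trans (ℤP.pos-* (a ℕ.* q) q′) (cong (_* + q′) (ℤP.pos-* a q)))))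
    sum-nat : ∀ a p q p′ q′ → (p ℕ.* p′ ℕ.+ q ℕ.* q′) ℕ.+ (p ℕ.* q′ ℕ.+ q ℕ.* p′ ℕ.+ a ℕ.* q ℕ.* q′)
                            ≡ (p ℕ.+ q) ℕ.* (p′ ℕ.+ q′) ℕ.+ a ℕ.* q ℕ.* q′
    sum-nat = NatSolver.solve-∀

  Nβ⁺-𝟙 : Nβ⁺ 𝟙
  Nβ⁺-𝟙 = nβ⁺ {p = 1} {q = 0} refl refl (ℕ.s≤s ℕ.z≤n)

  Nβ⁺-β : Nβ⁺ β
  Nβ⁺-β = nβ⁺ {p = 0} {q = 1} (eq (+ a)) refl (ℕ.s≤s ℕ.z≤n)
    where
    eq : ∀ A → A + (- + 1) * A ≡ + 0
    eq = solve-∀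

  Nβ⁺-β^ : ∀ k → Nβ⁺ (β ^ k)
  Nβ⁺-β^ zero = Nβ⁺-𝟙
  Nβ⁺-β^ (suc k) = Nβ⁺-· Nβ⁺-β (Nβ⁺-β^ k)

  ¬Nβ⁺𝟘 : ¬ Nβ⁺ 𝟘
  ¬Nβ⁺𝟘 (nβ⁺ {zero} {zero} refl refl ())

  Positive : ℤα → Set
  Positive x = Σ ℕ λ k → Nβ⁺ (β ^ k · x)

  Nβ⁺⇒Positive : ∀ {x} → Nβ⁺ x → Positive x
  Nβ⁺⇒Positive {x} h = 0 , subst Nβ⁺ (sym (·-identityˡ x)) h

  Positive-𝟙 : Positive 𝟙
  Positive-𝟙 = Nβ⁺⇒Positive Nβ⁺-𝟙

  Positive-β : Positive β
  Positive-β = Nβ⁺⇒Positive Nβ⁺-β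

  Positive-⊕ : ∀ {x y} → Positive x → Positive y → Positive (x ⊕ y)
  Positive-⊕ {x} {y} (k , hx) (l , hy) =
    l ℕ.+ k , subst Nβ⁺ (sym eq) (Nβ⁺-⊕ (Nβ⁺-· (Nβ⁺-β^ l) hx) (Nβ⁺-· (Nβ⁺-β^ k) hy))
    where
    regroup : ∀ u v x y → (u · v) · (x ⊕ y) ≡ u · (v · x) ⊕ v · (u · y)
    regroup = solve 4 (λ u v x y → (u :* v) :* (x :+ y) := u :* (v :* x) :+ v :* (u :* y)) refl
    eq : β ^ (l ℕ.+ k) · (x ⊕ y) ≡ β ^ l · (β ^ k · x) ⊕ β ^ k · (β ^ l · y)
    eq = trans (cong (_· (x ⊕ y)) (^-distribˡ-+-· β l k)) (regroup (β ^ l) (β ^ k) x y)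

  Positive-· : ∀ {x y} → Positive x → Positive y → Positive (x · y)
  Positive-· {x} {y} (k , hx) (l , hy) = k ℕ.+ l , subst Nβ⁺ (sym eq) (Nβ⁺-· hx hy)
    where
    regroup : ∀ u v x y → (u · v) · (x · y) ≡ (u · x) · (v · y)
    regroup = solve 4 (λ u v x y → (u :* v) :* (x :* y) := (u :* x) :* (v :* y)) refl
    eq : β ^ (k ℕ.+ l) · (x · y) ≡ (β ^ k · x) · (β ^ l · y)
    eq = trans (cong (_· (x · y)) (^-distribˡ-+-· β k l)) (regroup (β ^ k) (β ^ l) x y)

  ¬Positive𝟘 : ¬ Positive 𝟘
  ¬Positive𝟘 (k , h) = ¬Nβ⁺𝟘 (subst Nβ⁺ (solve 1 (λ u → u :* con 𝟘 := con 𝟘) refl (β ^ k)) h)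

  Positive-asym : ∀ {x} → Positive x → ¬ Positive (⊖ x)
  Positive-asym {x} px p⊖x = ¬Positive𝟘 (subst Positive (⊖-inverseʳ x) (Positive-⊕ px p⊖x))

  Sign : ℤα → Set
  Sign x = Positive x ⊎ x ≡ 𝟘 ⊎ Positive (⊖ x)

  Sign-⊖ : ∀ {x} → Sign (⊖ x) → Sign x
  Sign-⊖ {x} (inj₁ p) = inj₂ (inj₂ p)
  Sign-⊖ {x} (inj₂ (inj₁ e)) = inj₂ (inj₁ (trans (solve 1 (λ x → x := :- (:- x)) refl x) (cong ⊖_ e)))
  Sign-⊖ {x} (inj₂ (inj₂ p)) = inj₁ (subst Positive (solve 1 (λ x → :- (:- x) := x) refl x) p)

  Positive-β·⇒ : ∀ {x} → Positive (β · x) → Positive x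
  Positive-β·⇒ {x} (k , h) = suc k , subst Nβ⁺ (regroup (β ^ k) β x) h
    where
    regroup : ∀ u b x → u · (b · x) ≡ (b · u) · x
    regroup = solve 3 (λ u b x → u :* (b :* x) := (b :* u) :* x) refl

  β·x≡𝟘⇒x≡𝟘 : ∀ {x} → β · x ≡ 𝟘 → x ≡ 𝟘
  β·x≡𝟘⇒x≡𝟘 {x} βx≡𝟘 = begin
    x              ≡⟨ sym (·-identityˡ x) ⟩
    𝟙 · x          ≡⟨ cong (_· x) (trans (sym β·ρ) (·-comm β ρ)) ⟩
    (ρ · β) · x    ≡⟨ ·-assoc ρ β x ⟩
    ρ · (β · x)    ≡⟨ cong (ρ ·_) βx≡𝟘 ⟩
    ρ · 𝟘          ≡⟨ solve 1 (λ u → u :* con 𝟘 := con 𝟘) refl ρ ⟩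
    𝟘              ∎
    where open ≡-Reasoning

  Sign-β· : ∀ {x} → Sign (β · x) → Sign x
  Sign-β· (inj₁ p) = inj₁ (Positive-β·⇒ p)
  Sign-β· (inj₂ (inj₁ e)) = inj₂ (inj₁ (β·x≡𝟘⇒x≡𝟘 e))
  Sign-β· {x} (inj₂ (inj₂ p)) = inj₂ (inj₂ (Positive-β·⇒ (subst Positive (⊖-β· x) p)))
    where
    ⊖-β· : ∀ x → ⊖ (β · x) ≡ β · ⊖ x
    ⊖-β· x = solve 2 (λ b x → :- (b :* x) := b :* (:- x)) refl β x

  private
    negative : ∀ {y} p q → c₀ y ≡ - + p → c₁ y ≡ - + q → 0 ℕ.< p ℕ.+ q → Sign y
    negative {y} p q c₀y c₁y pos = inj₂ (inj₂ (Nβ⁺⇒Positive (nβ⁺ (negate (c₀-⊖ y) c₀y) (negate (c₁-⊖ y) c₁y) pos)))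
      where
      negate : ∀ {k l r} → k ≡ - l → l ≡ - + r → k ≡ + r
      negate {r = r} k≡-l l≡-r = trans k≡-l (trans (cong -_ l≡-r) (ℤP.neg-involutive (+ r)))

    -[1+u]+k≡-[1+u′]⇒u′<u : ∀ u k u′ → 0 ℕ.< k → -[1+ u ] + + k ≡ -[1+ u′ ] → u′ ℕ.< u
    -[1+u]+k≡-[1+u′]⇒u′<u u k u′ 0<k eq = drop (subst (-[1+ u ] ℤ.<_) eq -[1+u]<-[1+u]+k)
      where
      -[1+u]<-[1+u]+k : -[1+ u ] ℤ.< -[1+ u ] + + k
      -[1+u]<-[1+u]+k = subst (ℤ._< -[1+ u ] + + k) (ℤP.+-identityʳ -[1+ u ]) (ℤP.+-monoʳ-< -[1+ u ] (+<+ 0<k))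
      drop : -[1+ u ] ℤ.< -[1+ u′ ] → u′ ℕ.< u
      drop (-<- u′<u) = u′<u

    -- Multiplication by β maps the coordinates (P , Q) to (Q , P + aQ).  From P < 0 < Q,
    -- two such steps either settle the sign or lead back to P′ < 0 < Q′ with P < P′.
    signMixed : ∀ fuel y u v → u ℕ.< fuel → c₀ y ≡ -[1+ u ] → c₁ y ≡ + suc v → Sign y
    signMixed (suc fuel) y u v (ℕ.s≤s u≤fuel) c₀y c₁y = Sign-β· (afterOne (-[1+ u ] + + a * + suc v) refl)
      where
      c₀βy : c₀ (β · y) ≡ + suc v
      c₀βy = trans (c₀-β· y) c₁y
      c₁βy : c₁ (β · y) ≡ -[1+ u ] + + a * + suc v
      c₁βy = trans (c₁-β· y) (cong₂ (λ s t → s + + a * t) c₀y c₁y)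
      afterOne : ∀ Q → -[1+ u ] + + a * + suc v ≡ Q → Sign (β · y)
      afterOne (+ q) e = inj₁ (Nβ⁺⇒Positive (nβ⁺ c₀βy (trans c₁βy e) (ℕ.s≤s ℕ.z≤n)))
      afterOne -[1+ u′ ] e = Sign-β· (afterTwo (+ suc v + + a * -[1+ u′ ]) refl)
        where
        u′<u : u′ ℕ.< u
        u′<u = -[1+u]+k≡-[1+u′]⇒u′<u u (a ℕ.* suc v) u′ (ℕP.*-mono-< 1≤a (ℕ.s≤s ℕ.z≤n))
                 (trans (cong (_+_ -[1+ u ]) (ℤP.pos-* a (suc v))) e)
        c₀ββy : c₀ (β · (β · y)) ≡ -[1+ u′ ]
        c₀ββy = trans (c₀-β· (β · y)) (trans c₁βy e)
        c₁ββy : c₁ (β · (β · y)) ≡ + suc v + + a * -[1+ u′ ]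
        c₁ββy = trans (c₁-β· (β · y)) (cong₂ (λ s t → s + + a * t) c₀βy (trans c₁βy e))
        afterTwo : ∀ Q → + suc v + + a * -[1+ u′ ] ≡ Q → Sign (β · (β · y))
        afterTwo (+ zero) e′ = negative (suc u′) 0 c₀ββy (trans c₁ββy e′) (ℕ.s≤s ℕ.z≤n)
        afterTwo -[1+ w ] e′ = negative (suc u′) (suc w) c₀ββy (trans c₁ββy e′) (ℕ.s≤s ℕ.z≤n)
        afterTwo (+ suc v′) e′ = signMixed fuel (β · (β · y)) u′ v′ (ℕP.<-≤-trans u′<u u≤fuel) c₀ββy (trans c₁ββy e′)

  sign : ∀ x → Sign x
  sign x = signAt (c₀ x) (c₁ x) refl refl
    where
    signAt : ∀ P Q → c₀ x ≡ P → c₁ x ≡ Q → Sign x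
    signAt (+ zero) (+ zero) e₀ e₁ = inj₂ (inj₁ (coords-zero x e₀ e₁))
    signAt (+ zero) (+ suc q) e₀ e₁ = inj₁ (Nβ⁺⇒Positive (nβ⁺ e₀ e₁ (ℕ.s≤s ℕ.z≤n)))
    signAt (+ suc p) (+ q) e₀ e₁ = inj₁ (Nβ⁺⇒Positive (nβ⁺ e₀ e₁ (ℕ.s≤s ℕ.z≤n)))
    signAt (+ zero) -[1+ q ] e₀ e₁ = negative 0 (suc q) e₀ e₁ (ℕ.s≤s ℕ.z≤n)
    signAt -[1+ p ] (+ zero) e₀ e₁ = negative (suc p) 0 e₀ e₁ (ℕ.s≤s ℕ.z≤n)
    signAt -[1+ p ] -[1+ q ] e₀ e₁ = negative (suc p) (suc q) e₀ e₁ (ℕ.s≤s ℕ.z≤n)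
    signAt -[1+ p ] (+ suc q) e₀ e₁ = signMixed (suc p) x p q ℕP.≤-refl e₀ e₁
    signAt (+ suc p) -[1+ q ] e₀ e₁ =
      Sign-⊖ (signMixed (suc p) (⊖ x) p q ℕP.≤-refl (trans (c₀-⊖ x) (cong -_ e₀)) (trans (c₁-⊖ x) (cong -_ e₁)))

  D′ : ℤ
  D′ = + a * + a + + 4

  D≡D′ : D a ≡ D′
  D≡D′ = trans (ℤP.pos-+ (a ℕ.* a) 4) (cong (_+ + 4) (ℤP.pos-* a a))

  -- X < q √D, exactly as LtSqrtD but with D a unfolded to a polynomial in a.
  Lt√D : ℤ → ℤ → Set
  Lt√D X q = (q ℤ.≤ + 0 → (X ℤ.< + 0) × (q * q * D′ ℤ.< X * X))
           × (+ 0 ℤ.< q → (X ℤ.< + 0) ⊎ (X * X ℤ.< q * q * D′))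

  LtSqrtD⇒Lt√D : ∀ {X q} → LtSqrtD a X q → Lt√D X q
  LtSqrtD⇒Lt√D {X} {q} = subst (λ d → (q ℤ.≤ + 0 → (X ℤ.< + 0) × (q * q * d ℤ.< X * X))
                                     × (+ 0 ℤ.< q → (X ℤ.< + 0) ⊎ (X * X ℤ.< q * q * d))) D≡D′

  Lt√D⇒LtSqrtD : ∀ {X q} → Lt√D X q → LtSqrtD a X q
  Lt√D⇒LtSqrtD {X} {q} = subst (λ d → (q ℤ.≤ + 0 → (X ℤ.< + 0) × (q * q * d ℤ.< X * X))
                                     × (+ 0 ℤ.< q → (X ℤ.< + 0) ⊎ (X * X ℤ.< q * q * d))) (sym D≡D′)

  Lt√D-asym : ∀ {X q} → Lt√D X q → ¬ Lt√D (- X) (- q)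
  Lt√D-asym {X} {+ zero} (≤0 , _) (≤0′ , _) =
    ℤP.<-asym (proj₁ (≤0 (+≤+ ℕ.z≤n))) (subst (+ 0 ℤ.<_) (ℤP.neg-involutive X) (ℤP.neg-mono-< (proj₁ (≤0′ (+≤+ ℕ.z≤n)))))
  Lt√D-asym {X} {+ suc q} (_ , >0) (≤0′ , _) with ≤0′ -≤+ | >0 (+<+ (ℕ.s≤s ℕ.z≤n))
  ... | (-X<0 , _) | inj₁ X<0 = ℤP.<-asym X<0 (subst (+ 0 ℤ.<_) (ℤP.neg-involutive X) (ℤP.neg-mono-< -X<0))
  ... | (_ , lt) | inj₂ lt′ = ℤP.<-asym lt′ (subst₂ ℤ._<_ (squares (+ suc q) D′) (squares′ X) lt)
    where
    squares : ∀ x d → - x * - x * d ≡ x * x * d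
    squares = solve-∀
    squares′ : ∀ x → - x * - x ≡ x * x
    squares′ = solve-∀
  Lt√D-asym {X} { -[1+ q ]} (≤0 , _) (_ , >0′) with ≤0 -≤+ | >0′ (+<+ (ℕ.s≤s ℕ.z≤n))
  ... | (X<0 , _) | inj₁ -X<0 = ℤP.<-asym X<0 (subst (+ 0 ℤ.<_) (ℤP.neg-involutive X) (ℤP.neg-mono-< -X<0))
  ... | (_ , lt) | inj₂ lt′ = ℤP.<-asym lt (subst₂ ℤ._<_ (squares′ X) (squares -[1+ q ] D′) lt′)
    where
    squares : ∀ x d → - x * - x * d ≡ x * x * d
    squares = solve-∀
    squares′ : ∀ x → - x * - x ≡ x * x
    squares′ = solve-∀

  -- x > 0 as a real number: this is Negα a (⊖ x) with D unfolded.
  RealPositive : ℤα → Set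
  RealPositive ⟨ m , n ⟩ = Lt√D (+ 2 * - m + - n * + a) (- n)

  Nβ⁺⇒RealPositive : ∀ {x} → Nβ⁺ x → RealPositive x
  Nβ⁺⇒RealPositive {⟨ m , n ⟩} (nβ⁺ {p} {q} c₀≡ c₁≡ p+q>0) = (λ -n≤0 → X<0 , q²D<X² -n≤0) , (λ _ → inj₁ X<0)
    where
    X : ℤ
    X = + 2 * - m + - n * + a
    X≡ : X ≡ - + (2 ℕ.* p ℕ.+ q ℕ.* a)
    X≡ = trans (eq (+ a) m n) (cong -_ (trans (cong₂ (λ u v → + 2 * u + v * + a) c₀≡ c₁≡) nat))
      where
      eq : ∀ A m n → + 2 * - m + - n * A ≡ - (+ 2 * (m + n * A) + (- n) * A)
      eq = solve-∀
      nat : + 2 * + p + + q * + a ≡ + (2 ℕ.* p ℕ.+ q ℕ.* a)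
      nat = sym (trans (ℤP.pos-+ (2 ℕ.* p) (q ℕ.* a)) (cong₂ _+_ (ℤP.pos-* 2 p) (ℤP.pos-* q a)))
    0<2p+qa : ∀ p q → 0 ℕ.< p ℕ.+ q → 0 ℕ.< 2 ℕ.* p ℕ.+ q ℕ.* a
    0<2p+qa zero (suc q) _ = ℕP.*-mono-< (ℕ.s≤s (ℕ.z≤n {q})) 1≤a
    0<2p+qa (suc p) q _ = ℕ.s≤s ℕ.z≤n
    X<0 : X ℤ.< + 0
    X<0 = subst (ℤ._< + 0) (sym X≡) (ℤP.neg-mono-< (+<+ (0<2p+qa p q p+q>0)))
    q²D<X² : - n ℤ.≤ + 0 → - n * - n * D′ ℤ.< X * X
    q²D<X² -n≤0 = subst (λ t → t * t * D′ ℤ.< X * X) (sym -n≡0) (x<0⇒0<x*x X<0)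
      where
      -n≡0 : - n ≡ + 0
      -n≡0 = nat≤0 c₁≡ -n≤0
        where
        nat≤0 : ∀ {x k} → x ≡ + k → x ℤ.≤ + 0 → x ≡ + 0
        nat≤0 {k = zero} e _ = e
        nat≤0 {k = suc k} refl (+≤+ ())

  -- Dividing by β > 0: the squares compared by Lt√D differ by ±4 times the norm m² + mna − n² = (m + nα)(m + nβ).
  RealPositive-β·⇒ : ∀ y → RealPositive (β · y) → RealPositive y
  RealPositive-β·⇒ ⟨ m , n ⟩ h = divided (subst₂ Lt√D (X-eq (+ a) m n) (q-eq (+ a) m n) h)
    where
    X-eq : ∀ A m n → + 2 * - (A * m + (- + 1) * n) + - (A * n + (- + 1) * m + (- + 1) * n * A) * A ≡ + 2 * n - m * A
    X-eq = solve-∀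
    q-eq : ∀ A m n → - (A * n + (- + 1) * m + (- + 1) * n * A) ≡ m
    q-eq = solve-∀
    N X : ℤ
    N = m * m + m * n * + a - n * n
    X = + 2 * - m + - n * + a
    norm₁ : ∀ A m n → (+ 2 * n - m * A) * (+ 2 * n - m * A) - m * m * (A * A + + 4) ≡ + 4 * (- (m * m + m * n * A - n * n))
    norm₁ = solve-∀
    norm₂ : ∀ A m n → m * m * (A * A + + 4) - (+ 2 * n - m * A) * (+ 2 * n - m * A) ≡ + 4 * (m * m + m * n * A - n * n)
    norm₂ = solve-∀
    norm₃ : ∀ A m n → (+ 2 * - m + - n * A) * (+ 2 * - m + - n * A) - (- n) * (- n) * (A * A + + 4) ≡ + 4 * (m * m + m * n * A - n * n)
    norm₃ = solve-∀
    norm₄ : ∀ A m n → (- n) * (- n) * (A * A + + 4) - (+ 2 * - m + - n * A) * (+ 2 * - m + - n * A) ≡ + 4 * (- (m * m + m * n * A - n * n))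
    norm₄ = solve-∀
    0<4 : + 0 ℤ.< + 4
    0<4 = +<+ (ℕ.s≤s ℕ.z≤n)
    0≤a : + 0 ℤ.≤ + a
    0≤a = +≤+ ℕ.z≤n
    N<0⇒X²<n²D : + 0 ℤ.< - N → X * X ℤ.< - n * - n * D′
    N<0⇒X²<n²D 0<-N = 0<-⇒< (subst (+ 0 ℤ.<_) (sym (norm₄ (+ a) m n)) (0<*0< 0<4 0<-N))
    divided : Lt√D (+ 2 * n - m * + a) m → Lt√D X (- n)
    divided (m≤0⇒ , 0<m⇒) with + 0 ℤP.<? m
    ... | no m≯0 = (λ -n≤0 → ⊥-elim (ℤP.<⇒≱ n<0 (-≤0⇒0≤ -n≤0))) , (λ _ → inj₂ (N<0⇒X²<n²D 0<-N))
      where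
      m≤0 : m ℤ.≤ + 0
      m≤0 = ℤP.≮⇒≥ m≯0
      Y<0 : + 2 * n - m * + a ℤ.< + 0
      Y<0 = proj₁ (m≤0⇒ m≤0)
      0<-N : + 0 ℤ.< - N
      0<-N = 0<4*⇒0< (subst (+ 0 ℤ.<_) (norm₁ (+ a) m n) (<⇒0<- (proj₂ (m≤0⇒ m≤0))))
      n<0 : n ℤ.< + 0
      n<0 with n ℤP.<? + 0
      ... | yes n<0 = n<0
      ... | no n≮0 = ⊥-elim (ℤP.<⇒≱ Y<0 (subst (+ 0 ℤ.≤_) (sym (eq (+ a) m n))
                       (0≤+0≤ (0≤*0≤ {+ 2} (+≤+ ℕ.z≤n) (ℤP.≮⇒≥ n≮0)) (0≤*0≤ (ℤP.neg-mono-≤ m≤0) 0≤a))))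
        where
        eq : ∀ A m n → + 2 * n - m * A ≡ + 2 * n + (- m) * A
        eq = solve-∀
    ... | yes 0<m = n≥0-case , n<0-case
      where
      n≥0-case : - n ℤ.≤ + 0 → (X ℤ.< + 0) × (- n * - n * D′ ℤ.< X * X)
      n≥0-case -n≤0 = X<0 , 0<-⇒< (subst (+ 0 ℤ.<_) (sym (norm₃ (+ a) m n)) (0<*0< 0<4 0<N))
        where
        0≤n : + 0 ℤ.≤ n
        0≤n = -≤0⇒0≤ -n≤0
        X<0 : X ℤ.< + 0
        X<0 = 0<-⇒<0 (subst (+ 0 ℤ.<_) (sym (eq (+ a) m n)) (0<+0≤ (0<+0≤ 0<m (ℤP.<⇒≤ 0<m)) (0≤*0≤ 0≤n 0≤a)))
          where
          eq : ∀ A m n → - (+ 2 * - m + - n * A) ≡ m + m + n * A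
          eq = solve-∀
        0<N : + 0 ℤ.< N
        0<N with 0<m⇒ 0<m
        ... | inj₂ lt = 0<4*⇒0< (subst (+ 0 ℤ.<_) (norm₂ (+ a) m n) (<⇒0<- lt))
        ... | inj₁ Y<0 = subst (+ 0 ℤ.<_) (sym (eq (+ a) m n))
                           (0<+0≤ (0<+0≤ (0<*0< 0<m 0<m) (0≤*0≤ 0≤n (ℤP.<⇒≤ (ℤP.neg-mono-< Y<0)))) (0≤x*x n))
          where
          eq : ∀ A m n → m * m + m * n * A - n * n ≡ m * m + n * (- (+ 2 * n - m * A)) + n * n
          eq = solve-∀
      n<0-case : + 0 ℤ.< - n → (X ℤ.< + 0) ⊎ (X * X ℤ.< - n * - n * D′)
      n<0-case _ with X ℤP.<? + 0
      ... | yes X<0 = inj₁ X<0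
      ... | no X≮0 = inj₂ (N<0⇒X²<n²D (subst (+ 0 ℤ.<_) (sym (eq (+ a) m n))
                       (0<+0≤ (0≤+0< (0≤*0≤ (ℤP.<⇒≤ 0<m) (ℤP.≮⇒≥ X≮0)) (0<*0< 0<m 0<m)) (0≤x*x n))))
        where
        eq : ∀ A m n → - (m * m + m * n * A - n * n) ≡ m * (+ 2 * - m + - n * A) + m * m + n * n
        eq = solve-∀
        0≤+0< : ∀ {x y} → + 0 ℤ.≤ x → + 0 ℤ.< y → + 0 ℤ.< x + y
        0≤+0< {x} {y} p q = subst (+ 0 ℤ.<_) (ℤP.+-comm y x) (0<+0≤ q p)

  Positive⇒RealPositive : ∀ {x} → Positive x → RealPositive x
  Positive⇒RealPositive {x} (k , h) = unshift k (Nβ⁺⇒RealPositive h)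
    where
    unshift : ∀ k → RealPositive (β ^ k · x) → RealPositive x
    unshift zero h = subst RealPositive (·-identityˡ x) h
    unshift (suc k) h = unshift k (RealPositive-β·⇒ (β ^ k · x) (subst RealPositive (·-assoc β (β ^ k) x) h))

  Positive⊖⇒Negα : ∀ {r} → Positive (⊖ r) → Negα a r
  Positive⊖⇒Negα {⟨ m , n ⟩} p =
    Lt√D⇒LtSqrtD (subst₂ Lt√D (eq (+ a) m n) (ℤP.neg-involutive n) (Positive⇒RealPositive p))
    where
    eq : ∀ A m n → + 2 * - - m + - - n * A ≡ + 2 * m + n * A
    eq = solve-∀

  Negα⇒Positive⊖ : ∀ {r} → Negα a r → Positive (⊖ r)
  Negα⇒Positive⊖ {r} r<0 with sign r
  ... | inj₂ (inj₂ p) = p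
  ... | inj₂ (inj₁ refl) = ⊥-elim (ℤP.<-irrefl refl (proj₁ (proj₁ r<0 (+≤+ ℕ.z≤n))))
  Negα⇒Positive⊖ {⟨ m , n ⟩} r<0 | inj₁ p =
    ⊥-elim (Lt√D-asym (LtSqrtD⇒Lt√D r<0) (subst (λ X → Lt√D X (- n)) (eq (+ a) m n) (Positive⇒RealPositive p)))
    where
    eq : ∀ A m n → + 2 * - m + - n * A ≡ - (+ 2 * m + n * A)
    eq = solve-∀

  Negβ⇒Positive⊖conj : ∀ m n → Negβ a m n → Positive (⊖ conj ⟨ m , n ⟩)
  Negβ⇒Positive⊖conj m n x<0 =
    Negα⇒Positive⊖ (Lt√D⇒LtSqrtD (subst (λ X → Lt√D X (- n)) (sym (eq (+ a) m n)) (LtSqrtD⇒Lt√D x<0)))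
    where
    eq : ∀ A m n → + 2 * (m + n * A) + (- n) * A ≡ + 2 * m + n * A
    eq = solve-∀

module Order (a : ℕ) (1≤a : 1 ℕ.≤ a) where
  open Ring a
  open Positivity a 1≤a
  open ℤα-Solver using (solve; _:=_; _:+_; _:-_; _:*_; :-_; con)

  infix 4 _<_ _≤_
  record _<_ (x y : ℤα) : Set where
    constructor mk<
    field positive : Positive (y ⊕ ⊖ x)

  _≤_ : ℤα → ℤα → Set
  x ≤ y = x < y ⊎ x ≡ y

  private
    difference : ∀ x y → y ≡ x ⊕ (y ⊕ ⊖ x)
    difference = solve 2 (λ x y → y := x :+ (y :- x)) refl

    difference-𝟘 : ∀ {x y} → y ⊕ ⊖ x ≡ 𝟘 → x ≡ y
    difference-𝟘 {x} {y} e = sym (trans (difference x y) (trans (cong (x ⊕_) e) (⊕-identityʳ x)))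

  Positive⇒0< : ∀ {x} → Positive x → 𝟘 < x
  Positive⇒0< {x} p = mk< (subst Positive (solve 1 (λ x → x := x :- con 𝟘) refl x) p)

  0<⇒Positive : ∀ {x} → 𝟘 < x → Positive x
  0<⇒Positive {x} (mk< p) = subst Positive (solve 1 (λ x → x :- con 𝟘 := x) refl x) p

  <-trans : ∀ {x y z} → x < y → y < z → x < z
  <-trans {x} {y} {z} (mk< p) (mk< q) = mk< (subst Positive (eq x y z) (Positive-⊕ q p))
    where
    eq : ∀ x y z → (z ⊕ ⊖ y) ⊕ (y ⊕ ⊖ x) ≡ z ⊕ ⊖ x
    eq = solve 3 (λ x y z → (z :- y) :+ (y :- x) := z :- x) refl

  <-irrefl : ∀ {x} → ¬ x < x
  <-irrefl {x} (mk< p) = ¬Positive𝟘 (subst Positive (⊖-inverseʳ x) p)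

  <-asym : ∀ {x y} → x < y → ¬ y < x
  <-asym {x} {y} (mk< p) (mk< q) = Positive-asym p (subst Positive (eq x y) q)
    where
    eq : ∀ x y → x ⊕ ⊖ y ≡ ⊖ (y ⊕ ⊖ x)
    eq = solve 2 (λ x y → x :- y := :- (y :- x)) refl

  Positive⊖⇒<𝟘 : ∀ {x} → Positive (⊖ x) → x < 𝟘
  Positive⊖⇒<𝟘 {x} p = mk< (subst Positive (sym (⊕-identityˡ (⊖ x))) p)

  ≤-refl : ∀ {x} → x ≤ x
  ≤-refl = inj₂ refl

  <⇒≤ : ∀ {x y} → x < y → x ≤ y
  <⇒≤ = inj₁

  ≤-<-trans : ∀ {x y z} → x ≤ y → y < z → x < z
  ≤-<-trans (inj₁ x<y) y<z = <-trans x<y y<z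
  ≤-<-trans (inj₂ refl) y<z = y<z

  <-≤-trans : ∀ {x y z} → x < y → y ≤ z → x < z
  <-≤-trans x<y (inj₁ y<z) = <-trans x<y y<z
  <-≤-trans x<y (inj₂ refl) = x<y

  ≤-trans : ∀ {x y z} → x ≤ y → y ≤ z → x ≤ z
  ≤-trans (inj₁ x<y) y≤z = inj₁ (<-≤-trans x<y y≤z)
  ≤-trans (inj₂ refl) y≤z = y≤z

  ≤⇒≯ : ∀ {x y} → x ≤ y → ¬ y < x
  ≤⇒≯ (inj₁ x<y) = <-asym x<y
  ≤⇒≯ (inj₂ refl) = <-irrefl

  ≤-isPreorder : IsPreorder _≡_ _≤_
  ≤-isPreorder = record { isEquivalence = isEquivalence ; reflexive = inj₂ ; trans = ≤-trans }

  module ≤-Reasoning where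
    open TripleReasoning ≤-isPreorder <-asym <-trans (resp₂ _<_) <⇒≤ <-≤-trans ≤-<-trans public
      hiding (step-≈; step-≈˘; step-≈-⟩; step-≈-⟨)

  <-cmp : ∀ x y → x < y ⊎ x ≡ y ⊎ y < x
  <-cmp x y with sign (y ⊕ ⊖ x)
  ... | inj₁ p = inj₁ (mk< p)
  ... | inj₂ (inj₁ e) = inj₂ (inj₁ (difference-𝟘 e))
  ... | inj₂ (inj₂ p) = inj₂ (inj₂ (mk< (subst Positive (eq x y) p)))
    where
    eq : ∀ x y → ⊖ (y ⊕ ⊖ x) ≡ x ⊕ ⊖ y
    eq = solve 2 (λ x y → :- (y :- x) := x :- y) refl

  ≮⇒≥ : ∀ {x y} → ¬ y < x → x ≤ y
  ≮⇒≥ {x} {y} y≮x with <-cmp x y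
  ... | inj₁ x<y = inj₁ x<y
  ... | inj₂ (inj₁ x≡y) = inj₂ x≡y
  ... | inj₂ (inj₂ y<x) = ⊥-elim (y≮x y<x)

  ≰⇒> : ∀ {x y} → ¬ x ≤ y → y < x
  ≰⇒> {x} {y} x≰y with <-cmp x y
  ... | inj₁ x<y = ⊥-elim (x≰y (inj₁ x<y))
  ... | inj₂ (inj₁ x≡y) = ⊥-elim (x≰y (inj₂ x≡y))
  ... | inj₂ (inj₂ y<x) = y<x

  infix 4 _≤?_
  _≤?_ : ∀ x y → Dec (x ≤ y)
  x ≤? y with <-cmp x y
  ... | inj₁ x<y = yes (inj₁ x<y)
  ... | inj₂ (inj₁ x≡y) = yes (inj₂ x≡y)
  ... | inj₂ (inj₂ y<x) = no (λ x≤y → ≤⇒≯ x≤y y<x)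

  +-monoʳ-< : ∀ {x y} z → x < y → z ⊕ x < z ⊕ y
  +-monoʳ-< {x} {y} z (mk< p) = mk< (subst Positive (eq x y z) p)
    where
    eq : ∀ x y z → y ⊕ ⊖ x ≡ (z ⊕ y) ⊕ ⊖ (z ⊕ x)
    eq = solve 3 (λ x y z → y :- x := (z :+ y) :- (z :+ x)) refl

  +-monoˡ-< : ∀ {x y} z → x < y → x ⊕ z < y ⊕ z
  +-monoˡ-< {x} {y} z x<y = subst₂ _<_ (⊕-comm z x) (⊕-comm z y) (+-monoʳ-< z x<y)

  +-monoʳ-≤ : ∀ {x y} z → x ≤ y → z ⊕ x ≤ z ⊕ y
  +-monoʳ-≤ z (inj₁ x<y) = inj₁ (+-monoʳ-< z x<y)
  +-monoʳ-≤ z (inj₂ refl) = ≤-refl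

  +-monoˡ-≤ : ∀ {x y} z → x ≤ y → x ⊕ z ≤ y ⊕ z
  +-monoˡ-≤ z (inj₁ x<y) = inj₁ (+-monoˡ-< z x<y)
  +-monoˡ-≤ z (inj₂ refl) = ≤-refl

  +-mono-≤-< : ∀ {x y u v} → x ≤ y → u < v → x ⊕ u < y ⊕ v
  +-mono-≤-< {y = y} {u = u} x≤y u<v = ≤-<-trans (+-monoˡ-≤ u x≤y) (+-monoʳ-< y u<v)

  +-mono-<-≤ : ∀ {x y u v} → x < y → u ≤ v → x ⊕ u < y ⊕ v
  +-mono-<-≤ {y = y} {u = u} x<y u≤v = <-≤-trans (+-monoˡ-< u x<y) (+-monoʳ-≤ y u≤v)

  +-mono-≤ : ∀ {x y u v} → x ≤ y → u ≤ v → x ⊕ u ≤ y ⊕ v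
  +-mono-≤ {y = y} {u = u} x≤y u≤v = ≤-trans (+-monoˡ-≤ u x≤y) (+-monoʳ-≤ y u≤v)

  ⊖-mono-< : ∀ {x y} → x < y → ⊖ y < ⊖ x
  ⊖-mono-< {x} {y} (mk< p) = mk< (subst Positive (eq x y) p)
    where
    eq : ∀ x y → y ⊕ ⊖ x ≡ ⊖ x ⊕ ⊖ (⊖ y)
    eq = solve 2 (λ x y → y :- x := (:- x) :- (:- y)) refl

  ⊖-mono-≤ : ∀ {x y} → x ≤ y → ⊖ y ≤ ⊖ x
  ⊖-mono-≤ (inj₁ x<y) = inj₁ (⊖-mono-< x<y)
  ⊖-mono-≤ (inj₂ refl) = ≤-refl

  ·-monoʳ-< : ∀ {c x y} → 𝟘 < c → x < y → c · x < c · y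
  ·-monoʳ-< {c} {x} {y} 0<c (mk< p) = mk< (subst Positive (eq c x y) (Positive-· (0<⇒Positive 0<c) p))
    where
    eq : ∀ c x y → c · (y ⊕ ⊖ x) ≡ c · y ⊕ ⊖ (c · x)
    eq = solve 3 (λ c x y → c :* (y :- x) := c :* y :- c :* x) refl

  ·-monoˡ-< : ∀ {c x y} → 𝟘 < c → x < y → x · c < y · c
  ·-monoˡ-< {c} {x} {y} 0<c x<y = subst₂ _<_ (·-comm c x) (·-comm c y) (·-monoʳ-< 0<c x<y)

  ·-monoʳ-≤ : ∀ {c x y} → 𝟘 ≤ c → x ≤ y → c · x ≤ c · y
  ·-monoʳ-≤ (inj₁ 0<c) (inj₁ x<y) = inj₁ (·-monoʳ-< 0<c x<y)
  ·-monoʳ-≤ (inj₁ 0<c) (inj₂ refl) = ≤-refl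
  ·-monoʳ-≤ {x = x} {y} (inj₂ refl) _ = inj₂ (trans (zeroˡ x) (sym (zeroˡ y)))
    where
    zeroˡ : ∀ x → 𝟘 · x ≡ 𝟘
    zeroˡ = solve 1 (λ x → con 𝟘 :* x := con 𝟘) refl

  ·-monoˡ-≤ : ∀ {c x y} → 𝟘 ≤ c → x ≤ y → x · c ≤ y · c
  ·-monoˡ-≤ {c} {x} {y} 0≤c x≤y = subst₂ _≤_ (·-comm c x) (·-comm c y) (·-monoʳ-≤ 0≤c x≤y)

  0<· : ∀ {x y} → 𝟘 < x → 𝟘 < y → 𝟘 < x · y
  0<· 0<x 0<y = Positive⇒0< (Positive-· (0<⇒Positive 0<x) (0<⇒Positive 0<y))

  0≤· : ∀ {x y} → 𝟘 ≤ x → 𝟘 ≤ y → 𝟘 ≤ x · y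
  0≤· {x} {y} 0≤x 0≤y = subst (_≤ x · y) (solve 1 (λ x → x :* con 𝟘 := con 𝟘) refl x) (·-monoʳ-≤ 0≤x 0≤y)

  ι : ℕ → ℤα
  ι n = fromℤ (+ n)

  Positive-fromℤ : ∀ {k} → + 0 ℤ.< k → Positive (fromℤ k)
  Positive-fromℤ {+ suc n} _ = Nβ⁺⇒Positive (nβ⁺ {p = suc n} {q = 0} (ℤP.+-identityʳ (+ suc n)) refl (ℕ.s≤s ℕ.z≤n))
  Positive-fromℤ {+ zero} (+<+ ())

  fromℤ-mono-< : ∀ {k l} → k ℤ.< l → fromℤ k < fromℤ l
  fromℤ-mono-< k<l = mk< (Positive-fromℤ (<⇒0<- k<l))

  fromℤ-mono-≤ : ∀ {k l} → k ℤ.≤ l → fromℤ k ≤ fromℤ l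
  fromℤ-mono-≤ {k} {l} k≤l with k ℤP.≟ l
  ... | yes refl = ≤-refl
  ... | no k≢l = inj₁ (fromℤ-mono-< (ℤP.≤∧≢⇒< k≤l k≢l))

  fromℤ-cancel-< : ∀ {k l} → fromℤ k < fromℤ l → k ℤ.< l
  fromℤ-cancel-< {k} {l} k<l with k ℤP.<? l
  ... | yes k<l′ = k<l′
  ... | no k≮l = ⊥-elim (≤⇒≯ (fromℤ-mono-≤ (ℤP.≮⇒≥ k≮l)) k<l)

  ι-mono-≤ : ∀ {m n} → m ℕ.≤ n → ι m ≤ ι n
  ι-mono-≤ m≤n = fromℤ-mono-≤ (+≤+ m≤n)

  0≤ι : ∀ n → 𝟘 ≤ ι n
  0≤ι n = ι-mono-≤ ℕ.z≤n

  1≤ι : ∀ n → 𝟙 ≤ ι (suc n)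
  1≤ι n = ι-mono-≤ {1} {suc n} (ℕ.s≤s ℕ.z≤n)

  ι-+ : ∀ m n → ι (m ℕ.+ n) ≡ ι m ⊕ ι n
  ι-+ m n = cong₂ ⟨_,_⟩ (ℤP.pos-+ m n) refl

  ι-suc : ∀ n → ι (suc n) ≡ ι n ⊕ 𝟙
  ι-suc n = trans (cong ι (ℕP.+-comm 1 n)) (ι-+ n 1)

  0<𝟙 : 𝟘 < 𝟙
  0<𝟙 = Positive⇒0< Positive-𝟙

  0<ρ : 𝟘 < ρ
  0<ρ = Positive⇒0< (Positive-β·⇒ (subst Positive (sym β·ρ) Positive-𝟙))

  0<β : 𝟘 < β
  0<β = Positive⇒0< Positive-β

  a<β : ι a < β
  a<β = subst₂ _<_ (⊕-identityʳ (ι a)) (sym β≡a⊕ρ) (+-monoʳ-< (ι a) 0<ρ)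

  1<β : 𝟙 < β
  1<β = ≤-<-trans (ι-mono-≤ 1≤a) a<β

  ρ<1 : ρ < 𝟙
  ρ<1 = subst₂ _<_ (·-identityʳ ρ) (trans (·-comm ρ β) β·ρ) (·-monoʳ-< 0<ρ 1<β)

  α·≡⊖ρ· : ∀ x → α · x ≡ ⊖ (ρ · x)
  α·≡⊖ρ· x = solve 2 (λ α x → α :* x := :- ((:- α) :* x)) refl α x

  α·-anti-< : ∀ {x y} → x < y → α · y < α · x
  α·-anti-< {x} {y} x<y = subst₂ _<_ (sym (α·≡⊖ρ· y)) (sym (α·≡⊖ρ· x)) (⊖-mono-< (·-monoʳ-< 0<ρ x<y))

  1≤· : ∀ {x y} → 𝟙 ≤ x → 𝟙 ≤ y → 𝟙 ≤ x · y
  1≤· {x} {y} 1≤x 1≤y = ≤-trans 1≤y (subst₂ _≤_ (·-identityˡ y) refl (·-monoˡ-≤ (≤-trans (inj₁ 0<𝟙) 1≤y) 1≤x))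

  1≤β^ : ∀ t → 𝟙 ≤ β ^ t
  1≤β^ zero = ≤-refl
  1≤β^ (suc t) = 1≤· (inj₁ 1<β) (1≤β^ t)

  ι≤β^ : ∀ n → ι (suc n) ≤ β ^ (n ℕ.+ n)
  ι≤β^ zero = ≤-refl
  ι≤β^ (suc n) = subst (λ t → ι (suc (suc n)) ≤ β ^ t) (cong suc (sym (ℕP.+-suc n n))) (begin
      ι (suc (suc n))                 ≡⟨ trans (ι-suc (suc n)) (⊕-comm (ι (suc n)) 𝟙) ⟩
      𝟙 ⊕ ι (suc n)                   ≤⟨ +-mono-≤ (1≤· (ι-mono-≤ 1≤a) (1≤β^ (suc m))) (ι≤β^ n) ⟩
      ι a · (β · β ^ m) ⊕ β ^ m       ≡⟨ sym (β²-expansion (β ^ m)) ⟩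
      β · (β · β ^ m)                 ∎)
    where
    m : ℕ
    m = n ℕ.+ n
    open ≤-Reasoning
    β²-expansion : ∀ x → β · (β · x) ≡ ι a · (β · x) ⊕ x
    β²-expansion x = trans (sym (·-assoc β β x)) (trans (cong (_· x) β·β)
      (solve 3 (λ a b x → (a :* b :+ con 𝟙) :* x := a :* (b :* x) :+ x) refl (ι a) β x))

  fromℤ≤ι∣∣ : ∀ m → fromℤ m ≤ ι ℤ.∣ m ∣
  fromℤ≤ι∣∣ (+ k) = ≤-refl
  fromℤ≤ι∣∣ -[1+ k ] = fromℤ-mono-≤ -≤+

  fromℤ·α≤ι∣∣ : ∀ n → fromℤ n · α ≤ ι ℤ.∣ n ∣
  fromℤ·α≤ι∣∣ (+ k) = begin
    ι k · α     ≡⟨ ·-comm (ι k) α ⟩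
    α · ι k     ≡⟨ α·≡⊖ρ· (ι k) ⟩
    ⊖ (ρ · ι k) ≤⟨ ⊖-mono-≤ (0≤· (inj₁ 0<ρ) (0≤ι k)) ⟩
    ⊖ 𝟘         ≤⟨ 0≤ι k ⟩
    ι k         ∎
    where open ≤-Reasoning
  fromℤ·α≤ι∣∣ -[1+ k ] = begin
    fromℤ -[1+ k ] · α  ≡⟨ solve 2 (λ k r → (:- k) :* (:- r) := k :* r) refl (ι (suc k)) ρ ⟩
    ι (suc k) · ρ       ≤⟨ ·-monoʳ-≤ (0≤ι (suc k)) (inj₁ ρ<1) ⟩
    ι (suc k) · 𝟙       ≡⟨ ·-identityʳ (ι (suc k)) ⟩
    ι (suc k)           ∎
    where open ≤-Reasoning

  archimedean : ∀ x → Σ ℕ λ N → x < ι N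
  archimedean ⟨ m , n ⟩ = suc (ℤ.∣ m ∣ ℕ.+ ℤ.∣ n ∣) , (begin-strict
    ⟨ m , n ⟩                       ≡⟨ decomposition ⟩
    fromℤ m ⊕ fromℤ n · α           ≤⟨ +-mono-≤ (fromℤ≤ι∣∣ m) (fromℤ·α≤ι∣∣ n) ⟩
    ι ℤ.∣ m ∣ ⊕ ι ℤ.∣ n ∣           ≡⟨ sym (⊕-identityʳ (ι ℤ.∣ m ∣ ⊕ ι ℤ.∣ n ∣)) ⟩
    ι ℤ.∣ m ∣ ⊕ ι ℤ.∣ n ∣ ⊕ 𝟘       <⟨ +-monoʳ-< (ι ℤ.∣ m ∣ ⊕ ι ℤ.∣ n ∣) 0<𝟙 ⟩
    ι ℤ.∣ m ∣ ⊕ ι ℤ.∣ n ∣ ⊕ 𝟙       ≡⟨ cong (_⊕ 𝟙) (ι-+ ℤ.∣ m ∣ ℤ.∣ n ∣) ⟨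
    ι (ℤ.∣ m ∣ ℕ.+ ℤ.∣ n ∣) ⊕ 𝟙     ≡⟨ ι-suc (ℤ.∣ m ∣ ℕ.+ ℤ.∣ n ∣) ⟨
    ι (suc (ℤ.∣ m ∣ ℕ.+ ℤ.∣ n ∣))   ∎)
    where
    open ≤-Reasoning
    decomposition : ⟨ m , n ⟩ ≡ fromℤ m ⊕ fromℤ n · α
    decomposition = sym (cong₂ ⟨_,_⟩ (eq₁ m n) (eq₂ (+ a) n))
      where
      eq₁ : ∀ m n → m + (n * + 0 + + 0 * + 1) ≡ m
      eq₁ = solve-∀
      eq₂ : ∀ A n → + 0 + (n * + 1 + + 0 * + 0 + + 0 * + 1 * A) ≡ n
      eq₂ = solve-∀

  Nβ⁺⇒1≤ : ∀ {y} → Nβ⁺ y → 𝟙 ≤ y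
  Nβ⁺⇒1≤ {⟨ m , n ⟩} (nβ⁺ {p} {q} c₀≡ c₁≡ p+q>0) =
    subst (𝟙 ≤_) (sym (trans decomposition (cong₂ (λ u v → fromℤ u ⊕ fromℤ v · β) c₀≡ c₁≡))) (1≤p+qβ p q p+q>0)
    where
    decomposition : ⟨ m , n ⟩ ≡ fromℤ (m + n * + a) ⊕ fromℤ (- n) · β
    decomposition = sym (cong₂ ⟨_,_⟩ (eq₁ (+ a) m n) (eq₂ (+ a) n))
      where
      eq₁ : ∀ A m n → m + n * A + ((- n) * A + + 0 * (- + 1)) ≡ m
      eq₁ = solve-∀
      eq₂ : ∀ A n → + 0 + ((- n) * (- + 1) + + 0 * A + + 0 * (- + 1) * A) ≡ n
      eq₂ = solve-∀
    1≤p+qβ : ∀ p q → 0 ℕ.< p ℕ.+ q → 𝟙 ≤ ι p ⊕ ι q · β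
    1≤p+qβ (suc p) q _ = ≤-trans (1≤ι p)
      (subst (_≤ ι (suc p) ⊕ ι q · β) (⊕-identityʳ (ι (suc p))) (+-monoʳ-≤ (ι (suc p)) (0≤· (0≤ι q) (inj₁ 0<β))))
    1≤p+qβ zero (suc q) _ = subst (𝟙 ≤_) (sym (⊕-identityˡ (ι (suc q) · β))) (1≤· (1≤ι q) (inj₁ 1<β))

  archimedean-0< : ∀ {e} → 𝟘 < e → Σ ℕ λ n → 𝟙 ≤ ι (suc n) · e
  archimedean-0< {e} 0<e = bound (0<⇒Positive 0<e)
    where
    open ≤-Reasoning
    bound : Positive e → Σ ℕ λ n → 𝟙 ≤ ι (suc n) · e
    bound (k , h) = N , (begin
      𝟙              ≤⟨ Nβ⁺⇒1≤ h ⟩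
      β ^ k · e      ≤⟨ ·-monoˡ-≤ (inj₁ 0<e) (inj₁ (<-≤-trans β^k<N (ι-mono-≤ (ℕP.n≤1+n N)))) ⟩
      ι (suc N) · e  ∎)
      where
      N : ℕ
      N = proj₁ (archimedean (β ^ k))
      β^k<N : β ^ k < ι N
      β^k<N = proj₂ (archimedean (β ^ k))

  0<ρ^ : ∀ t → 𝟘 < ρ ^ t
  0<ρ^ zero = 0<𝟙
  0<ρ^ (suc t) = 0<· 0<ρ (0<ρ^ t)

  ρ^≤1 : ∀ t → ρ ^ t ≤ 𝟙
  ρ^≤1 zero = ≤-refl
  ρ^≤1 (suc t) = ≤-trans (·-monoʳ-≤ (inj₁ 0<ρ) (ρ^≤1 t)) (subst (_≤ 𝟙) (sym (·-identityʳ ρ)) (inj₁ ρ<1))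

  β^·ρ^ : ∀ t → β ^ t · ρ ^ t ≡ 𝟙
  β^·ρ^ t = ^-inverse t β·ρ

  ρ^-eventually-small : ∀ c → Eventually (λ T → c · ρ ^ T < ρ)
  ρ^-eventually-small c = suc (N ℕ.+ N) , λ T 2N<T →
    subst (λ t → c · ρ ^ t < ρ) (trans (ℕP.+-suc (N ℕ.+ N) (T ℕ.∸ suc (N ℕ.+ N))) (ℕP.m+[n∸m]≡n 2N<T))
          (small (T ℕ.∸ suc (N ℕ.+ N)))
    where
    open ≤-Reasoning
    N : ℕ
    N = proj₁ (archimedean c)
    c<β^2N : c < β ^ (N ℕ.+ N)
    c<β^2N = <-≤-trans (proj₂ (archimedean c)) (≤-trans (ι-mono-≤ (ℕP.n≤1+n N)) (ι≤β^ N))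
    small : ∀ j → c · ρ ^ (N ℕ.+ N ℕ.+ suc j) < ρ
    small j = begin-strict
      c · ρ ^ (N ℕ.+ N ℕ.+ suc j)                       <⟨ ·-monoˡ-< (0<ρ^ (N ℕ.+ N ℕ.+ suc j)) c<β^2N ⟩
      β ^ (N ℕ.+ N) · ρ ^ (N ℕ.+ N ℕ.+ suc j)           ≡⟨ cong (β ^ (N ℕ.+ N) ·_) (^-distribˡ-+-· ρ (N ℕ.+ N) (suc j)) ⟩
      β ^ (N ℕ.+ N) · (ρ ^ (N ℕ.+ N) · ρ ^ suc j)       ≡⟨ sym (·-assoc (β ^ (N ℕ.+ N)) (ρ ^ (N ℕ.+ N)) (ρ ^ suc j)) ⟩
      β ^ (N ℕ.+ N) · ρ ^ (N ℕ.+ N) · ρ ^ suc j         ≡⟨ cong (_· ρ ^ suc j) (β^·ρ^ (N ℕ.+ N)) ⟩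
      𝟙 · ρ ^ suc j                                     ≡⟨ ·-identityˡ (ρ ^ suc j) ⟩
      ρ · ρ ^ j                                         ≤⟨ ·-monoʳ-≤ (inj₁ 0<ρ) (ρ^≤1 j) ⟩
      ρ · 𝟙                                             ≡⟨ ·-identityʳ ρ ⟩
      ρ                                                 ∎

  AbsLt : ℤα → ℤα → Set
  AbsLt x y = x < y × ⊖ x < y

  AbsLt-⊖ : ∀ {x y} → AbsLt x y → AbsLt (⊖ x) y
  AbsLt-⊖ {x} {y} (x<y , ⊖x<y) = ⊖x<y , subst (_< y) (solve 1 (λ x → x := :- (:- x)) refl x) x<y

  AbsLtInv⇒AbsLt : ∀ w n → AbsLtInv a w n → AbsLt (ι (suc n) · w) 𝟙
  AbsLtInv⇒AbsLt w n (lo , hi) = pred<0⇒<𝟙 (ι (suc n) · w) lo , pred<0⇒<𝟙 (⊖ (ι (suc n) · w)) hi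
    where
    pred<0⇒<𝟙 : ∀ c → Negα a (c ⊕ fromℤ (- + 1)) → c < 𝟙
    pred<0⇒<𝟙 c h = mk< (subst Positive (solve 1 (λ c → :- (c :+ :- con 𝟙) := con 𝟙 :- c) refl c) (Negα⇒Positive⊖ h))

  AbsLt⇒AbsLtInv : ∀ w n → AbsLt (ι (suc n) · w) 𝟙 → AbsLtInv a w n
  AbsLt⇒AbsLtInv w n (lo , hi) = <𝟙⇒pred<0 (ι (suc n) · w) lo , <𝟙⇒pred<0 (⊖ (ι (suc n) · w)) hi
    where
    <𝟙⇒pred<0 : ∀ c → c < 𝟙 → Negα a (c ⊕ fromℤ (- + 1))
    <𝟙⇒pred<0 c (mk< p) = Positive⊖⇒Negα (subst Positive (solve 1 (λ c → con 𝟙 :- c := :- (c :+ :- con 𝟙)) refl c) p)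

module DigitSums (a : ℕ) (1≤a : 1 ℕ.≤ a) where
  open Ring a
  open Order a 1≤a
  open ℤα-Solver using (solve; _:=_; _:+_; _:-_; _:*_; :-_; con)

  -- Digit d t carries the weight αᵗ (or βᵗ after conjugation).
  Dig : Set
  Dig = ℕ → ℕ

  shift : ℕ → Dig → Dig
  shift T d t = d (T ℕ.+ t)

  Bounded : Dig → Set
  Bounded d = ∀ t → d t ℕ.≤ a

  Admissible : Dig → Set
  Admissible d = ∀ t → d (suc t) ≡ a → d t ≡ 0

  A0Pair : ℕ → ℕ → Set
  A0Pair k k′ = (k ≡ a × k′ ≡ 0) ⊎ (k ≡ 0 × k′ ≡ a)

  Bounded-shift : ∀ {d} T → Bounded d → Bounded (shift T d)
  Bounded-shift T bd t = bd (T ℕ.+ t)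

  Admissible-shift : ∀ {d} T → Admissible d → Admissible (shift T d)
  Admissible-shift {d} T ad t e = ad (T ℕ.+ t) (subst (λ s → d s ≡ a) (ℕP.+-suc T t) e)

  digitSum : ℤα → Dig → ℕ → ℤα
  digitSum b d zero = 𝟘
  digitSum b d (suc T) = digitSum b d T ⊕ ι (d T) · b ^ T

  horner : ℤα → Dig → ℕ → ℤα
  horner b d zero = 𝟘
  horner b d (suc L) = ι (d 0) ⊕ b · horner b (shift 1 d) L

  conj-digitSum : ∀ d T → conj (digitSum α d T) ≡ digitSum β d T
  conj-digitSum d zero = refl
  conj-digitSum d (suc T) = begin
    conj (digitSum α d T ⊕ ι (d T) · α ^ T)              ≡⟨ conj-⊕ (digitSum α d T) (ι (d T) · α ^ T) ⟩
    conj (digitSum α d T) ⊕ conj (ι (d T) · α ^ T)       ≡⟨ cong₂ _⊕_ (conj-digitSum d T) (conj-· (ι (d T)) (α ^ T)) ⟩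
    digitSum β d T ⊕ conj (ι (d T)) · conj (α ^ T)       ≡⟨ cong₂ (λ u v → digitSum β d T ⊕ u · v) (conj-fromℤ (+ d T))
                                                                  (trans (conj-^ α T) (cong (_^ T) conj-α)) ⟩
    digitSum β d T ⊕ ι (d T) · β ^ T                     ∎
    where open ≡-Reasoning

  digitSum-split : ∀ b d T L → digitSum b d (T ℕ.+ L) ≡ digitSum b d T ⊕ b ^ T · digitSum b (shift T d) L
  digitSum-split b d T zero = trans (cong (digitSum b d) (ℕP.+-identityʳ T))
    (solve 2 (λ u p → u := u :+ p :* con 𝟘) refl (digitSum b d T) (b ^ T))
  digitSum-split b d T (suc L) = begin
    digitSum b d (T ℕ.+ suc L)                                              ≡⟨ cong (digitSum b d) (ℕP.+-suc T L) ⟩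
    digitSum b d (T ℕ.+ L) ⊕ ι (d (T ℕ.+ L)) · b ^ (T ℕ.+ L)                ≡⟨ cong₂ (λ x y → x ⊕ ι (d (T ℕ.+ L)) · y)
                                                                                 (digitSum-split b d T L) (^-distribˡ-+-· b T L) ⟩
    digitSum b d T ⊕ b ^ T · S ⊕ ι (d (T ℕ.+ L)) · (b ^ T · b ^ L)          ≡⟨ solve 5 (λ u p w c q → u :+ p :* w :+ c :* (p :* q) := u :+ p :* (w :+ c :* q))
                                                                                 refl (digitSum b d T) (b ^ T) S (ι (d (T ℕ.+ L))) (b ^ L) ⟩
    digitSum b d T ⊕ b ^ T · (S ⊕ ι (d (T ℕ.+ L)) · b ^ L)                  ∎
    where
    open ≡-Reasoning
    S : ℤα
    S = digitSum b (shift T d) L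

  digitSum≡horner : ∀ b d L → digitSum b d L ≡ horner b d L
  digitSum≡horner b d zero = refl
  digitSum≡horner b d (suc L) = begin
    digitSum b d (1 ℕ.+ L)                               ≡⟨ digitSum-split b d 1 L ⟩
    𝟘 ⊕ ι (d 0) · 𝟙 ⊕ (b · 𝟙) · digitSum b (shift 1 d) L ≡⟨ solve 3 (λ c b s → con 𝟘 :+ c :* con 𝟙 :+ (b :* con 𝟙) :* s := c :+ b :* s)
                                                              refl (ι (d 0)) b (digitSum b (shift 1 d) L) ⟩
    ι (d 0) ⊕ b · digitSum b (shift 1 d) L               ≡⟨ cong (λ s → ι (d 0) ⊕ b · s) (digitSum≡horner b (shift 1 d) L) ⟩
    ι (d 0) ⊕ b · horner b (shift 1 d) L                 ∎
    where open ≡-Reasoning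

  digitSum-cong : ∀ b {d d′} → (∀ t → d t ≡ d′ t) → ∀ L → digitSum b d L ≡ digitSum b d′ L
  digitSum-cong b d≗d′ zero = refl
  digitSum-cong b {d} {d′} d≗d′ (suc L) = cong₂ (λ u x → u ⊕ ι x · b ^ L) (digitSum-cong b d≗d′ L) (d≗d′ L)

  digitSum-zeros : ∀ b d n → (∀ t → t ℕ.< n → d t ≡ 0) → digitSum b d n ≡ 𝟘
  digitSum-zeros b d zero _ = refl
  digitSum-zeros b d (suc n) zeros = trans
    (cong₂ (λ u x → u ⊕ ι x · b ^ n) (digitSum-zeros b d n (λ t t<n → zeros t (ℕP.<-trans t<n (ℕP.n<1+n n)))) (zeros n (ℕP.n<1+n n)))
    (solve 1 (λ p → con 𝟘 :+ con 𝟘 :* p := con 𝟘) refl (b ^ n))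

  ⊖𝟙<𝟘 : ⊖ 𝟙 < 𝟘
  ⊖𝟙<𝟘 = fromℤ-mono-< -<+

  β⊖𝟙≡a∸1⊕ρ : β ⊕ ⊖ 𝟙 ≡ ι (a ℕ.∸ 1) ⊕ ρ
  β⊖𝟙≡a∸1⊕ρ = begin
    β ⊕ ⊖ 𝟙                  ≡⟨ cong (_⊕ ⊖ 𝟙) β≡a⊕ρ ⟩
    ι a ⊕ ρ ⊕ ⊖ 𝟙            ≡⟨ cong (λ k → ι k ⊕ ρ ⊕ ⊖ 𝟙) (sym (ℕP.m+[n∸m]≡n 1≤a)) ⟩
    ι (1 ℕ.+ (a ℕ.∸ 1)) ⊕ ρ ⊕ ⊖ 𝟙  ≡⟨ cong (λ x → x ⊕ ρ ⊕ ⊖ 𝟙) (ι-+ 1 (a ℕ.∸ 1)) ⟩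
    𝟙 ⊕ ι (a ℕ.∸ 1) ⊕ ρ ⊕ ⊖ 𝟙  ≡⟨ solve 2 (λ x r → con 𝟙 :+ x :+ r :- con 𝟙 := x :+ r) refl (ι (a ℕ.∸ 1)) ρ ⟩
    ι (a ℕ.∸ 1) ⊕ ρ          ∎
    where open ≡-Reasoning

  ι⊕ρ≤β : ∀ {k} → k ℕ.≤ a → ι k ⊕ ρ ≤ β
  ι⊕ρ≤β {k} k≤a = subst (ι k ⊕ ρ ≤_) (sym β≡a⊕ρ) (+-monoˡ-≤ ρ (ι-mono-≤ k≤a))

  ι⊕ρ≤β⊖𝟙 : ∀ {k} → k ℕ.≤ a ℕ.∸ 1 → ι k ⊕ ρ ≤ β ⊕ ⊖ 𝟙
  ι⊕ρ≤β⊖𝟙 {k} k≤a-1 = subst (ι k ⊕ ρ ≤_) (sym β⊖𝟙≡a∸1⊕ρ) (+-monoˡ-≤ ρ (ι-mono-≤ k≤a-1))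

  ρ≤β⊖𝟙 : ρ ≤ β ⊕ ⊖ 𝟙
  ρ≤β⊖𝟙 = subst (_≤ β ⊕ ⊖ 𝟙) (⊕-identityˡ ρ) (ι⊕ρ≤β⊖𝟙 ℕ.z≤n)

  α·⊖𝟙 : α · ⊖ 𝟙 ≡ ρ
  α·⊖𝟙 = solve 1 (λ x → x :* (:- con 𝟙) := :- x) refl α

  α·β⊖𝟙 : α · (β ⊕ ⊖ 𝟙) ≡ ⊖ 𝟙 ⊕ ρ
  α·β⊖𝟙 = trans (·-distribˡ-⊕ α β (⊖ 𝟙)) (cong₂ _⊕_ α·β α·⊖𝟙)

  private
    horner-step : ∀ {k W} → k ℕ.≤ a → ⊖ 𝟙 < W → W < β → (k ≢ 0 → W < β ⊕ ⊖ 𝟙) →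
                  (⊖ 𝟙 < ι k ⊕ α · W) × (ι k ⊕ α · W < β) × (k ≢ a → ι k ⊕ α · W < β ⊕ ⊖ 𝟙)
    horner-step {zero} {W} _ -1<W W<β _ =
      subst (⊖ 𝟙 <_) (sym (⊕-identityˡ (α · W))) -1<αW , <-≤-trans αW<β-1 (<⇒≤ β⊖𝟙<β) , λ _ → αW<β-1
      where
      -1<αW : ⊖ 𝟙 < α · W
      -1<αW = subst (_< α · W) α·β (α·-anti-< W<β)
      αW<β-1 : 𝟘 ⊕ α · W < β ⊕ ⊖ 𝟙
      αW<β-1 = subst (_< β ⊕ ⊖ 𝟙) (sym (⊕-identityˡ (α · W))) (<-≤-trans (subst (α · W <_) α·⊖𝟙 (α·-anti-< -1<W)) ρ≤β⊖𝟙)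
      β⊖𝟙<β : β ⊕ ⊖ 𝟙 < β
      β⊖𝟙<β = subst (β ⊕ ⊖ 𝟙 <_) (⊕-identityʳ β) (+-monoʳ-< β ⊖𝟙<𝟘)
    horner-step {suc k} {W} 1+k≤a -1<W W<β W<β-1 = lower , <-≤-trans upper (ι⊕ρ≤β 1+k≤a) , refined
      where
      open ≤-Reasoning
      upper : ι (suc k) ⊕ α · W < ι (suc k) ⊕ ρ
      upper = +-monoʳ-< (ι (suc k)) (subst (α · W <_) α·⊖𝟙 (α·-anti-< -1<W))
      lower : ⊖ 𝟙 < ι (suc k) ⊕ α · W
      lower = begin-strict
        ⊖ 𝟙                        <⟨ <-trans ⊖𝟙<𝟘 0<ρ ⟩
        ρ                          ≡⟨ sym (⊕-identityˡ ρ) ⟩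
        𝟘 ⊕ ρ                      ≤⟨ +-monoˡ-≤ ρ (0≤ι k) ⟩
        ι k ⊕ ρ                    ≡⟨ solve 2 (λ x r → x :+ r := (x :+ con 𝟙) :+ (:- con 𝟙 :+ r)) refl (ι k) ρ ⟩
        (ι k ⊕ 𝟙) ⊕ (⊖ 𝟙 ⊕ ρ)      ≡⟨ cong (_⊕ (⊖ 𝟙 ⊕ ρ)) (sym (ι-suc k)) ⟩
        ι (suc k) ⊕ (⊖ 𝟙 ⊕ ρ)      <⟨ +-monoʳ-< (ι (suc k)) (subst (_< α · W) α·β⊖𝟙 (α·-anti-< (W<β-1 (λ ())))) ⟩
        ι (suc k) ⊕ α · W          ∎
      refined : suc k ≢ a → ι (suc k) ⊕ α · W < β ⊕ ⊖ 𝟙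
      refined 1+k≢a = <-≤-trans upper (ι⊕ρ≤β⊖𝟙 (ℕP.<⇒≤pred (ℕP.≤∧≢⇒< 1+k≤a 1+k≢a)))

  horner-bounds : ∀ {d} → Bounded d → Admissible d → ∀ L →
                  (⊖ 𝟙 < horner α d L) × (horner α d L < β) × (d 0 ≢ a → horner α d L < β ⊕ ⊖ 𝟙)
  horner-bounds bd ad zero = ⊖𝟙<𝟘 , 0<β , λ _ → <-≤-trans 0<ρ ρ≤β⊖𝟙
  horner-bounds {d} bd ad (suc L) with horner-bounds (Bounded-shift 1 bd) (Admissible-shift 1 ad) L
  ... | (-1<W , W<β , W<β-1) = horner-step (bd 0) -1<W W<β (λ d₀≢0 → W<β-1 (λ d₁≡a → d₀≢0 (ad 0 d₁≡a)))

  0≤ι·β^ : ∀ k t → 𝟘 ≤ ι k · β ^ t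
  0≤ι·β^ k t = 0≤· (0≤ι k) (≤-trans (inj₁ 0<𝟙) (1≤β^ t))

  0≤digitSumβ : ∀ d T → 𝟘 ≤ digitSum β d T
  0≤digitSumβ d zero = ≤-refl
  0≤digitSumβ d (suc T) = subst (_≤ digitSum β d (suc T)) (⊕-identityˡ 𝟘) (+-mono-≤ (0≤digitSumβ d T) (0≤ι·β^ (d T) T))

  private
    next-digit< : ∀ {V x} k → 𝟘 < x → V < x → V ⊕ ι k · x < ι (suc k) · x
    next-digit< {V} {x} k 0<x V<x = begin-strict
      V ⊕ ι k · x       <⟨ +-monoˡ-< (ι k · x) V<x ⟩
      x ⊕ ι k · x       ≡⟨ solve 2 (λ x c → x :+ c :* x := (c :+ con 𝟙) :* x) refl x (ι k) ⟩
      (ι k ⊕ 𝟙) · x     ≡⟨ cong (_· x) (sym (ι-suc k)) ⟩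
      ι (suc k) · x     ∎
      where open ≤-Reasoning

    0<β^ : ∀ t → 𝟘 < β ^ t
    0<β^ t = <-≤-trans 0<𝟙 (1≤β^ t)

  digitSumβ<β^ : ∀ {d} → Bounded d → Admissible d → ∀ T → digitSum β d T < β ^ T
  digitSumβ<β^ {d} bd ad T = proj₁ (pair T)
    where
    open ≤-Reasoning
    V : ℕ → ℤα
    V = digitSum β d
    pair : ∀ T → (V T < β ^ T) × (V (suc T) < β ^ suc T)
    pair zero = 0<𝟙 , (begin-strict
      𝟘 ⊕ ι (d 0) · 𝟙    ≡⟨ trans (⊕-identityˡ (ι (d 0) · 𝟙)) (·-identityʳ (ι (d 0))) ⟩
      ι (d 0)            ≤⟨ ι-mono-≤ (bd 0) ⟩
      ι a                <⟨ a<β ⟩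
      β                  ≡⟨ sym (·-identityʳ β) ⟩
      β · 𝟙              ∎)
    pair (suc T) with pair T
    ... | (V<β^ , V′<β^) = V′<β^ , next (d (suc T) ℕP.≟ a)
      where
      next : Dec (d (suc T) ≡ a) → V (suc (suc T)) < β ^ suc (suc T)
      next (yes d′≡a) = begin-strict
        V T ⊕ ι (d T) · β ^ T ⊕ ι (d (suc T)) · (β · β ^ T)   ≡⟨ cong₂ (λ x y → V T ⊕ ι x · β ^ T ⊕ ι y · (β · β ^ T)) (ad T d′≡a) d′≡a ⟩
        V T ⊕ 𝟘 · β ^ T ⊕ ι a · (β · β ^ T)                   ≡⟨ solve 4 (λ v b x p → v :+ con 𝟘 :* p :+ x :* (b :* p) := v :+ x :* b :* p) refl (V T) β (ι a) (β ^ T) ⟩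
        V T ⊕ ι a · β · β ^ T                                 <⟨ +-monoˡ-< (ι a · β · β ^ T) V<β^ ⟩
        β ^ T ⊕ ι a · β · β ^ T                               ≡⟨ solve 3 (λ x b p → p :+ x :* b :* p := (x :* b :+ con 𝟙) :* p) refl (ι a) β (β ^ T) ⟩
        (ι a · β ⊕ 𝟙) · β ^ T                                 ≡⟨ cong (_· β ^ T) (sym β·β) ⟩
        (β · β) · β ^ T                                       ≡⟨ ·-assoc β β (β ^ T) ⟩
        β ^ suc (suc T)                                       ∎
      next (no d′≢a) = begin-strict
        V (suc T) ⊕ ι (d (suc T)) · β ^ suc T      <⟨ next-digit< (d (suc T)) (0<β^ (suc T)) V′<β^ ⟩
        ι (suc (d (suc T))) · β ^ suc T            ≤⟨ ·-monoˡ-≤ (inj₁ (0<β^ (suc T))) (ι-mono-≤ (ℕP.≤∧≢⇒< (bd (suc T)) d′≢a)) ⟩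
        ι a · β ^ suc T                            ≤⟨ ·-monoˡ-≤ (inj₁ (0<β^ (suc T))) (inj₁ a<β) ⟩
        β ^ suc (suc T)                            ∎

  digitSumβ-greedy : ∀ {d d′} → Bounded d → Admissible d → ∀ T → d T ℕ.< d′ T → digitSum β d (suc T) < digitSum β d′ (suc T)
  digitSumβ-greedy {d} {d′} bd ad T d<d′ = begin-strict
    digitSum β d T ⊕ ι (d T) · β ^ T     <⟨ next-digit< (d T) (0<β^ T) (digitSumβ<β^ bd ad T) ⟩
    ι (suc (d T)) · β ^ T                ≤⟨ ·-monoˡ-≤ (inj₁ (0<β^ T)) (ι-mono-≤ d<d′) ⟩
    ι (d′ T) · β ^ T                     ≡⟨ sym (⊕-identityˡ (ι (d′ T) · β ^ T)) ⟩
    𝟘 ⊕ ι (d′ T) · β ^ T                 ≤⟨ +-monoˡ-≤ (ι (d′ T) · β ^ T) (0≤digitSumβ d′ T) ⟩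
    digitSum β d′ T ⊕ ι (d′ T) · β ^ T   ∎
    where open ≤-Reasoning

  digitSumβ-injective : ∀ {d d′} → Bounded d → Admissible d → Bounded d′ → Admissible d′ →
                        ∀ T → digitSum β d T ≡ digitSum β d′ T → ∀ t → t ℕ.< T → d t ≡ d′ t
  digitSumβ-injective {d} {d′} bd ad bd′ ad′ (suc T) V≡V′ t t<1+T with ℕP.<-cmp (d T) (d′ T)
  ... | tri< d<d′ _ _ = ⊥-elim (<-irrefl (subst (_< digitSum β d′ (suc T)) V≡V′ (digitSumβ-greedy bd ad T d<d′)))
  ... | tri> _ _ d′<d = ⊥-elim (<-irrefl (subst (digitSum β d′ (suc T) <_) V≡V′ (digitSumβ-greedy bd′ ad′ T d′<d)))
  ... | tri≈ _ dT≡d′T _ with ℕP.m≤n⇒m<n∨m≡n (ℕP.≤-pred t<1+T)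
  ...   | inj₂ refl = dT≡d′T
  ...   | inj₁ t<T = digitSumβ-injective bd ad bd′ ad′ T (cancel V≡V′) t t<T
    where
    cancel : ∀ {u v} → u ⊕ ι (d T) · β ^ T ≡ v ⊕ ι (d′ T) · β ^ T → u ≡ v
    cancel {u} {v} e = begin
      u                                               ≡⟨ solve 2 (λ u c → u := u :+ c :- c) refl u (ι (d T) · β ^ T) ⟩
      u ⊕ ι (d T) · β ^ T ⊕ ⊖ (ι (d T) · β ^ T)       ≡⟨ cong₂ (λ x y → x ⊕ ⊖ (ι y · β ^ T)) e dT≡d′T ⟩
      v ⊕ ι (d′ T) · β ^ T ⊕ ⊖ (ι (d′ T) · β ^ T)     ≡⟨ solve 2 (λ u c → u :+ c :- c := u) refl v (ι (d′ T) · β ^ T) ⟩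
      v                                               ∎
      where open ≡-Reasoning

module Remainders (a : ℕ) (1≤a : 1 ℕ.≤ a) where
  open Ring a
  open Order a 1≤a
  open DigitSums a 1≤a
  open ℤα-Solver using (solve; _:=_; _:+_; _:-_; _:*_; :-_; con)

  -- Writing y = digitSum α d T + αᵀ r, the remainder r has to be expanded by the digits d T, d (T+1), ….
  remainder : ℤα → Dig → ℕ → ℤα
  remainder y d T = (y ⊕ ⊖ digitSum α d T) · α⁻¹ ^ T

  α^·α⁻¹^ : ∀ t → α ^ t · α⁻¹ ^ t ≡ 𝟙
  α^·α⁻¹^ t = ^-inverse t α·α⁻¹

  remainder-split : ∀ y d T → y ≡ digitSum α d T ⊕ α ^ T · remainder y d T
  remainder-split y d T = begin
    y                                              ≡⟨ solve 2 (λ y u → y := u :+ (y :- u) :* con 𝟙) refl y U ⟩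
    U ⊕ (y ⊕ ⊖ U) · 𝟙                              ≡⟨ cong (λ t → U ⊕ (y ⊕ ⊖ U) · t) (sym (α^·α⁻¹^ T)) ⟩
    U ⊕ (y ⊕ ⊖ U) · (α ^ T · α⁻¹ ^ T)              ≡⟨ solve 4 (λ y u p q → u :+ (y :- u) :* (p :* q) := u :+ p :* ((y :- u) :* q))
                                                        refl y U (α ^ T) (α⁻¹ ^ T) ⟩
    U ⊕ α ^ T · remainder y d T                    ∎
    where
    open ≡-Reasoning
    U : ℤα
    U = digitSum α d T

  remainder-next : ∀ y d T → remainder y d (suc T) ≡ (remainder y d T ⊕ ⊖ ι (d T)) · α⁻¹
  remainder-next y d T = begin
    (y ⊕ ⊖ (U ⊕ c · p)) · (α⁻¹ · q)          ≡⟨ solve 6 (λ y u c p q b → (y :- (u :+ c :* p)) :* (b :* q) := ((y :- u) :* q :- c :* (p :* q)) :* b)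
                                                  refl y U c p q α⁻¹ ⟩
    ((y ⊕ ⊖ U) · q ⊕ ⊖ (c · (p · q))) · α⁻¹  ≡⟨ cong (λ t → ((y ⊕ ⊖ U) · q ⊕ ⊖ (c · t)) · α⁻¹) (α^·α⁻¹^ T) ⟩
    ((y ⊕ ⊖ U) · q ⊕ ⊖ (c · 𝟙)) · α⁻¹        ≡⟨ cong (λ t → ((y ⊕ ⊖ U) · q ⊕ ⊖ t) · α⁻¹) (·-identityʳ c) ⟩
    (remainder y d T ⊕ ⊖ c) · α⁻¹            ∎
    where
    open ≡-Reasoning
    U : ℤα
    U = digitSum α d T
    c : ℤα
    c = ι (d T)
    p : ℤα
    p = α ^ T
    q : ℤα
    q = α⁻¹ ^ T

  remainder-step : ∀ y d T → remainder y d T ≡ ι (d T) ⊕ α · remainder y d (suc T)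
  remainder-step y d T = begin
    R                                  ≡⟨ solve 2 (λ r c → r := c :+ (r :- c) :* con 𝟙) refl R c ⟩
    c ⊕ (R ⊕ ⊖ c) · 𝟙                  ≡⟨ cong (λ t → c ⊕ (R ⊕ ⊖ c) · t) (sym α·α⁻¹) ⟩
    c ⊕ (R ⊕ ⊖ c) · (α · α⁻¹)          ≡⟨ solve 4 (λ r c x y → c :+ (r :- c) :* (x :* y) := c :+ x :* ((r :- c) :* y)) refl R c α α⁻¹ ⟩
    c ⊕ α · ((R ⊕ ⊖ c) · α⁻¹)          ≡⟨ cong (λ t → c ⊕ α · t) (sym (remainder-next y d T)) ⟩
    c ⊕ α · remainder y d (suc T)      ∎
    where
    open ≡-Reasoning
    R : ℤα
    R = remainder y d T
    c : ℤα
    c = ι (d T)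

  conj-remainder : ∀ y d T → conj (remainder y d T) ≡ (conj y ⊕ ⊖ digitSum β d T) · ρ ^ T
  conj-remainder y d T = begin
    conj ((y ⊕ ⊖ U) · α⁻¹ ^ T)                 ≡⟨ conj-· (y ⊕ ⊖ U) (α⁻¹ ^ T) ⟩
    conj (y ⊕ ⊖ U) · conj (α⁻¹ ^ T)            ≡⟨ cong₂ _·_ (trans (conj-⊕ y (⊖ U)) (cong (conj y ⊕_) (conj-⊖ U)))
                                                             (trans (conj-^ α⁻¹ T) (cong (_^ T) conj-α⁻¹)) ⟩
    (conj y ⊕ ⊖ conj U) · ρ ^ T                ≡⟨ cong (λ v → (conj y ⊕ ⊖ v) · ρ ^ T) (conj-digitSum d T) ⟩
    (conj y ⊕ ⊖ digitSum β d T) · ρ ^ T        ∎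
    where
    open ≡-Reasoning
    U : ℤα
    U = digitSum α d T

  conj-remainder<0 : ∀ y d T → conj y < 𝟘 → conj (remainder y d T) < 𝟘
  conj-remainder<0 y d T conj-y<0 = begin-strict
    conj (remainder y d T)                ≡⟨ conj-remainder y d T ⟩
    (conj y ⊕ ⊖ digitSum β d T) · ρ ^ T   <⟨ ·-monoˡ-< (0<ρ^ T) (+-mono-<-≤ conj-y<0 (⊖-mono-≤ (0≤digitSumβ d T))) ⟩
    𝟘 · ρ ^ T                             ≡⟨ solve 1 (λ x → con 𝟘 :* x := con 𝟘) refl (ρ ^ T) ⟩
    𝟘                                     ∎
    where open ≤-Reasoning

  conj-remainder> : ∀ y {d} → Bounded d → Admissible d → ∀ T → ⊖ 𝟙 ⊕ conj y · ρ ^ T < conj (remainder y d T)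
  conj-remainder> y {d} bd ad T = begin-strict
    ⊖ 𝟙 ⊕ conj y · ρ ^ T                  ≡⟨ cong (λ t → ⊖ t ⊕ conj y · ρ ^ T) (sym (β^·ρ^ T)) ⟩
    ⊖ (β ^ T · ρ ^ T) ⊕ conj y · ρ ^ T    ≡⟨ solve 3 (λ b r x → :- (b :* r) :+ x :* r := (x :- b) :* r) refl (β ^ T) (ρ ^ T) (conj y) ⟩
    (conj y ⊕ ⊖ β ^ T) · ρ ^ T            <⟨ ·-monoˡ-< (0<ρ^ T) (+-monoʳ-< (conj y) (⊖-mono-< (digitSumβ<β^ bd ad T))) ⟩
    (conj y ⊕ ⊖ digitSum β d T) · ρ ^ T   ≡⟨ sym (conj-remainder y d T) ⟩
    conj (remainder y d T)                ∎
    where open ≤-Reasoning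

  conj-remainder-eventually : ∀ y {d} → conj y < 𝟘 → Bounded d → Admissible d →
    Eventually (λ T → (⊖ 𝟙 ⊕ ⊖ ρ < conj (remainder y d T)) × (conj (remainder y d T) < 𝟘))
  conj-remainder-eventually y {d} conj-y<0 bd ad = T₀ , λ T T₀≤T →
    <-trans (+-monoʳ-< (⊖ 𝟙) (⊖ρ< T T₀≤T)) (conj-remainder> y bd ad T) , conj-remainder<0 y d T conj-y<0
    where
    T₀ : ℕ
    T₀ = proj₁ (ρ^-eventually-small (⊖ conj y))
    ⊖ρ< : ∀ T → T₀ ℕ.≤ T → ⊖ ρ < conj y · ρ ^ T
    ⊖ρ< T T₀≤T = subst (⊖ ρ <_) (solve 2 (λ x r → :- ((:- x) :* r) := x :* r) refl (conj y) (ρ ^ T))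
                   (⊖-mono-< (proj₂ (ρ^-eventually-small (⊖ conj y)) T T₀≤T))

  Cyclic : ℤα → Set
  Cyclic r = r ≡ ⊖ 𝟙 ⊎ r ≡ β

  CyclicFrom : ℤα → Dig → ℕ → Set
  CyclicFrom y d T₀ = ∀ T → T₀ ℕ.≤ T → Cyclic (remainder y d T)

  CycleStep : ℤα → ℕ → ℤα → Set
  CycleStep r k r′ = (r ≡ ⊖ 𝟙 × k ≡ 0 × r′ ≡ β) ⊎ (r ≡ β × k ≡ a × r′ ≡ ⊖ 𝟙)

  private
    γ : ℤα
    γ = β ⊕ ρ

    1<γ : 𝟙 < γ
    1<γ = <-trans 1<β (subst (_< γ) (⊕-identityʳ β) (+-monoʳ-< β 0<ρ))

    r⊖conj-r : ∀ p q → ⟨ p , q ⟩ ⊕ ⊖ conj ⟨ p , q ⟩ ≡ fromℤ (- q) · γ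
    r⊖conj-r p q = cong₂ ⟨_,_⟩ (re-eq (+ a) p q) (im-eq (+ a) q)
      where
      re-eq : ∀ A p q → p + - (p + q * A) ≡ (- q) * (A + (- + 0)) + + 0 * ((- + 1) + (- + 1))
      re-eq = solve-∀
      im-eq : ∀ A q → q + - - q ≡ (- q) * ((- + 1) + (- + 1)) + + 0 * (A + (- + 0)) + + 0 * ((- + 1) + (- + 1)) * A
      im-eq = solve-∀

    multiple-of-γ : ∀ k → ⊖ 𝟙 < fromℤ k · γ → fromℤ k · γ < γ ⊕ 𝟙 → k ≡ + 0 ⊎ k ≡ + 1
    multiple-of-γ (+ zero) _ _ = inj₁ refl
    multiple-of-γ (+ suc zero) _ _ = inj₂ refl
    multiple-of-γ (+ suc (suc j)) _ kγ<γ+1 = ⊥-elim (<-asym kγ<γ+1 (begin-strict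
      γ ⊕ 𝟙                   <⟨ +-monoʳ-< γ 1<γ ⟩
      γ ⊕ γ                   ≡⟨ solve 1 (λ g → g :+ g := (con 𝟙 :+ con 𝟙) :* g) refl γ ⟩
      ι 2 · γ                 ≤⟨ ·-monoˡ-≤ (inj₁ (<-trans 0<𝟙 1<γ)) (ι-mono-≤ {2} {suc (suc j)} (ℕ.s≤s (ℕ.s≤s ℕ.z≤n))) ⟩
      ι (suc (suc j)) · γ     ∎))
      where open ≤-Reasoning
    multiple-of-γ -[1+ j ] -1<kγ _ = ⊥-elim (<-asym -1<kγ (begin-strict
      fromℤ -[1+ j ] · γ      ≡⟨ solve 2 (λ k g → (:- k) :* g := :- (k :* g)) refl (ι (suc j)) γ ⟩
      ⊖ (ι (suc j) · γ)       ≤⟨ ⊖-mono-≤ (subst (_≤ ι (suc j) · γ) (·-identityˡ γ) (·-monoˡ-≤ (inj₁ (<-trans 0<𝟙 1<γ)) (1≤ι j))) ⟩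
      ⊖ γ                     <⟨ ⊖-mono-< 1<γ ⟩
      ⊖ 𝟙                     ∎))
      where open ≤-Reasoning

    ⊕-cancelʳ-< : ∀ {x y} z → x ⊕ z < y ⊕ z → x < y
    ⊕-cancelʳ-< {x} {y} z x+z<y+z = subst₂ _<_ (cancel x) (cancel y) (+-monoˡ-< (⊖ z) x+z<y+z)
      where
      cancel : ∀ x → x ⊕ z ⊕ ⊖ z ≡ x
      cancel x = solve 2 (λ x z → x :+ z :- z := x) refl x z

    -1<k<1 : ∀ {k} → -[1+ 0 ] ℤ.< k → k ℤ.< + 1 → k ≡ + 0
    -1<k<1 {+ zero} _ _ = refl
    -1<k<1 {+ suc k} _ (+<+ (ℕ.s≤s ()))
    -1<k<1 { -[1+ k ]} (-<- ()) _

    -2<k<0 : ∀ {k} → -[1+ 1 ] ℤ.< k → k ℤ.< + 0 → k ≡ -[1+ 0 ]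
    -2<k<0 { -[1+ zero ]} _ _ = refl
    -2<k<0 { -[1+ suc k ]} (-<- (ℕ.s≤s ())) _
    -2<k<0 {+ k} _ (+<+ ())

    integer-point : ∀ p → ⊖ 𝟙 ⊕ ⊖ ρ < conj (fromℤ p) → conj (fromℤ p) < 𝟘 → p ≡ -[1+ 0 ]
    integer-point p lo hi = -2<k<0 (fromℤ-cancel-< (<-trans -2<-1-ρ (subst (⊖ 𝟙 ⊕ ⊖ ρ <_) (conj-fromℤ p) lo)))
                                   (fromℤ-cancel-< (subst (_< 𝟘) (conj-fromℤ p) hi))
      where
      -2<-1-ρ : fromℤ -[1+ 1 ] < ⊖ 𝟙 ⊕ ⊖ ρ
      -2<-1-ρ = +-monoʳ-< (⊖ 𝟙) (⊖-mono-< ρ<1)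

    β-point : ∀ p → ⊖ 𝟙 ⊕ ⊖ ρ < conj ⟨ p , -[1+ 0 ] ⟩ → conj ⟨ p , -[1+ 0 ] ⟩ < 𝟘 → p ≡ + a
    β-point p lo hi = trans (sym (eq₂ p (+ a))) (cong (_+ + a) (-1<k<1 -1<k k<1))
      where
      k : ℤ
      k = p - + a
      eq₁ : ∀ A p → p + -[1+ 0 ] * A ≡ p - A + + 0
      eq₁ = solve-∀
      eq₂ : ∀ p A → p - A + A ≡ p
      eq₂ = solve-∀
      conj≡ : conj ⟨ p , -[1+ 0 ] ⟩ ≡ fromℤ k ⊕ ⊖ ρ
      conj≡ = cong₂ ⟨_,_⟩ (eq₁ (+ a) p) refl
      -1<k : -[1+ 0 ] ℤ.< k
      -1<k = fromℤ-cancel-< (⊕-cancelʳ-< (⊖ ρ) (subst (⊖ 𝟙 ⊕ ⊖ ρ <_) conj≡ lo))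
      k<1 : k ℤ.< + 1
      k<1 = fromℤ-cancel-< (<-trans (⊕-cancelʳ-< (⊖ ρ) (subst₂ _<_ conj≡ (sym (⊖-inverseʳ ρ)) hi)) ρ<1)

  private
    r⊖conj-r-bounds : ∀ r → ⊖ 𝟙 ≤ r → r ≤ β → ⊖ 𝟙 ⊕ ⊖ ρ < conj r → conj r < 𝟘 →
                      (⊖ 𝟙 < r ⊕ ⊖ conj r) × (r ⊕ ⊖ conj r < γ ⊕ 𝟙)
    r⊖conj-r-bounds r -1≤r r≤β lo hi =
      subst (_< r ⊕ ⊖ conj r) (⊕-identityʳ (⊖ 𝟙)) (+-mono-≤-< -1≤r (⊖-mono-< hi)) ,
      subst (r ⊕ ⊖ conj r <_) (eq β ρ) (+-mono-≤-< r≤β (⊖-mono-< lo))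
      where
      eq : ∀ b r → b ⊕ ⊖ (⊖ 𝟙 ⊕ ⊖ r) ≡ (b ⊕ r) ⊕ 𝟙
      eq = solve 2 (λ b r → b :- (:- con 𝟙 :- r) := (b :+ r) :+ con 𝟙) refl

    points : ∀ p q → (- q ≡ + 0 ⊎ - q ≡ + 1) → ⊖ 𝟙 ⊕ ⊖ ρ < conj ⟨ p , q ⟩ → conj ⟨ p , q ⟩ < 𝟘 → Cyclic ⟨ p , q ⟩
    points p (+ zero) _ lo hi = inj₁ (cong (λ t → ⟨ t , + 0 ⟩) (integer-point p lo hi))
    points p -[1+ zero ] _ lo hi = inj₂ (cong (λ t → ⟨ t , -[1+ 0 ] ⟩) (β-point p lo hi))
    points p (+ suc k) (inj₁ ()) _ _
    points p (+ suc k) (inj₂ ()) _ _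
    points p -[1+ suc k ] (inj₁ ()) _ _
    points p -[1+ suc k ] (inj₂ ()) _ _

  window-points : ∀ r → ⊖ 𝟙 ≤ r → r ≤ β → ⊖ 𝟙 ⊕ ⊖ ρ < conj r → conj r < 𝟘 → Cyclic r
  window-points ⟨ p , q ⟩ -1≤r r≤β lo hi = points p q (multiple-of-γ (- q) lower upper) lo hi
    where
    lower : ⊖ 𝟙 < fromℤ (- q) · γ
    lower = subst (⊖ 𝟙 <_) (r⊖conj-r p q) (proj₁ (r⊖conj-r-bounds ⟨ p , q ⟩ -1≤r r≤β lo hi))
    upper : fromℤ (- q) · γ < γ ⊕ 𝟙
    upper = subst (_< γ ⊕ 𝟙) (r⊖conj-r p q) (proj₂ (r⊖conj-r-bounds ⟨ p , q ⟩ -1≤r r≤β lo hi))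

  private
    ι⊕α·-components : ∀ k r → ι k ⊕ α · r ≡ ⟨ + k + im r , re r + im r * + a ⟩
    ι⊕α·-components k ⟨ m , n ⟩ = cong₂ ⟨_,_⟩ (cong (_+_ (+ k)) (eq₁ m n)) (trans (ℤP.+-identityˡ _) (eq₂ (+ a) m n))
      where
      eq₁ : ∀ m n → + 0 * m + + 1 * n ≡ n
      eq₁ = solve-∀
      eq₂ : ∀ A m n → + 0 * n + + 1 * m + + 1 * n * A ≡ m + n * A
      eq₂ = solve-∀

    -1≢β : ⊖ 𝟙 ≢ β
    -1≢β e with cong im e
    ... | ()

  cyclic-step : ∀ {k r r′} → r ≡ ι k ⊕ α · r′ → Cyclic r → Cyclic r′ → CycleStep r k r′
  cyclic-step {k} e (inj₁ refl) (inj₁ refl) with trans (cong im e) (cong im (ι⊕α·-components k (⊖ 𝟙)))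
  ... | ()
  cyclic-step {k} e (inj₁ refl) (inj₂ refl) = inj₁ (refl , k≡0 (sym (trans (cong re e) (cong re (ι⊕α·-components k β)))) , refl)
    where
    k≡0 : ∀ {k} → + k + - + 1 ≡ - + 1 → k ≡ 0
    k≡0 {zero} _ = refl
    k≡0 {suc k} ()
  cyclic-step {k} e (inj₂ refl) (inj₁ refl) =
    inj₂ (refl , sym (ℤP.+-injective (trans (cong re e) (trans (cong re (ι⊕α·-components k (⊖ 𝟙))) (ℤP.+-identityʳ (+ k))))) , refl)
  cyclic-step {k} e (inj₂ refl) (inj₂ refl) with trans (cong im e) (trans (cong im (ι⊕α·-components k β)) (eq (+ a)))
    where
    eq : ∀ A → A + - + 1 * A ≡ + 0
    eq = solve-∀
  ... | ()

  cyclic-determined : ∀ {k k′ r r′ s s′} → r ≡ ι k ⊕ α · s → r′ ≡ ι k′ ⊕ α · s′ →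
                      Cyclic r → Cyclic s → Cyclic r′ → Cyclic s′ → r ≡ r′ → k ≡ k′ × s ≡ s′
  cyclic-determined e e′ cr cs cr′ cs′ r≡r′ with cyclic-step e cr cs | cyclic-step e′ cr′ cs′
  ... | inj₁ (_ , k≡0 , s≡β) | inj₁ (_ , k′≡0 , s′≡β) = trans k≡0 (sym k′≡0) , trans s≡β (sym s′≡β)
  ... | inj₂ (_ , k≡a , s≡-1) | inj₂ (_ , k′≡a , s′≡-1) = trans k≡a (sym k′≡a) , trans s≡-1 (sym s′≡-1)
  ... | inj₁ (r≡-1 , _) | inj₂ (r′≡β , _) = ⊥-elim (-1≢β (trans (sym r≡-1) (trans r≡r′ r′≡β)))
  ... | inj₂ (r≡β , _) | inj₁ (r′≡-1 , _) = ⊥-elim (-1≢β (trans (sym r′≡-1) (trans (sym r≡r′) r≡β)))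

  remainder-injective : ∀ y d d′ T → remainder y d T ≡ remainder y d′ T → digitSum α d T ≡ digitSum α d′ T
  remainder-injective y d d′ T R≡R′ = begin
    digitSum α d T                                  ≡⟨ solve 2 (λ u w → u := u :+ w :- w) refl (digitSum α d T) (α ^ T · remainder y d T) ⟩
    digitSum α d T ⊕ α ^ T · R ⊕ ⊖ (α ^ T · R)      ≡⟨ cong (_⊕ ⊖ (α ^ T · R)) (sym (remainder-split y d T)) ⟩
    y ⊕ ⊖ (α ^ T · R)                               ≡⟨ cong₂ (λ u r → u ⊕ ⊖ (α ^ T · r)) (remainder-split y d′ T) R≡R′ ⟩
    digitSum α d′ T ⊕ α ^ T · R′ ⊕ ⊖ (α ^ T · R′)   ≡⟨ solve 2 (λ u w → u :+ w :- w := u) refl (digitSum α d′ T) (α ^ T · R′) ⟩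
    digitSum α d′ T                                 ∎
    where
    open ≡-Reasoning
    R : ℤα
    R = remainder y d T
    R′ : ℤα
    R′ = remainder y d′ T

  cyclic-remainders-agree : ∀ y {d d′} T₀ → CyclicFrom y d T₀ → CyclicFrom y d′ T₀ → remainder y d T₀ ≡ remainder y d′ T₀ → ∀ j → remainder y d (T₀ ℕ.+ j) ≡ remainder y d′ (T₀ ℕ.+ j) × d (T₀ ℕ.+ j) ≡ d′ (T₀ ℕ.+ j)
  cyclic-remainders-agree y {d} {d′} T₀ cyc cyc′ R≡R′ = agree
    where
    step : ∀ T → T₀ ℕ.≤ T → remainder y d T ≡ remainder y d′ T → d T ≡ d′ T × remainder y d (suc T) ≡ remainder y d′ (suc T)
    step T T₀≤T = cyclic-determined (remainder-step y d T) (remainder-step y d′ T)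
      (cyc T T₀≤T) (cyc (suc T) (ℕP.m≤n⇒m≤1+n T₀≤T)) (cyc′ T T₀≤T) (cyc′ (suc T) (ℕP.m≤n⇒m≤1+n T₀≤T))
    R-agree : ∀ j → remainder y d (T₀ ℕ.+ j) ≡ remainder y d′ (T₀ ℕ.+ j)
    R-agree zero = subst (λ t → remainder y d t ≡ remainder y d′ t) (sym (ℕP.+-identityʳ T₀)) R≡R′
    R-agree (suc j) = subst (λ t → remainder y d t ≡ remainder y d′ t) (sym (ℕP.+-suc T₀ j))
                        (proj₂ (step (T₀ ℕ.+ j) (ℕP.m≤m+n T₀ j) (R-agree j)))
    agree : ∀ j → remainder y d (T₀ ℕ.+ j) ≡ remainder y d′ (T₀ ℕ.+ j) × d (T₀ ℕ.+ j) ≡ d′ (T₀ ℕ.+ j)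
    agree j = R-agree j , proj₁ (step (T₀ ℕ.+ j) (ℕP.m≤m+n T₀ j) (R-agree j))

  cyclic-expansions-unique : ∀ y {d d′} → Bounded d → Admissible d → Bounded d′ → Admissible d′ → ∀ T₀ →
    CyclicFrom y d T₀ → CyclicFrom y d′ T₀ → remainder y d T₀ ≡ remainder y d′ T₀ → ∀ t → d t ≡ d′ t
  cyclic-expansions-unique y {d} {d′} bd ad bd′ ad′ T₀ cyc cyc′ R≡R′ t with ℕP.<-≤-connex t T₀
  ... | inj₁ t<T₀ = digitSumβ-injective bd ad bd′ ad′ T₀ V≡V′ t t<T₀
    where
    V≡V′ : digitSum β d T₀ ≡ digitSum β d′ T₀
    V≡V′ = trans (sym (conj-digitSum d T₀)) (trans (cong conj (remainder-injective y d d′ T₀ R≡R′)) (conj-digitSum d′ T₀))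
  ... | inj₂ T₀≤t =
    subst (λ s → d s ≡ d′ s) (ℕP.m+[n∸m]≡n T₀≤t) (proj₂ (cyclic-remainders-agree y T₀ cyc cyc′ R≡R′ (t ℕ.∸ T₀)))

  cyclic-digits-alternate : ∀ y {d} T₀ → CyclicFrom y d T₀ → ∀ T → T₀ ℕ.≤ T → A0Pair (d T) (d (suc T))
  cyclic-digits-alternate y {d} T₀ cyc T T₀≤T = combine (step T T₀≤T) (step (suc T) (ℕP.m≤n⇒m≤1+n T₀≤T))
    where
    step : ∀ T → T₀ ℕ.≤ T → CycleStep (remainder y d T) (d T) (remainder y d (suc T))
    step T T₀≤T = cyclic-step (remainder-step y d T) (cyc T T₀≤T) (cyc (suc T) (ℕP.m≤n⇒m≤1+n T₀≤T))
    combine : ∀ {r₀ r₁ r₂ k₀ k₁} → CycleStep r₀ k₀ r₁ → CycleStep r₁ k₁ r₂ → A0Pair k₀ k₁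
    combine (inj₁ (_ , k₀≡0 , _)) (inj₂ (_ , k₁≡a , _)) = inj₂ (k₀≡0 , k₁≡a)
    combine (inj₂ (_ , k₀≡a , _)) (inj₁ (_ , k₁≡0 , _)) = inj₁ (k₀≡a , k₁≡0)
    combine (inj₁ (_ , _ , r₁≡β)) (inj₁ (r₁≡-1 , _)) = ⊥-elim (-1≢β (trans (sym r₁≡-1) r₁≡β))
    combine (inj₂ (_ , _ , r₁≡-1)) (inj₂ (r₁≡β , _)) = ⊥-elim (-1≢β (trans (sym r₁≡-1) r₁≡β))

module Convergence (a : ℕ) (1≤a : 1 ℕ.≤ a) where
  open Ring a
  open Order a 1≤a
  open DigitSums a 1≤a
  open Remainders a 1≤a
  open ℤα-Solver using (solve; _:=_; _:+_; _:-_; _:*_; :-_; con)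

  infix 4 _≡±_
  _≡±_ : ℤα → ℤα → Set
  x ≡± y = x ≡ y ⊎ x ≡ ⊖ y

  ≡±-· : ∀ {x x₊ y y₊} → x ≡± x₊ → y ≡± y₊ → x · y ≡± x₊ · y₊
  ≡±-· (inj₁ refl) (inj₁ refl) = inj₁ refl
  ≡±-· {x₊ = x₊} {y₊ = y₊} (inj₁ refl) (inj₂ refl) = inj₂ (solve 2 (λ x y → x :* (:- y) := :- (x :* y)) refl x₊ y₊)
  ≡±-· {x₊ = x₊} {y₊ = y₊} (inj₂ refl) (inj₁ refl) = inj₂ (solve 2 (λ x y → (:- x) :* y := :- (x :* y)) refl x₊ y₊)
  ≡±-· {x₊ = x₊} {y₊ = y₊} (inj₂ refl) (inj₂ refl) = inj₁ (solve 2 (λ x y → (:- x) :* (:- y) := x :* y) refl x₊ y₊)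

  ≡±-⊖ : ∀ {x y} → x ≡± y → ⊖ x ≡± y
  ≡±-⊖ (inj₁ refl) = inj₂ refl
  ≡±-⊖ {y = y} (inj₂ refl) = inj₁ (solve 1 (λ y → :- (:- y) := y) refl y)

  ⊖^≡± : ∀ x t → (⊖ x) ^ t ≡± x ^ t
  ⊖^≡± x zero = inj₁ refl
  ⊖^≡± x (suc t) = ≡±-· {x = ⊖ x} {x₊ = x} (inj₂ refl) (⊖^≡± x t)

  AbsLt-≡± : ∀ {x y ε} → x ≡± y → AbsLt x ε → AbsLt y ε
  AbsLt-≡± (inj₁ refl) h = h
  AbsLt-≡± {y = y} {ε} (inj₂ refl) h = subst (λ t → AbsLt t ε) (solve 1 (λ y → :- (:- y) := y) refl y) (AbsLt-⊖ h)

  -- Digit d t sits at position t − K, so the partial sums are α⁻ᴷ · digitSum α d (M + 1); the remainders are those of αᴷ z.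
  Converges : ℤα → Dig → ℕ → Set
  Converges z d K = ∀ n → Eventually (λ M → AbsLtInv a (α⁻¹ ^ K · digitSum α d (suc M) ⊕ ⊖ z) n)

  partial-sum-error : ∀ z d K T L →
    α⁻¹ ^ K · digitSum α d (T ℕ.+ L) ⊕ ⊖ z ≡± β ^ K · ρ ^ T · (remainder (α ^ K · z) d T ⊕ ⊖ horner α (shift T d) L)
  partial-sum-error z d K T L =
    subst (_≡± β ^ K · ρ ^ T · (R ⊕ ⊖ W)) (sym error≡) (≡±-⊖ (≡±-· (≡±-· (⊖^≡± β K) (⊖^≡± ρ T)) (inj₁ refl)))
    where
    open ≡-Reasoning
    y : ℤα
    y = α ^ K · z
    U : ℤα
    U = digitSum α d T
    R : ℤα
    R = remainder y d T
    W : ℤα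
    W = horner α (shift T d) L
    z≡ : z ≡ α⁻¹ ^ K · y
    z≡ = begin
      z                       ≡⟨ sym (·-identityˡ z) ⟩
      𝟙 · z                   ≡⟨ cong (_· z) (sym (trans (·-comm (α⁻¹ ^ K) (α ^ K)) (α^·α⁻¹^ K))) ⟩
      (α⁻¹ ^ K · α ^ K) · z   ≡⟨ ·-assoc (α⁻¹ ^ K) (α ^ K) z ⟩
      α⁻¹ ^ K · y             ∎
    error≡ : α⁻¹ ^ K · digitSum α d (T ℕ.+ L) ⊕ ⊖ z ≡ ⊖ ((α⁻¹ ^ K · α ^ T) · (R ⊕ ⊖ W))
    error≡ = begin
      α⁻¹ ^ K · digitSum α d (T ℕ.+ L) ⊕ ⊖ z          ≡⟨ cong₂ (λ u v → α⁻¹ ^ K · u ⊕ ⊖ v)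
                                                           (trans (digitSum-split α d T L) (cong (λ t → U ⊕ α ^ T · t) (digitSum≡horner α (shift T d) L)))
                                                           (trans z≡ (cong (α⁻¹ ^ K ·_) (remainder-split y d T))) ⟩
      α⁻¹ ^ K · (U ⊕ α ^ T · W) ⊕ ⊖ (α⁻¹ ^ K · (U ⊕ α ^ T · R))
        ≡⟨ solve 5 (λ k p u w r → k :* (u :+ p :* w) :- k :* (u :+ p :* r) := :- ((k :* p) :* (r :- w))) refl (α⁻¹ ^ K) (α ^ T) U W R ⟩
      ⊖ ((α⁻¹ ^ K · α ^ T) · (R ⊕ ⊖ W))               ∎

  ≡±-sym : ∀ {x y} → x ≡± y → y ≡± x
  ≡±-sym (inj₁ refl) = inj₁ refl
  ≡±-sym {y = y} (inj₂ refl) = inj₂ (solve 1 (λ y → y := :- (:- y)) refl y)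

  private
    AbsLt-between : ∀ {k r} → 𝟘 ≤ k → ⊖ 𝟙 ≤ r → r ≤ β → k · β < 𝟙 → AbsLt (k · r) 𝟙
    AbsLt-between {k} {r} 0≤k -1≤r r≤β kβ<1 = ≤-<-trans (·-monoʳ-≤ 0≤k r≤β) kβ<1 , (begin-strict
      ⊖ (k · r)      ≡⟨ solve 2 (λ k r → :- (k :* r) := k :* (:- r)) refl k r ⟩
      k · ⊖ r        ≤⟨ ·-monoʳ-≤ 0≤k (subst (⊖ r ≤_) (solve 0 (:- (:- con 𝟙) := con 𝟙) refl) (⊖-mono-≤ -1≤r)) ⟩
      k · 𝟙          ≤⟨ ·-monoʳ-≤ 0≤k (inj₁ 1<β) ⟩
      k · β          <⟨ kβ<1 ⟩
      𝟙              ∎)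
      where open ≤-Reasoning

    0<β^·ρ^ : ∀ K T → 𝟘 < β ^ K · ρ ^ T
    0<β^·ρ^ K T = 0<· (<-≤-trans 0<𝟙 (1≤β^ K)) (0<ρ^ T)

  bounded⇒converges : ∀ z d K → (∀ T → (⊖ 𝟙 ≤ remainder (α ^ K · z) d T) × (remainder (α ^ K · z) d T ≤ β)) → Converges z d K
  bounded⇒converges z d K bounds n = T₀ , λ M T₀≤M →
    AbsLt⇒AbsLtInv (α⁻¹ ^ K · digitSum α d (suc M) ⊕ ⊖ z) n (AbsLt-≡± (≡±-sym (error≡± M))
      (AbsLt-between (0≤k (suc M)) (proj₁ (bounds (suc M))) (proj₂ (bounds (suc M))) (kβ<1 (suc M) (ℕP.m≤n⇒m≤1+n T₀≤M))))
    where
    c : ℤα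
    c = ι (suc n) · (β ^ K · β)
    T₀ : ℕ
    T₀ = proj₁ (ρ^-eventually-small c)
    k : ℕ → ℤα
    k T = ι (suc n) · (β ^ K · ρ ^ T)
    0≤k : ∀ T → 𝟘 ≤ k T
    0≤k T = 0≤· (0≤ι (suc n)) (inj₁ (0<β^·ρ^ K T))
    kβ<1 : ∀ T → T₀ ℕ.≤ T → k T · β < 𝟙
    kβ<1 T T₀≤T = <-trans (subst (_< ρ) (solve 4 (λ m b r β → m :* (b :* β) :* r := m :* (b :* r) :* β) refl (ι (suc n)) (β ^ K) (ρ ^ T) β)
                                  (proj₂ (ρ^-eventually-small c) T T₀≤T)) ρ<1
    error≡± : ∀ M → ι (suc n) · (α⁻¹ ^ K · digitSum α d (suc M) ⊕ ⊖ z) ≡± k (suc M) · remainder (α ^ K · z) d (suc M)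
    error≡± M = subst (ι (suc n) · E ≡±_) (sym (·-assoc (ι (suc n)) (β ^ K · ρ ^ suc M) R)) (≡±-· {x = ι (suc n)} (inj₁ refl) e)
      where
      R : ℤα
      R = remainder (α ^ K · z) d (suc M)
      E : ℤα
      E = α⁻¹ ^ K · digitSum α d (suc M) ⊕ ⊖ z
      e : E ≡± β ^ K · ρ ^ suc M · R
      e = subst₂ _≡±_ (cong (λ t → α⁻¹ ^ K · digitSum α d t ⊕ ⊖ z) (ℕP.+-identityʳ (suc M)))
                      (cong (β ^ K · ρ ^ suc M ·_) (⊕-identityʳ R)) (partial-sum-error z d K (suc M) 0)

  private
    bounded-away⇒¬Converges : ∀ z d K T δ (v : ℕ → ℤα) → 𝟘 < δ → (∀ L → δ < v L) →
      (∀ L → α⁻¹ ^ K · digitSum α d (T ℕ.+ L) ⊕ ⊖ z ≡± β ^ K · ρ ^ T · v L) → ¬ Converges z d K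
    bounded-away⇒¬Converges z d K T δ v 0<δ δ<v error≡± conv = refute (archimedean-0< (0<· (0<β^·ρ^ K T) 0<δ))
      where
      c : ℤα
      c = β ^ K · ρ ^ T
      refute : (Σ ℕ λ n → 𝟙 ≤ ι (suc n) · (c · δ)) → ⊥
      refute (n , 1≤ncδ) = refute-at (conv n)
        where
        refute-at : Eventually (λ M → AbsLtInv a (α⁻¹ ^ K · digitSum α d (suc M) ⊕ ⊖ z) n) → ⊥
        refute-at (N , close) = <-asym small large
          where
          E : ℤα
          E = α⁻¹ ^ K · digitSum α d (suc (T ℕ.+ N)) ⊕ ⊖ z
          E≡± : ι (suc n) · E ≡± ι (suc n) · (c · v (suc N))
          E≡± = ≡±-· {x = ι (suc n)} (inj₁ refl)
                  (subst (λ t → α⁻¹ ^ K · digitSum α d t ⊕ ⊖ z ≡± c · v (suc N)) (ℕP.+-suc T N) (error≡± (suc N)))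
          small : ι (suc n) · (c · v (suc N)) < 𝟙
          small = proj₁ (AbsLt-≡± E≡± (AbsLtInv⇒AbsLt E n (close (T ℕ.+ N) (ℕP.m≤n+m N T))))
          large : 𝟙 < ι (suc n) · (c · v (suc N))
          large = ≤-<-trans 1≤ncδ (·-monoʳ-< {ι (suc n)} {c · δ} {c · v (suc N)} (<-≤-trans 0<𝟙 (1≤ι n))
                                     (·-monoʳ-< {c} {δ} {v (suc N)} (0<β^·ρ^ K T) (δ<v (suc N))))

  converges⇒bounded : ∀ z d K → Bounded d → Admissible d → Converges z d K →
    ∀ T → (⊖ 𝟙 ≤ remainder (α ^ K · z) d T) × (remainder (α ^ K · z) d T ≤ β)
  converges⇒bounded z d K bd ad conv T =
    ≮⇒≥ (λ R<-1 → bounded-away⇒¬Converges z d K T (⊖ 𝟙 ⊕ ⊖ R) (λ L → W L ⊕ ⊖ R) (0<difference R<-1)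
                     (λ L → +-monoˡ-< (⊖ R) (proj₁ (W-bounds L))) (λ L → ≡±-flip (β ^ K · ρ ^ T) (W L) (partial-sum-error z d K T L)) conv) ,
    ≮⇒≥ (λ β<R → bounded-away⇒¬Converges z d K T (R ⊕ ⊖ β) (λ L → R ⊕ ⊖ W L) (0<difference β<R)
                     (λ L → +-monoʳ-< R (⊖-mono-< (proj₁ (proj₂ (W-bounds L))))) (partial-sum-error z d K T) conv)
    where
    R : ℤα
    R = remainder (α ^ K · z) d T
    W : ℕ → ℤα
    W L = horner α (shift T d) L
    W-bounds : ∀ L → (⊖ 𝟙 < W L) × (W L < β) × (shift T d 0 ≢ a → W L < β ⊕ ⊖ 𝟙)
    W-bounds = horner-bounds (Bounded-shift T bd) (Admissible-shift T ad)
    0<difference : ∀ {x y} → x < y → 𝟘 < y ⊕ ⊖ x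
    0<difference (mk< p) = Positive⇒0< p
    ≡±-flip : ∀ {x} c w → x ≡± c · (R ⊕ ⊖ w) → x ≡± c · (w ⊕ ⊖ R)
    ≡±-flip c w (inj₁ refl) = inj₂ (solve 3 (λ c r w → c :* (r :- w) := :- (c :* (w :- r))) refl c R w)
    ≡±-flip c w (inj₂ refl) = inj₁ (solve 3 (λ c r w → :- (c :* (r :- w)) := c :* (w :- r)) refl c R w)

module Construction (a : ℕ) (1≤a : 1 ℕ.≤ a) where
  open Ring a
  open Order a 1≤a
  open DigitSums a 1≤a
  open Remainders a 1≤a
  open ℤα-Solver using (solve; _:=_; _:+_; _:-_; _:*_; :-_; con)

  isZero : ℕ → Bool
  isZero zero = true
  isZero (suc _) = false

  -- After a nonzero digit the next (more significant) digit must stay below a.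
  maxDigit : Bool → ℕ
  maxDigit true = a
  maxDigit false = a ℕ.∸ 1

  maxDigit≤a : ∀ b → maxDigit b ℕ.≤ a
  maxDigit≤a true = ℕP.≤-refl
  maxDigit≤a false = ℕP.m∸n≤m a 1

  record State : Set where
    constructor state
    field
      rem : ℤα
      lastZero : Bool
      -1≤rem : ⊖ 𝟙 ≤ rem
      rem≤ceiling : rem ≤ ι (maxDigit lastZero) ⊕ ρ
  open State public

  infix 4 _-1+ρ≤_
  _-1+ρ≤_ : ℕ → ℤα → Set
  zero -1+ρ≤ r = ⊤
  suc j -1+ρ≤ r = ι j ⊕ ρ ≤ r

  _-1+ρ≤?_ : ∀ k r → Dec (k -1+ρ≤ r)
  zero -1+ρ≤? r = yes tt
  suc j -1+ρ≤? r = ι j ⊕ ρ ≤? r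

  record Valid (s : State) (k : ℕ) : Set where
    field
      k≤max : k ℕ.≤ maxDigit (lastZero s)
      rem≤k+ρ : rem s ≤ ι k ⊕ ρ
      k-1+ρ≤rem : k -1+ρ≤ rem s
  open Valid public

  private
    ·α⁻¹-anti-≤ : ∀ {x y} → x ≤ y → y · α⁻¹ ≤ x · α⁻¹
    ·α⁻¹-anti-≤ {x} {y} x≤y = subst₂ _≤_ (eq y) (eq x) (⊖-mono-≤ (·-monoʳ-≤ (inj₁ 0<β) x≤y))
      where
      eq : ∀ x → ⊖ (β · x) ≡ x · α⁻¹
      eq x = solve 2 (λ b x → :- (b :* x) := x :* (:- b)) refl β x

    ρ·α⁻¹ : ρ · α⁻¹ ≡ ⊖ 𝟙
    ρ·α⁻¹ = trans (solve 2 (λ b r → r :* (:- b) := :- (b :* r)) refl β ρ) (cong ⊖_ β·ρ)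

    ⊖𝟙·α⁻¹ : ⊖ 𝟙 · α⁻¹ ≡ β
    ⊖𝟙·α⁻¹ = solve 1 (λ b → (:- con 𝟙) :* (:- b) := b) refl β

    ⊖𝟙⊕ρ·α⁻¹ : (⊖ 𝟙 ⊕ ρ) · α⁻¹ ≡ β ⊕ ⊖ 𝟙
    ⊖𝟙⊕ρ·α⁻¹ = trans (·-distribʳ-⊕ α⁻¹ (⊖ 𝟙) ρ) (cong₂ _⊕_ ⊖𝟙·α⁻¹ ρ·α⁻¹)

  next : (s : State) (k : ℕ) → Valid s k → State
  next s k v = state ((rem s ⊕ ⊖ ι k) · α⁻¹) (isZero k) lower (upper k refl)
    where
    y : ℤα
    y = rem s ⊕ ⊖ ι k
    y≤ρ : y ≤ ρ
    y≤ρ = subst (y ≤_) (solve 2 (λ x r → x :+ r :- x := r) refl (ι k) ρ) (+-monoˡ-≤ (⊖ ι k) (rem≤k+ρ v))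
    lower : ⊖ 𝟙 ≤ y · α⁻¹
    lower = subst (_≤ y · α⁻¹) ρ·α⁻¹ (·α⁻¹-anti-≤ y≤ρ)
    upper : ∀ k′ → k′ ≡ k → y · α⁻¹ ≤ ι (maxDigit (isZero k′)) ⊕ ρ
    upper zero refl = subst₂ _≤_ (cong (_· α⁻¹) (sym (⊕-identityʳ (rem s)))) (trans ⊖𝟙·α⁻¹ β≡a⊕ρ) (·α⁻¹-anti-≤ (-1≤rem s))
    upper (suc j) refl = subst (y · α⁻¹ ≤_) (trans ⊖𝟙⊕ρ·α⁻¹ β⊖𝟙≡a∸1⊕ρ) (·α⁻¹-anti-≤ -1+ρ≤y)
      where
      -1+ρ≤y : ⊖ 𝟙 ⊕ ρ ≤ y
      -1+ρ≤y = subst₂ _≤_ (eq (ι j) ρ) (cong (λ t → rem s ⊕ ⊖ t) (sym (ι-suc j))) (+-monoˡ-≤ (⊖ (ι j ⊕ 𝟙)) (k-1+ρ≤rem v))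
        where
        eq : ∀ x r → x ⊕ r ⊕ ⊖ (x ⊕ 𝟙) ≡ ⊖ 𝟙 ⊕ r
        eq = solve 2 (λ x r → x :+ r :- (x :+ con 𝟙) := :- con 𝟙 :+ r) refl

  Rule : Set
  Rule = (s : State) → Σ ℕ (Valid s)

  states : Rule → State → ℕ → State
  states rule s₀ zero = s₀
  states rule s₀ (suc t) = next (states rule s₀ t) (proj₁ (rule (states rule s₀ t))) (proj₂ (rule (states rule s₀ t)))

  digits : Rule → State → Dig
  digits rule s₀ t = proj₁ (rule (states rule s₀ t))

  digits-bounded : ∀ rule s₀ → Bounded (digits rule s₀)
  digits-bounded rule s₀ t = ℕP.≤-trans (k≤max (proj₂ (rule (states rule s₀ t)))) (maxDigit≤a (lastZero (states rule s₀ t)))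

  digits-admissible : ∀ rule s₀ → Admissible (digits rule s₀)
  digits-admissible rule s₀ t = after (digits rule s₀ t) (k≤max (proj₂ (rule (states rule s₀ (suc t)))))
    where
    after : ∀ k {k′} → k′ ℕ.≤ maxDigit (isZero k) → k′ ≡ a → k ≡ 0
    after zero _ _ = refl
    after (suc k) a≤a-1 refl = ⊥-elim (ℕP.<-irrefl refl (subst (ℕ._≤ a ℕ.∸ 1) (sym (ℕP.m+[n∸m]≡n 1≤a)) a≤a-1))

  remainder≡rem : ∀ rule s₀ → ∀ T → remainder (rem s₀) (digits rule s₀) T ≡ rem (states rule s₀ T)
  remainder≡rem rule s₀ zero = solve 1 (λ y → (y :- con 𝟘) :* con 𝟙 := y) refl (rem s₀)
  remainder≡rem rule s₀ (suc T) = trans (remainder-next (rem s₀) (digits rule s₀) T)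
                                        (cong (λ r → (r ⊕ ⊖ ι (digits rule s₀ T)) · α⁻¹) (remainder≡rem rule s₀ T))

  remainders-bounded : ∀ rule s₀ T → (⊖ 𝟙 ≤ remainder (rem s₀) (digits rule s₀) T) × (remainder (rem s₀) (digits rule s₀) T ≤ β)
  remainders-bounded rule s₀ T = subst (⊖ 𝟙 ≤_) (sym (remainder≡rem rule s₀ T)) (-1≤rem (states rule s₀ T)) ,
    subst (_≤ β) (sym (remainder≡rem rule s₀ T))
          (≤-trans (rem≤ceiling (states rule s₀ T)) (ι⊕ρ≤β (maxDigit≤a (lastZero (states rule s₀ T)))))

  lowestDigit : (s : State) → Σ ℕ λ k → Valid s k × (∀ j → j ℕ.< k → ¬ rem s ≤ ι j ⊕ ρ)
  lowestDigit s with least (λ j → rem s ≤? ι j ⊕ ρ) (maxDigit (lastZero s)) (rem≤ceiling s)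
  ... | (k , rem≤k+ρ , k≤max , below) = k , record { k≤max = k≤max ; rem≤k+ρ = rem≤k+ρ ; k-1+ρ≤rem = floor k below } , below
    where
    floor : ∀ k → (∀ j → j ℕ.< k → ¬ rem s ≤ ι j ⊕ ρ) → k -1+ρ≤ rem s
    floor zero _ = tt
    floor (suc j) below = <⇒≤ (≰⇒> (below j (ℕP.n<1+n j)))

  highestDigit : (s : State) → Σ ℕ λ k → Valid s k × (∀ j → k ℕ.< j → j ℕ.≤ maxDigit (lastZero s) → ¬ j -1+ρ≤ rem s)
  highestDigit s with greatest (λ j → j -1+ρ≤? rem s) (maxDigit (lastZero s)) tt
  ... | (k , k-1+ρ≤rem , k≤max , above) = k , record { k≤max = k≤max ; rem≤k+ρ = ceiling k≤max above ; k-1+ρ≤rem = k-1+ρ≤rem } , above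
    where
    ceiling : ∀ {k} → k ℕ.≤ maxDigit (lastZero s) → (∀ j → k ℕ.< j → j ℕ.≤ maxDigit (lastZero s) → ¬ j -1+ρ≤ rem s) →
              rem s ≤ ι k ⊕ ρ
    ceiling {k} k≤max above with ℕP.m≤n⇒m<n∨m≡n k≤max
    ... | inj₁ k<max = <⇒≤ (≰⇒> (above (suc k) (ℕP.n<1+n k) k<max))
    ... | inj₂ refl = rem≤ceiling s

  lowestRule highestRule : Rule
  lowestRule s = proj₁ (lowestDigit s) , proj₁ (proj₂ (lowestDigit s))
  highestRule s = proj₁ (highestDigit s) , proj₁ (proj₂ (highestDigit s))

  cyclic? : ∀ r → Dec (Cyclic r)
  cyclic? r with r ≟ ⊖ 𝟙 | r ≟ β
  ... | yes r≡-1 | _ = yes (inj₁ r≡-1)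
  ... | no _ | yes r≡β = yes (inj₂ r≡β)
  ... | no r≢-1 | no r≢β = no λ { (inj₁ r≡-1) → r≢-1 r≡-1 ; (inj₂ r≡β) → r≢β r≡β }

  private
    previous-rem : ∀ {x} k c → (x ⊕ ⊖ ι k) · α⁻¹ ≡ c → x ≡ ι k ⊕ α · c
    previous-rem {x} k c e = begin
      x                              ≡⟨ solve 3 (λ x c b → x := c :+ (x :- c) :* con 𝟙) refl x (ι k) α ⟩
      ι k ⊕ (x ⊕ ⊖ ι k) · 𝟙          ≡⟨ cong (λ t → ι k ⊕ (x ⊕ ⊖ ι k) · t) (sym α·α⁻¹) ⟩
      ι k ⊕ (x ⊕ ⊖ ι k) · (α · α⁻¹)  ≡⟨ solve 4 (λ x c b b′ → c :+ (x :- c) :* (b :* b′) := c :+ b :* ((x :- c) :* b′)) refl x (ι k) α α⁻¹ ⟩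
      ι k ⊕ α · ((x ⊕ ⊖ ι k) · α⁻¹)  ≡⟨ cong (λ t → ι k ⊕ α · t) e ⟩
      ι k ⊕ α · c                    ∎
      where open ≡-Reasoning

    isZero≡false : ∀ k → isZero k ≡ false → Σ ℕ λ j → k ≡ suc j
    isZero≡false (suc j) _ = j , refl

  module FromStart (y : ℤα) (-1<y : ⊖ 𝟙 < y) (y<1 : y < 𝟙) where

    start : State
    start = state y true (<⇒≤ -1<y) (<⇒≤ (<-trans y<1 (subst (𝟙 <_) β≡a⊕ρ 1<β)))

    L U : ℕ → State
    L = states lowestRule start
    U = states highestRule start

    dL dU : Dig
    dL = digits lowestRule start
    dU = digits highestRule start

    same-state : ∀ t → (∀ t′ → t′ ℕ.< t → dL t′ ≡ dU t′) → rem (L t) ≡ rem (U t) × lastZero (L t) ≡ lastZero (U t)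
    same-state zero _ = refl , refl
    same-state (suc t) agree =
      cong₂ (λ r k → (r ⊕ ⊖ ι k) · α⁻¹) (proj₁ previous) (agree t (ℕP.n<1+n t)) , cong isZero (agree t (ℕP.n<1+n t))
      where
      previous : rem (L t) ≡ rem (U t) × lastZero (L t) ≡ lastZero (U t)
      previous = same-state t (λ t′ t′<t → agree t′ (ℕP.<-trans t′<t (ℕP.n<1+n t)))

    agree-or-differ : ∀ n → (Σ ℕ λ t → t ℕ.< n × dL t ≢ dU t) ⊎ (∀ t → t ℕ.< n → dL t ≡ dU t)
    agree-or-differ zero = inj₂ (λ _ ())
    agree-or-differ (suc n) = extend (agree-or-differ n) (dL n ℕP.≟ dU n)
      where
      extend : (Σ ℕ λ t → t ℕ.< n × dL t ≢ dU t) ⊎ (∀ t → t ℕ.< n → dL t ≡ dU t) → Dec (dL n ≡ dU n) →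
               (Σ ℕ λ t → t ℕ.< suc n × dL t ≢ dU t) ⊎ (∀ t → t ℕ.< suc n → dL t ≡ dU t)
      extend (inj₁ (t , t<n , differ)) _ = inj₁ (t , ℕP.<-trans t<n (ℕP.n<1+n n) , differ)
      extend (inj₂ _) (no differ) = inj₁ (n , ℕP.n<1+n n , differ)
      extend (inj₂ agree) (yes same) = inj₂ λ t t<1+n → [ agree t , (λ { refl → same }) ]′ (ℕP.m≤n⇒m<n∨m≡n (ℕP.≤-pred t<1+n))

    -- A non-cyclic remainder of the lowest-digit sequence is followed by a cyclic one only if it equals k + ρ
    -- for the chosen digit k, and then the digit k + 1 is admissible as well.
    tie : ∀ t → Cyclic (rem (L (suc t))) → ¬ Cyclic (rem (L t)) →
          suc (dL t) ℕ.≤ maxDigit (lastZero (L t)) × suc (dL t) -1+ρ≤ rem (L t)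
    tie t (inj₂ next≡β) not-cyclic = ⊥-elim (after-β (dL t) refl)
      where
      s : State
      s = L t
      rem≡ : rem s ≡ ι (dL t) ⊕ ⊖ 𝟙
      rem≡ = trans (previous-rem (dL t) β next≡β) (cong (ι (dL t) ⊕_) α·β)
      after-β : ∀ k → dL t ≡ k → ⊥
      after-β zero e = not-cyclic (inj₁ (trans rem≡ (trans (cong (λ k → ι k ⊕ ⊖ 𝟙) e) (⊕-identityˡ (⊖ 𝟙)))))
      after-β (suc j) e = ≤⇒≯ (subst (ι j ⊕ ρ ≤_) rem≡j (subst (_-1+ρ≤ rem s) e (k-1+ρ≤rem (proj₂ (lowestRule s)))))
                              (subst (_< ι j ⊕ ρ) (⊕-identityʳ (ι j)) (+-monoʳ-< (ι j) 0<ρ))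
        where
        rem≡j : rem s ≡ ι j
        rem≡j = trans rem≡ (trans (cong (λ k → ι k ⊕ ⊖ 𝟙) e)
                  (trans (cong (_⊕ ⊖ 𝟙) (ι-suc j)) (solve 1 (λ x → x :+ con 𝟙 :- con 𝟙 := x) refl (ι j))))
    tie t (inj₁ next≡-1) not-cyclic = room (suc (dL t) ℕP.≤? maxDigit (lastZero s)) , inj₂ (sym rem≡)
      where
      s : State
      s = L t
      rem≡ : rem s ≡ ι (dL t) ⊕ ρ
      rem≡ = trans (previous-rem (dL t) (⊖ 𝟙) next≡-1) (cong (ι (dL t) ⊕_) α·⊖𝟙)
      at-max : ∀ t b → lastZero (L t) ≡ b → rem (L t) ≡ ι (maxDigit b) ⊕ ρ → ¬ Cyclic (rem (L t)) → ⊥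
      at-max t true _ e not-cyclic = not-cyclic (inj₂ (trans e (sym β≡a⊕ρ)))
      at-max zero false () _ _
      at-max (suc t′) false lz e _ = below-lowest (isZero≡false (dL t′) lz)
        where
        below-lowest : (Σ ℕ λ j → dL t′ ≡ suc j) → ⊥
        below-lowest (j , d≡1+j) = proj₂ (proj₂ (lowestDigit (L t′))) j (subst (j ℕ.<_) (sym d≡1+j) (ℕP.n<1+n j)) (inj₂ prev≡)
          where
          prev≡ : rem (L t′) ≡ ι j ⊕ ρ
          prev≡ = begin
            rem (L t′)                     ≡⟨ previous-rem (dL t′) (β ⊕ ⊖ 𝟙) (trans e (sym β⊖𝟙≡a∸1⊕ρ)) ⟩
            ι (dL t′) ⊕ α · (β ⊕ ⊖ 𝟙)      ≡⟨ cong₂ (λ k u → ι k ⊕ u) d≡1+j α·β⊖𝟙 ⟩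
            ι (suc j) ⊕ (⊖ 𝟙 ⊕ ρ)          ≡⟨ cong (_⊕ (⊖ 𝟙 ⊕ ρ)) (ι-suc j) ⟩
            ι j ⊕ 𝟙 ⊕ (⊖ 𝟙 ⊕ ρ)            ≡⟨ solve 2 (λ x r → x :+ con 𝟙 :+ (:- con 𝟙 :+ r) := x :+ r) refl (ι j) ρ ⟩
            ι j ⊕ ρ                        ∎
            where open ≡-Reasoning
      room : Dec (suc (dL t) ℕ.≤ maxDigit (lastZero s)) → suc (dL t) ℕ.≤ maxDigit (lastZero s)
      room (yes fits) = fits
      room (no too-big) = ⊥-elim (at-max t (lastZero s) refl
        (trans rem≡ (cong (λ k → ι k ⊕ ρ) (ℕP.≤-antisym (k≤max (proj₂ (lowestRule s))) (ℕP.≮⇒≥ too-big)))) not-cyclic)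

    differ-at : ∀ t → (∀ t′ → t′ ℕ.< t → dL t′ ≡ dU t′) →
                suc (dL t) ℕ.≤ maxDigit (lastZero (L t)) × suc (dL t) -1+ρ≤ rem (L t) → dL t ≢ dU t
    differ-at t agree (fits , floor) same = proj₂ (proj₂ (highestDigit (U t))) (suc (dL t)) dU<1+dL fits′ floor′
      where
      states-agree : rem (L t) ≡ rem (U t) × lastZero (L t) ≡ lastZero (U t)
      states-agree = same-state t agree
      dU<1+dL : dU t ℕ.< suc (dL t)
      dU<1+dL = subst (ℕ._< suc (dL t)) same (ℕP.n<1+n (dL t))
      fits′ : suc (dL t) ℕ.≤ maxDigit (lastZero (U t))
      fits′ = subst (λ b → suc (dL t) ℕ.≤ maxDigit b) (proj₂ states-agree) fits
      floor′ : suc (dL t) -1+ρ≤ rem (U t)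
      floor′ = subst (suc (dL t) -1+ρ≤_) (proj₁ states-agree) floor

    start-not-cyclic : ¬ Cyclic y
    start-not-cyclic (inj₁ y≡-1) = <-irrefl (subst (⊖ 𝟙 <_) y≡-1 -1<y)
    start-not-cyclic (inj₂ y≡β) = <-asym (subst (_< 𝟙) y≡β y<1) 1<β

    lowest≢highest : ∀ T → Cyclic (rem (L T)) → Σ ℕ λ t → dL t ≢ dU t
    lowest≢highest T cyc = from-first (least (λ t → cyclic? (rem (L t))) T cyc)
      where
      from-first : (Σ ℕ λ t → Cyclic (rem (L t)) × t ℕ.≤ T × (∀ t′ → t′ ℕ.< t → ¬ Cyclic (rem (L t′)))) →
                   Σ ℕ λ t → dL t ≢ dU t
      from-first (zero , cyc₀ , _) = ⊥-elim (start-not-cyclic cyc₀)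
      from-first (suc t , cyc₁ , _ , before) = from-prefix (agree-or-differ t)
        where
        from-prefix : (Σ ℕ λ t′ → t′ ℕ.< t × dL t′ ≢ dU t′) ⊎ (∀ t′ → t′ ℕ.< t → dL t′ ≡ dU t′) →
                      Σ ℕ λ t → dL t ≢ dU t
        from-prefix (inj₁ (t′ , _ , differ)) = t′ , differ
        from-prefix (inj₂ agree) = t , differ-at t agree (tie t cyc₁ (before t (ℕP.n<1+n t)))

module Indexing (a : ℕ) (1≤a : 1 ℕ.≤ a) where
  open Ring a
  open Order a 1≤a
  open DigitSums a 1≤a
  open Remainders a 1≤a
  open Convergence a 1≤a
  open ℤα-Solver using (solve; _:=_; _:+_; _:-_; _:*_; :-_; con)

  toDig : Digits → ℕ → Dig
  toDig e K t = e (+ t - + K)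

  digitAt : Dig → ℤ → ℕ
  digitAt d (+ t) = d t
  digitAt d -[1+ _ ] = 0

  fromDig : Dig → ℕ → Digits
  fromDig d K i = digitAt d (i + + K)

  ZeroBelow : Digits → ℕ → Set
  ZeroBelow e K = ∀ i → i ℤ.< - (+ K) → e i ≡ 0

  private
    α⁻¹^·α^ : ∀ t → α⁻¹ ^ t · α ^ t ≡ 𝟙
    α⁻¹^·α^ t = trans (·-comm (α⁻¹ ^ t) (α ^ t)) (α^·α⁻¹^ t)

  αpow-difference : ∀ j K → αpow a (+ j - + K) ≡ α⁻¹ ^ K · α ^ j
  αpow-difference j K with ℕP.≤-total K j
  ... | inj₁ K≤j = subst (λ j → αpow a (+ j - + K) ≡ α⁻¹ ^ K · α ^ j) (ℕP.m+[n∸m]≡n K≤j) (nonnegative (j ℕ.∸ K))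
    where
    open ≡-Reasoning
    nonnegative : ∀ m → αpow a (+ (K ℕ.+ m) - + K) ≡ α⁻¹ ^ K · α ^ (K ℕ.+ m)
    nonnegative m = begin
      αpow a (+ (K ℕ.+ m) - + K)       ≡⟨ cong (αpow a) (trans (cong (_- + K) (ℤP.pos-+ K m)) (eq (+ K) (+ m))) ⟩
      α ^ m                            ≡⟨ sym (·-identityˡ (α ^ m)) ⟩
      𝟙 · α ^ m                        ≡⟨ cong (_· α ^ m) (sym (α⁻¹^·α^ K)) ⟩
      α⁻¹ ^ K · α ^ K · α ^ m          ≡⟨ ·-assoc (α⁻¹ ^ K) (α ^ K) (α ^ m) ⟩
      α⁻¹ ^ K · (α ^ K · α ^ m)        ≡⟨ cong (α⁻¹ ^ K ·_) (sym (^-distribˡ-+-· α K m)) ⟩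
      α⁻¹ ^ K · α ^ (K ℕ.+ m)          ∎
      where
      eq : ∀ k m → k + m - k ≡ m
      eq = solve-∀
  ... | inj₂ j≤K with ℕP.m≤n⇒m<n∨m≡n j≤K
  ...   | inj₂ refl = trans (cong (αpow a) (ℤP.+-inverseʳ (+ j))) (sym (α⁻¹^·α^ j))
  ...   | inj₁ j<K = subst (λ K → αpow a (+ j - + K) ≡ α⁻¹ ^ K · α ^ j)
                           (trans (ℕP.+-suc j (K ℕ.∸ suc j)) (ℕP.m+[n∸m]≡n j<K)) (negative (K ℕ.∸ suc j))
    where
    open ≡-Reasoning
    negative : ∀ m → αpow a (+ j - + (j ℕ.+ suc m)) ≡ α⁻¹ ^ (j ℕ.+ suc m) · α ^ j
    negative m = begin
      αpow a (+ j - + (j ℕ.+ suc m))        ≡⟨ cong (αpow a) (trans (cong (λ t → + j - t) (ℤP.pos-+ j (suc m))) (eq (+ j) (+ suc m))) ⟩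
      α⁻¹ ^ suc m                           ≡⟨ sym (·-identityʳ (α⁻¹ ^ suc m)) ⟩
      α⁻¹ ^ suc m · 𝟙                       ≡⟨ cong (α⁻¹ ^ suc m ·_) (sym (α⁻¹^·α^ j)) ⟩
      α⁻¹ ^ suc m · (α⁻¹ ^ j · α ^ j)       ≡⟨ solve 3 (λ x y z → x :* (y :* z) := y :* x :* z) refl (α⁻¹ ^ suc m) (α⁻¹ ^ j) (α ^ j) ⟩
      α⁻¹ ^ j · α⁻¹ ^ suc m · α ^ j         ≡⟨ cong (_· α ^ j) (sym (^-distribˡ-+-· α⁻¹ j (suc m))) ⟩
      α⁻¹ ^ (j ℕ.+ suc m) · α ^ j           ∎
      where
      eq : ∀ j m → j - (j + m) ≡ - m
      eq = solve-∀

  partialSum≡ : ∀ e K M → partialSum a e K M ≡ α⁻¹ ^ K · digitSum α (toDig e K) (suc M)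
  partialSum≡ e K zero = begin
    ι (e (- + K)) · αpow a (- + K)                    ≡⟨ cong₂ (λ i j → ι (e i) · αpow a j) (sym (ℤP.+-identityˡ (- + K))) (sym (ℤP.+-identityˡ (- + K))) ⟩
    ι (toDig e K 0) · αpow a (+ 0 - + K)              ≡⟨ cong (ι (toDig e K 0) ·_) (αpow-difference 0 K) ⟩
    ι (toDig e K 0) · (α⁻¹ ^ K · 𝟙)                   ≡⟨ solve 2 (λ c k → c :* (k :* con 𝟙) := k :* (con 𝟘 :+ c :* con 𝟙)) refl (ι (toDig e K 0)) (α⁻¹ ^ K) ⟩
    α⁻¹ ^ K · digitSum α (toDig e K) 1                ∎
    where open ≡-Reasoning
  partialSum≡ e K (suc M) = begin
    partialSum a e K M ⊕ ι c · αpow a (+ suc M - + K)            ≡⟨ cong₂ (λ u v → u ⊕ ι c · v) (partialSum≡ e K M) (αpow-difference (suc M) K) ⟩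
    α⁻¹ ^ K · U ⊕ ι c · (α⁻¹ ^ K · α ^ suc M)                    ≡⟨ solve 4 (λ k u c p → k :* u :+ c :* (k :* p) := k :* (u :+ c :* p)) refl (α⁻¹ ^ K) U (ι c) (α ^ suc M) ⟩
    α⁻¹ ^ K · (U ⊕ ι c · α ^ suc M)                              ∎
    where
    open ≡-Reasoning
    c : ℕ
    c = toDig e K (suc M)
    U : ℤα
    U = digitSum α (toDig e K) (suc M)

  record Expansion (z : ℤα) (e : Digits) (K : ℕ) : Set where
    field
      zero-below : ZeroBelow e K
      bounded : Bounded (toDig e K)
      admissible : Admissible (toDig e K)
      converges : Converges z (toDig e K) K

  private
    toDig-shift : ∀ e k j t → shift j (toDig e (k ℕ.+ j)) t ≡ toDig e k t
    toDig-shift e k j t = cong e (trans (cong₂ _-_ (ℤP.pos-+ j t) (ℤP.pos-+ k j)) (eq (+ k) (+ j) (+ t)))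
      where
      eq : ∀ k j t → (j + t) - (k + j) ≡ t - k
      eq = solve-∀

    below-shift : ∀ t j k → t ℕ.< j → + t - + (k ℕ.+ j) ℤ.< - (+ k)
    below-shift t j k t<j = subst₂ ℤ._<_ (sym (trans (cong (λ x → + t - x) (ℤP.pos-+ k j)) (eq (+ t) (+ k) (+ j))))
                              (ℤP.+-identityˡ (- + k)) (ℤP.+-monoˡ-< (- + k) t-j<0)
      where
      eq : ∀ t k j → t - (k + j) ≡ (t - j) + (- k)
      eq = solve-∀
      t-j<0 : + t - + j ℤ.< + 0
      t-j<0 = subst (+ t - + j ℤ.<_) (ℤP.+-inverseʳ (+ j)) (ℤP.+-monoˡ-< (- + j) (+<+ t<j))

  digitSum-lift : ∀ e k j → ZeroBelow e k → ∀ L →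
                  α⁻¹ ^ (k ℕ.+ j) · digitSum α (toDig e (k ℕ.+ j)) (j ℕ.+ L) ≡ α⁻¹ ^ k · digitSum α (toDig e k) L
  digitSum-lift e k j zb L = begin
    α⁻¹ ^ (k ℕ.+ j) · digitSum α d (j ℕ.+ L)                           ≡⟨ cong₂ _·_ (^-distribˡ-+-· α⁻¹ k j) (digitSum-split α d j L) ⟩
    α⁻¹ ^ k · α⁻¹ ^ j · (digitSum α d j ⊕ α ^ j · digitSum α (shift j d) L)
                                                                       ≡⟨ cong₂ (λ u w → α⁻¹ ^ k · α⁻¹ ^ j · (u ⊕ α ^ j · w))
                                                                            (digitSum-zeros α d j (λ t t<j → zb _ (below-shift t j k t<j)))
                                                                            (digitSum-cong α (toDig-shift e k j) L) ⟩
    α⁻¹ ^ k · α⁻¹ ^ j · (𝟘 ⊕ α ^ j · U)                                ≡⟨ solve 4 (λ x y p w → x :* y :* (con 𝟘 :+ p :* w) := x :* ((y :* p) :* w))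
                                                                            refl (α⁻¹ ^ k) (α⁻¹ ^ j) (α ^ j) U ⟩
    α⁻¹ ^ k · ((α⁻¹ ^ j · α ^ j) · U)                                  ≡⟨ cong (λ t → α⁻¹ ^ k · (t · U)) (α⁻¹^·α^ j) ⟩
    α⁻¹ ^ k · (𝟙 · U)                                                  ≡⟨ cong (α⁻¹ ^ k ·_) (·-identityˡ U) ⟩
    α⁻¹ ^ k · U                                                        ∎
    where
    open ≡-Reasoning
    d : Dig
    d = toDig e (k ℕ.+ j)
    U : ℤα
    U = digitSum α (toDig e k) L

  Converges-lift : ∀ z e k j → ZeroBelow e k → Converges z (toDig e k) k → Converges z (toDig e (k ℕ.+ j)) (k ℕ.+ j)
  Converges-lift z e k j zb conv n = lift (conv n)
    where
    lift : Eventually (λ M → AbsLtInv a (α⁻¹ ^ k · digitSum α (toDig e k) (suc M) ⊕ ⊖ z) n) →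
           Eventually (λ M → AbsLtInv a (α⁻¹ ^ (k ℕ.+ j) · digitSum α (toDig e (k ℕ.+ j)) (suc M) ⊕ ⊖ z) n)
    lift (N , close) = N ℕ.+ j , λ M N+j≤M → subst (λ w → AbsLtInv a (w ⊕ ⊖ z) n) (sym (same M N+j≤M))
                                                 (close (M ℕ.∸ j) (N≤M-j M N+j≤M))
      where
      N≤M-j : ∀ M → N ℕ.+ j ℕ.≤ M → N ℕ.≤ M ℕ.∸ j
      N≤M-j M h = subst (ℕ._≤ M ℕ.∸ j) (ℕP.m+n∸n≡m N j) (ℕP.∸-monoˡ-≤ j h)
      same : ∀ M → N ℕ.+ j ℕ.≤ M →
             α⁻¹ ^ (k ℕ.+ j) · digitSum α (toDig e (k ℕ.+ j)) (suc M) ≡ α⁻¹ ^ k · digitSum α (toDig e k) (suc (M ℕ.∸ j))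
      same M h = trans (cong (λ t → α⁻¹ ^ (k ℕ.+ j) · digitSum α (toDig e (k ℕ.+ j)) t) M+1≡)
                       (digitSum-lift e k j zb (suc (M ℕ.∸ j)))
        where
        M+1≡ : suc M ≡ j ℕ.+ suc (M ℕ.∸ j)
        M+1≡ = trans (cong suc (sym (ℕP.m+[n∸m]≡n (ℕP.≤-trans (ℕP.m≤n+m j N) h)))) (sym (ℕP.+-suc j (M ℕ.∸ j)))

  WeaklyAdmissible⇒Admissible : ∀ e K → WeaklyAdmissible a e → Admissible (toDig e K)
  WeaklyAdmissible⇒Admissible e K wa t d′≡a with wa (+ suc t - + K)
  ... | inj₁ d′<a = ⊥-elim (ℕP.<-irrefl d′≡a d′<a)
  ... | inj₂ (_ , d<1) = ℕP.n<1⇒n≡0 (subst (λ i → e i ℕ.< 1) (eq (+ t) (+ K)) d<1)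
    where
    eq : ∀ t k → (+ 1 + t) - k - + 1 ≡ t - k
    eq = solve-∀

  IsAlphaExpansion⇒Expansion : ∀ {z e} → IsAlphaExpansion a e z → Σ ℕ λ k → ∀ j → Expansion z e (k ℕ.+ j)
  IsAlphaExpansion⇒Expansion {z} {e} ((k , zb , close) , digits≤a , wa) = k , λ j → record
    { zero-below = λ i i<-k-j → zb i (ℤP.<-≤-trans i<-k-j (ℤP.neg-mono-≤ (+≤+ (ℕP.m≤m+n k j))))
    ; bounded = λ t → digits≤a _
    ; admissible = WeaklyAdmissible⇒Admissible e (k ℕ.+ j) wa
    ; converges = Converges-lift z e k j zb converges
    }
    where
    converges : Converges z (toDig e k) k
    converges n = proj₁ (close n) , λ M N≤M → subst (λ w → AbsLtInv a (w ⊕ ⊖ z) n) (partialSum≡ e k M) (proj₂ (close n) M N≤M)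

  toDig-fromDig : ∀ d K t → toDig (fromDig d K) K t ≡ d t
  toDig-fromDig d K t = cong (digitAt d) (eq (+ t) (+ K))
    where
    eq : ∀ t k → t - k + k ≡ t
    eq = solve-∀

  fromDig-zero-below : ∀ d K → ZeroBelow (fromDig d K) K
  fromDig-zero-below d K i i<-K = negative (i + + K) (subst (i + + K ℤ.<_) (ℤP.+-inverseˡ (+ K)) (ℤP.+-monoˡ-< (+ K) i<-K))
    where
    negative : ∀ x → x ℤ.< + 0 → digitAt d x ≡ 0
    negative -[1+ _ ] _ = refl
    negative (+ _) (+<+ ())

  fromDig-IsAlphaExpansion : ∀ z d K → Bounded d → Admissible d → Converges z d K → IsAlphaExpansion a (fromDig d K) z
  fromDig-IsAlphaExpansion z d K bd ad conv = (K , fromDig-zero-below d K , close) , digits≤a , weakly-admissible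
    where
    partialSum≡′ : ∀ M → partialSum a (fromDig d K) K M ≡ α⁻¹ ^ K · digitSum α d (suc M)
    partialSum≡′ M = trans (partialSum≡ (fromDig d K) K M) (cong (α⁻¹ ^ K ·_) (digitSum-cong α (toDig-fromDig d K) (suc M)))
    close : ∀ n → Σ ℕ λ N → ∀ M → N ℕ.≤ M → AbsLtInv a (partialSum a (fromDig d K) K M ⊕ ⊖ z) n
    close n = proj₁ (conv n) , λ M N≤M → subst (λ w → AbsLtInv a (w ⊕ ⊖ z) n) (sym (partialSum≡′ M)) (proj₂ (conv n) M N≤M)
    digits≤a : DigitsIn a (fromDig d K)
    digits≤a i = bounded (i + + K)
      where
      bounded : ∀ x → digitAt d x ℕ.≤ a
      bounded (+ t) = bd t
      bounded -[1+ _ ] = ℕ.z≤n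
    weakly-admissible : WeaklyAdmissible a (fromDig d K)
    weakly-admissible j = subst (λ x → digitAt d (j + + K) ℕ.< a ⊎ (digitAt d (j + + K) ≡ a × digitAt d x ℕ.< 1))
                                (sym (eq j (+ K))) (at (j + + K))
      where
      eq : ∀ j k → j - + 1 + k ≡ j + k - + 1
      eq = solve-∀
      at : ∀ x → digitAt d x ℕ.< a ⊎ (digitAt d x ≡ a × digitAt d (x - + 1) ℕ.< 1)
      at -[1+ _ ] = inj₁ 1≤a
      at (+ t) with d t ℕP.≟ a
      ... | no d≢a = inj₁ (ℕP.≤∧≢⇒< (bd t) d≢a)
      at (+ zero) | yes d≡a = inj₂ (d≡a , ℕ.s≤s ℕ.z≤n)
      at (+ suc t) | yes d≡a = inj₂ (d≡a , subst (ℕ._< 1) (sym (ad t d≡a)) (ℕ.s≤s ℕ.z≤n))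

  toDig-injective : ∀ {e e′} K → ZeroBelow e K → ZeroBelow e′ K → (∀ t → toDig e K t ≡ toDig e′ K t) → ∀ i → e i ≡ e′ i
  toDig-injective {e} {e′} K zb zb′ same i = at (i + + K) refl
    where
    at : ∀ x → i + + K ≡ x → e i ≡ e′ i
    at (+ t) i+K≡t = subst (λ j → e j ≡ e′ j) (trans (cong (_- + K) (sym i+K≡t)) (eq i (+ K))) (same t)
      where
      eq : ∀ i k → i + k - k ≡ i
      eq = solve-∀
    at -[1+ n ] i+K≡x = trans (zb i i<-K) (sym (zb′ i i<-K))
      where
      eq : ∀ i k → i + k + - k ≡ i
      eq = solve-∀
      i<-K : i ℤ.< - + K
      i<-K = subst₂ ℤ._<_ (eq i (+ K)) (ℤP.+-identityˡ (- + K)) (ℤP.+-monoˡ-< (- + K) (subst (ℤ._< + 0) (sym i+K≡x) -<+))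

  private
    position : ∀ K T₀ i → + T₀ - + K ℤ.≤ i → Σ ℕ λ t → i + + K ≡ + t × T₀ ℕ.≤ t
    position K T₀ i T₀-K≤i = natural (i + + K) refl (subst (ℤ._≤ i + + K) (eq (+ T₀) (+ K)) (ℤP.+-monoˡ-≤ (+ K) T₀-K≤i))
      where
      eq : ∀ t k → t - k + k ≡ t
      eq = solve-∀
      natural : ∀ x → i + + K ≡ x → + T₀ ℤ.≤ x → Σ ℕ λ t → i + + K ≡ + t × T₀ ℕ.≤ t
      natural (+ t) e (+≤+ T₀≤t) = t , e , T₀≤t

    fromDig-at : ∀ d K i t s → i + + K ≡ + t → fromDig d K (i + + s) ≡ d (s ℕ.+ t)
    fromDig-at d K i t s i+K≡t = cong (digitAt d) (trans (eq i (+ s) (+ K)) (trans (cong (_+_ (+ s)) i+K≡t) (sym (ℤP.pos-+ s t))))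
      where
      eq : ∀ i s k → i + s + k ≡ s + (i + k)
      eq = solve-∀

  alternating⇒periodic : ∀ d K T₀ → (∀ T → T₀ ℕ.≤ T → A0Pair (d T) (d (suc T))) → EventuallyPeriodic (fromDig d K) × LeftPeriodA0 a (fromDig d K)
  alternating⇒periodic d K T₀ alt = (2 , ℕ.s≤s ℕ.z≤n , + T₀ - + K , period-2) , (+ T₀ - + K , alternates)
    where
    a≢0 : a ≢ 0
    a≢0 a≡0 = ℕP.<-irrefl (sym a≡0) 1≤a
    fromDig-at₀ : ∀ i t → i + + K ≡ + t → fromDig d K i ≡ d t
    fromDig-at₀ i t i+K≡t = trans (cong (fromDig d K) (sym (ℤP.+-identityʳ i))) (fromDig-at d K i t 0 i+K≡t)
    alternates : ∀ i → + T₀ - + K ℤ.≤ i → A0Pair (fromDig d K i) (fromDig d K (i + + 1))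
    alternates i T₀-K≤i = at (position K T₀ i T₀-K≤i)
      where
      at : (Σ ℕ λ t → i + + K ≡ + t × T₀ ℕ.≤ t) → A0Pair (fromDig d K i) (fromDig d K (i + + 1))
      at (t , i+K≡t , T₀≤t) = subst₂ A0Pair
                                (sym (fromDig-at₀ i t i+K≡t)) (sym (fromDig-at d K i t 1 i+K≡t)) (alt t T₀≤t)
    two-steps : ∀ {x₀ x₁ x₂} → A0Pair x₀ x₁ → A0Pair x₁ x₂ → x₂ ≡ x₀
    two-steps (inj₁ (x₀≡a , _)) (inj₂ (_ , x₂≡a)) = trans x₂≡a (sym x₀≡a)
    two-steps (inj₂ (x₀≡0 , _)) (inj₁ (_ , x₂≡0)) = trans x₂≡0 (sym x₀≡0)
    two-steps (inj₁ (_ , x₁≡0)) (inj₁ (x₁≡a , _)) = ⊥-elim (a≢0 (trans (sym x₁≡a) x₁≡0))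
    two-steps (inj₂ (_ , x₁≡a)) (inj₂ (x₁≡0 , _)) = ⊥-elim (a≢0 (trans (sym x₁≡a) x₁≡0))
    period-2 : ∀ i → + T₀ - + K ℤ.≤ i → fromDig d K (i + + 2) ≡ fromDig d K i
    period-2 i T₀-K≤i = at (position K T₀ i T₀-K≤i)
      where
      at : (Σ ℕ λ t → i + + K ≡ + t × T₀ ℕ.≤ t) → fromDig d K (i + + 2) ≡ fromDig d K i
      at (t , i+K≡t , T₀≤t) = trans (fromDig-at d K i t 2 i+K≡t)
        (trans (two-steps (alt t T₀≤t) (alt (suc t) (ℕP.m≤n⇒m≤1+n T₀≤t))) (sym (fromDig-at₀ i t i+K≡t)))

module Theorem (a : ℕ) (1≤a : 1 ℕ.≤ a) where
  open Ring a
  open Positivity a 1≤a using (Positive; Negβ⇒Positive⊖conj)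
  open Order a 1≤a
  open DigitSums a 1≤a
  open Remainders a 1≤a
  open Convergence a 1≤a
  open Construction a 1≤a
  open Indexing a 1≤a
  open ℤα-Solver using (solve; _:=_; _:+_; _:-_; _:*_; :-_; con)

  eventually-cyclic : ∀ y {d} → conj y < 𝟘 → Bounded d → Admissible d →
    (∀ T → (⊖ 𝟙 ≤ remainder y d T) × (remainder y d T ≤ β)) → Eventually (λ T → Cyclic (remainder y d T))
  eventually-cyclic y {d} conj-y<0 bd ad bounds = cyclic (conj-remainder-eventually y conj-y<0 bd ad)
    where
    cyclic : Eventually (λ T → (⊖ 𝟙 ⊕ ⊖ ρ < conj (remainder y d T)) × (conj (remainder y d T) < 𝟘)) →
             Eventually (λ T → Cyclic (remainder y d T))
    cyclic (T₀ , window) = T₀ , λ T T₀≤T →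
      window-points (remainder y d T) (proj₁ (bounds T)) (proj₂ (bounds T)) (proj₁ (window T T₀≤T)) (proj₂ (window T T₀≤T))

  shift-into-unit-interval : ∀ z → Σ ℕ λ K → (⊖ 𝟙 < α ^ K · z) × (α ^ K · z < 𝟙)
  shift-into-unit-interval z = shifted (ρ^-eventually-small (ι (N₊ ℕ.+ N₋)))
    where
    N₊ : ℕ
    N₊ = proj₁ (archimedean z)
    N₋ : ℕ
    N₋ = proj₁ (archimedean (⊖ z))
    c : ℤα
    c = ι (N₊ ℕ.+ N₋)
    ±z<c : AbsLt z c
    ±z<c = <-≤-trans (proj₂ (archimedean z)) (ι-mono-≤ (ℕP.m≤m+n N₊ N₋)) ,
           <-≤-trans (proj₂ (archimedean (⊖ z))) (ι-mono-≤ (ℕP.m≤n+m N₋ N₊))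
    shifted : Eventually (λ T → c · ρ ^ T < ρ) → Σ ℕ λ K → (⊖ 𝟙 < α ^ K · z) × (α ^ K · z < 𝟙)
    shifted (K , small) = K , subst (⊖ 𝟙 <_) (solve 1 (λ x → :- (:- x) := x) refl (α ^ K · z)) (⊖-mono-< (proj₂ bound))
                          , proj₁ bound
      where
      ρ^K·c<1 : ρ ^ K · c < 𝟙
      ρ^K·c<1 = <-trans (subst (_< ρ) (·-comm c (ρ ^ K)) (small K ℕP.≤-refl)) ρ<1
      bound : AbsLt (α ^ K · z) 𝟙
      bound = AbsLt-≡± (≡±-sym (≡±-· {x = α ^ K} (⊖^≡± ρ K) (inj₁ refl)))
        (<-trans (·-monoʳ-< (0<ρ^ K) (proj₁ ±z<c)) ρ^K·c<1 ,
         subst (_< 𝟙) (solve 2 (λ r z → r :* (:- z) := :- (r :* z)) refl (ρ ^ K) z) (<-trans (·-monoʳ-< (0<ρ^ K) (proj₂ ±z<c)) ρ^K·c<1))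

  conj-α^· : ∀ K z → conj (α ^ K · z) ≡ β ^ K · conj z
  conj-α^· K z = trans (conj-· (α ^ K) z) (cong (_· conj z) (trans (conj-^ α K) (cong (_^ K) conj-α)))

  conj-α^·<0 : ∀ K {z} → conj z < 𝟘 → conj (α ^ K · z) < 𝟘
  conj-α^·<0 K {z} conj-z<0 = subst₂ _<_ (sym (conj-α^· K z)) (solve 1 (λ x → x :* con 𝟘 := con 𝟘) refl (β ^ K))
                                (·-monoʳ-< (<-≤-trans 0<𝟙 (1≤β^ K)) conj-z<0)

  Cyclic-third : ∀ {x y w} → Cyclic x → Cyclic y → Cyclic w → x ≢ y → w ≡ x ⊎ w ≡ y
  Cyclic-third (inj₁ x≡-1) (inj₁ y≡-1) _ x≢y = ⊥-elim (x≢y (trans x≡-1 (sym y≡-1)))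
  Cyclic-third (inj₂ x≡β) (inj₂ y≡β) _ x≢y = ⊥-elim (x≢y (trans x≡β (sym y≡β)))
  Cyclic-third (inj₁ x≡-1) (inj₂ _) (inj₁ w≡-1) _ = inj₁ (trans w≡-1 (sym x≡-1))
  Cyclic-third (inj₁ _) (inj₂ y≡β) (inj₂ w≡β) _ = inj₂ (trans w≡β (sym y≡β))
  Cyclic-third (inj₂ x≡β) (inj₁ _) (inj₂ w≡β) _ = inj₁ (trans w≡β (sym x≡β))
  Cyclic-third (inj₂ _) (inj₁ y≡-1) (inj₁ w≡-1) _ = inj₂ (trans w≡-1 (sym y≡-1))

  module _ (z : ℤα) (conj-z<0 : conj z < 𝟘) where

    Expansion-cycles : ∀ {e} K → Expansion z e K → Eventually (λ T → Cyclic (remainder (α ^ K · z) (toDig e K) T))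
    Expansion-cycles {e} K exp = eventually-cyclic (α ^ K · z) (conj-α^·<0 K conj-z<0) bounded admissible
                                   (converges⇒bounded z (toDig e K) K bounded admissible converges)
      where open Expansion exp

    Expansions-agree : ∀ {e e′} K → Expansion z e K → Expansion z e′ K → ∀ T →
      CyclicFrom (α ^ K · z) (toDig e K) T → CyclicFrom (α ^ K · z) (toDig e′ K) T →
      remainder (α ^ K · z) (toDig e K) T ≡ remainder (α ^ K · z) (toDig e′ K) T → ∀ i → e i ≡ e′ i
    Expansions-agree K exp exp′ T cyc cyc′ R≡R′ = toDig-injective K (zero-below exp) (zero-below exp′)
      (cyclic-expansions-unique (α ^ K · z) (bounded exp) (admissible exp) (bounded exp′) (admissible exp′) T cyc cyc′ R≡R′)
      where open Expansion

    module Shifted (K : ℕ) (-1<y : ⊖ 𝟙 < α ^ K · z) (y<1 : α ^ K · z < 𝟙) where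
      open FromStart (α ^ K · z) -1<y y<1

      module ByRule (rule : Rule) where
        d : Dig
        d = digits rule start
        bounds : ∀ T → (⊖ 𝟙 ≤ remainder (α ^ K · z) d T) × (remainder (α ^ K · z) d T ≤ β)
        bounds = remainders-bounded rule start
        cycles : Eventually (λ T → Cyclic (remainder (α ^ K · z) d T))
        cycles = eventually-cyclic (α ^ K · z) (conj-α^·<0 K conj-z<0) (digits-bounded rule start) (digits-admissible rule start) bounds
        e : Digits
        e = fromDig d K
        expansion : IsAlphaExpansion a e z
        expansion = fromDig-IsAlphaExpansion z d K (digits-bounded rule start) (digits-admissible rule start)
                      (bounded⇒converges z d K bounds)
        periodic : EventuallyPeriodic e × LeftPeriodA0 a e
        periodic = alternating⇒periodic d K (proj₁ cycles) (cyclic-digits-alternate (α ^ K · z) (proj₁ cycles) (proj₂ cycles))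
        level : ∀ k → Expansion z e (k ℕ.+ K)
        level k = subst (Expansion z e) (ℕP.+-comm K k) (proj₂ (IsAlphaExpansion⇒Expansion expansion) k)

      module Lowest = ByRule lowestRule
      module Highest = ByRule highestRule

      distinct : Σ ℤ λ i → Lowest.e i ≢ Highest.e i
      distinct = at (lowest≢highest (proj₁ Lowest.cycles) (subst Cyclic (remainder≡rem lowestRule start (proj₁ Lowest.cycles))
                                                                 (proj₂ Lowest.cycles (proj₁ Lowest.cycles) ℕP.≤-refl)))
        where
        at : (Σ ℕ λ t → dL t ≢ dU t) → Σ ℤ λ i → Lowest.e i ≢ Highest.e i
        at (t , differ) = + t - + K , λ same → differ (trans (sym (toDig-fromDig dL K t)) (trans same (toDig-fromDig dU K t)))

      unique : ∀ e → IsAlphaExpansion a e z → (∀ i → e i ≡ Lowest.e i) ⊎ (∀ i → e i ≡ Highest.e i)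
      unique e expansion = compare (IsAlphaExpansion⇒Expansion expansion)
        where
        compare : (Σ ℕ λ k → ∀ j → Expansion z e (k ℕ.+ j)) → (∀ i → e i ≡ Lowest.e i) ⊎ (∀ i → e i ≡ Highest.e i)
        compare (k , exp) = third (Eventually-× (Expansion-cycles K* (exp K)) (Eventually-× (Expansion-cycles K* exp₁) (Expansion-cycles K* exp₂)))
          where
          K* : ℕ
          K* = k ℕ.+ K
          exp₁ : Expansion z Lowest.e K*
          exp₁ = Lowest.level k
          exp₂ : Expansion z Highest.e K*
          exp₂ = Highest.level k
          R : Digits → ℕ → ℤα
          R e′ T = remainder (α ^ K* · z) (toDig e′ K*) T
          third : Eventually (λ T → Cyclic (R e T) × Cyclic (R Lowest.e T) × Cyclic (R Highest.e T)) →
                  (∀ i → e i ≡ Lowest.e i) ⊎ (∀ i → e i ≡ Highest.e i)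
          third (T , cyc) = pick (Cyclic-third (cyc₁ T ℕP.≤-refl) (cyc₂ T ℕP.≤-refl) (cyc₀ T ℕP.≤-refl) R₁≢R₂)
            where
            cyc₀ : CyclicFrom (α ^ K* · z) (toDig e K*) T
            cyc₀ T′ h = proj₁ (cyc T′ h)
            cyc₁ : CyclicFrom (α ^ K* · z) (toDig Lowest.e K*) T
            cyc₁ T′ h = proj₁ (proj₂ (cyc T′ h))
            cyc₂ : CyclicFrom (α ^ K* · z) (toDig Highest.e K*) T
            cyc₂ T′ h = proj₂ (proj₂ (cyc T′ h))
            R₁≢R₂ : R Lowest.e T ≢ R Highest.e T
            R₁≢R₂ R₁≡R₂ = proj₂ distinct (Expansions-agree K* exp₁ exp₂ T cyc₁ cyc₂ R₁≡R₂ (proj₁ distinct))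
            pick : R e T ≡ R Lowest.e T ⊎ R e T ≡ R Highest.e T → (∀ i → e i ≡ Lowest.e i) ⊎ (∀ i → e i ≡ Highest.e i)
            pick (inj₁ R≡R₁) = inj₁ (Expansions-agree K* (exp K) exp₁ T cyc₀ cyc₁ R≡R₁)
            pick (inj₂ R≡R₂) = inj₂ (Expansions-agree K* (exp K) exp₂ T cyc₀ cyc₂ R≡R₂)

  PeriodicExpansion : ℤα → Digits → Set
  PeriodicExpansion z e = IsAlphaExpansion a e z × EventuallyPeriodic e × LeftPeriodA0 a e

  two-periodic-expansions : ∀ z → conj z < 𝟘 → Σ Digits λ e₁ → Σ Digits λ e₂ →
    PeriodicExpansion z e₁ × PeriodicExpansion z e₂ × (Σ ℤ λ i → e₁ i ≢ e₂ i) ×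
    (∀ e → IsAlphaExpansion a e z → (∀ i → e i ≡ e₁ i) ⊎ (∀ i → e i ≡ e₂ i))
  two-periodic-expansions z conj-z<0 = from-shift (shift-into-unit-interval z)
    where
    from-shift : (Σ ℕ λ K → (⊖ 𝟙 < α ^ K · z) × (α ^ K · z < 𝟙)) → Σ Digits λ e₁ → Σ Digits λ e₂ →
      PeriodicExpansion z e₁ × PeriodicExpansion z e₂ × (Σ ℤ λ i → e₁ i ≢ e₂ i) ×
      (∀ e → IsAlphaExpansion a e z → (∀ i → e i ≡ e₁ i) ⊎ (∀ i → e i ≡ e₂ i))
    from-shift (K , -1<y , y<1) =
      Lowest.e , Highest.e , (Lowest.expansion , Lowest.periodic) , (Highest.expansion , Highest.periodic) , distinct , unique
      where open Shifted z conj-z<0 K -1<y y<1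

open import Data.Nat using (_≤_)

mainTheorem8 : (a : ℕ) → 1 ≤ a → (m n : ℤ) → Negβ a m n →
    Σ Digits λ e₁ → Σ Digits λ e₂ →
    (IsAlphaExpansion a e₁ ⟨ m , n ⟩ × EventuallyPeriodic e₁ × LeftPeriodA0 a e₁) ×
    (IsAlphaExpansion a e₂ ⟨ m , n ⟩ × EventuallyPeriodic e₂ × LeftPeriodA0 a e₂) ×
    (Σ ℤ λ i → e₁ i ≢ e₂ i) ×
    (∀ (e : Digits) → IsAlphaExpansion a e ⟨ m , n ⟩ → EventuallyPeriodic e →
    (∀ i → e i ≡ e₁ i) ⊎ (∀ i → e i ≡ e₂ i))
mainTheorem8 a 1≤a m n x<0 =
  let (e₁ , e₂ , periodic₁ , periodic₂ , differ , unique) =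
        two-periodic-expansions ⟨ m , n ⟩ (Positive⊖⇒<𝟘 (Negβ⇒Positive⊖conj m n x<0))
  -- every expansion of x′ turns out to be eventually periodic
  in e₁ , e₂ , periodic₁ , periodic₂ , differ , λ e expansion _ → unique e expansion
  where
  open Order a 1≤a using (Positive⊖⇒<𝟘)
  open Positivity a 1≤a using (Negβ⇒Positive⊖conj)
  open Theorem a 1≤a using (two-periodic-expansions)
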